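{- Let $m,n,a,b$ be positive integers and $q$ an indeterminate. Let $A,B$ be disjoint sets with $A\cup B=[a+b]$, $|A|=a$, $|B|=b$, and put $A'=[m]\cup(m+A)\cup(m+a+b+[n])$ and $B'=[m]\cup (m+B)\cup(m+a+b+[n])$. Then \begin{align*} &s_{\lambda(A')}(q,q^2,\dots, q^{m+n+a})\,s_{\lambda(B')}(q,q^2,\dots, q^{m+n+b}) \\ &=q^{abn+(a+b)\binom{n+1}{2}} \prod_{i=1}^{a+b}(q^i;q)_m (q^{a+b-i+1};q)_n \cdot \prod_{j=1}^{n} (q^{a+b+j};q)_m^2 \cdot \frac{\operatorname{H}_q(a)\operatorname{H}_q(b)\operatorname{H}_q(m)^2\operatorname{H}_q(n)^2}{\operatorname{H}_q(m+n+a)\operatorname{H}_q(m+n+b)} \cdot s_{\lambda(A)}(q,\dots, q^{a})\,s_{\lambda(B)}(q,\dots, q^{b}). \end{align*}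
   Context: $[N]=\{1,\dots,N\}$ and $k+S=\{k+s: s\in S\}$. For a finite set $X=\{x_1<\dots<x_k\}$ of positive integers, $\lambda(X)$ is the partition $(x_k-k,x_{k-1}-(k-1),\dots,x_1-1)$ (zero parts allowed); $s_\lambda$ is the Schur polynomial. $(x;q)_k=(1-x)(1-xq)\cdots(1-xq^{k-1})$ for $k\ge1$, $(x;q)_0=1$; $\operatorname{H}_q(N)=\prod_{k=1}^{N-1}(q;q)_k$ (empty product $=1$). -}

module Defs where

open import Data.Nat using (ℕ; zero; suc; _+_; _∸_)
open import Data.Bool using (Bool; true; false; if_then_else_)
open import Data.List using (List; []; _∷_; _++_; map; reverse; foldr; concatMap; upTo)
open import Data.Nat.ListAction using (sum)
open import Data.Vec using (Vec; []; _∷_)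
open import Algebra.Bundles using (CommutativeRing)

-- Finite sets of positive integers X ⊆ [N] are represented as
-- Data.Fin.Subset N  (= Vec Bool N; position i ↦ integer i+1).

elems : ∀ {N} → Vec Bool N → List ℕ
elems []            = []
elems (b ∷ s) = (if b then 1 ∷ [] else []) ++ map suc (elems s)

private
  subIdx : ℕ → List ℕ → List ℕ
  subIdx i []       = []
  subIdx i (x ∷ xs) = (x ∸ i) ∷ subIdx (suc i) xs

-- λ(X) = (x_k - k, x_{k-1} - (k-1), …, x₁ - 1), zero parts allowed
lam : ∀ {N} → Vec Bool N → List ℕ
lam X = reverse (subIdx 1 (elems X))

range : ℕ → ℕ → List ℕ
range lo hi = map (lo +_) (upTo (suc (hi ∸ lo)))

-- all μ = (μ₁,…,μ_k) with λ_{i+1} ≤ μ_i ≤ λ_i (λ_{k+1} := 0), i.e. λ/μ is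
-- a horizontal strip, for a weakly decreasing λ = (λ₁,…,λ_k)
strips : List ℕ → List (List ℕ)
strips []             = [] ∷ []
strips (l ∷ [])       = map (λ m → m ∷ []) (range 0 l)
strips (l ∷ l' ∷ ls)  =
  concatMap (λ m → map (m ∷_) (strips (l' ∷ ls))) (range l' l)

allZero : List ℕ → Bool
allZero []            = true
allZero (zero ∷ xs)   = allZero xs
allZero (suc _ ∷ xs)  = false

module _ {c ℓ} (R : CommutativeRing c ℓ) where
  open CommutativeRing R renaming (_+_ to _⊕_; _*_ to _⊛_)

  pow : Carrier → ℕ → Carrier
  pow x zero    = 1#
  pow x (suc n) = x ⊛ pow x n

  sumL : List Carrier → Carrier
  sumL = foldr _⊕_ 0#

  prodTo : ℕ → (ℕ → Carrier) → Carrier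
  prodTo zero    f = 1#
  prodTo (suc n) f = prodTo n f ⊛ f (suc n)

  qPoch : Carrier → Carrier → ℕ → Carrier
  qPoch x q zero    = 1#
  qPoch x q (suc k) = qPoch x q k ⊛ (1# - x ⊛ pow q k)

  Hq : Carrier → ℕ → Carrier
  Hq q N = prodTo (N ∸ 1) (λ k → qPoch q q k)

  -- Schur polynomial s_λ(x₁,…,x_N) (x i = x_i), defined combinatorially as
  -- the sum over semistandard Young tableaux of shape λ with entries in [N]
  -- of x^T, organised by the cells containing the largest entry N (a
  -- horizontal strip λ/μ):  s_λ(x₁..x_N) = Σ_μ x_N^{|λ|-|μ|} s_μ(x₁..x_{N-1}),
  -- and s_λ() = 1 if λ = 0, else 0.
  schur : List ℕ → ℕ → (ℕ → Carrier) → Carrier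
  schur lam zero    x = if allZero lam then 1# else 0#
  schur lam (suc N) x =
    sumL (map (λ μ → pow (x (suc N)) (sum lam ∸ sum μ) ⊛ schur μ N x) (strips lam))

-- Everything rests on the principal specialisation of a Schur polynomial: for a
-- set X with N elements and λ = λ(X),
--   H_q(N) s_λ(q, …, q^N) = q^(Σ_i i λ_i) ∏_{x < y in X} (1 − q^(y − x)).
-- It follows from the bialternant formula V(x) s_λ(x) = det (x_r^(λ_c + N − 1 − c)),
-- proved by induction from the branching rule, and the Vandermonde determinant.
-- For A′ the pairs of elements are then grouped by the blocks [m], m + A and
-- m + a + b + [n]: pairs within the outer blocks give H_q(m) H_q(n), pairs of an
-- element m + i (i ∈ A) with the outer blocks give (q^i;q)_m (q^(a+b−i+1);q)_n,
-- and pairs across the outer blocks give ∏_j (q^(a+b+j);q)_m. As A and B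
-- partition [a + b], the factors for i ∈ A and for i ∈ B together run over all
-- of [a + b], and the exponents add up because there are ab pairs (i, j) with
-- i ∈ A and j ∈ B.

{-# OPTIONS --safe #-}
module Submission where

open import Algebra.Bundles using (CommutativeRing)

-- Algebra.Solver.Ring for an arbitrary commutative ring, with integer coefficients so
-- that the normaliser can decide equality of coefficients.
module IntegerRingSolver {c ℓ} (R : CommutativeRing c ℓ) where

  open import Data.Nat as ℕ using (ℕ; zero; suc)
  open import Data.Nat.Properties using (+-suc)
  open import Data.Integer as ℤ using (ℤ; +_; -[1+_]; sign; ∣_∣; _◃_; _⊖_)
  open import Data.Integer.Properties using ([1+m]⊖[1+n]≡m⊖n)
  open import Data.Sign as Sign using (Sign)
  open import Data.Maybe using (Maybe; just; nothing)
  open import Relation.Nullary using (yes; no)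
  open import Relation.Binary.PropositionalEquality as ≡ using (_≡_)
  open import Algebra.Bundles using (RawRing)
  open import Algebra.Solver.Ring.AlmostCommutativeRing

  open CommutativeRing R
  open import Relation.Binary.Reasoning.Setoid setoid
  open import Algebra.Properties.Ring ring using (-‿distribˡ-*; -‿distribʳ-*; -‿involutive; -0#≈0#)
  open import Algebra.Properties.AbelianGroup +-abelianGroup using (⁻¹-∙-comm)
  open import Algebra.Properties.Semiring.Mult semiring using (_×_; ×-homo-+; ×1-homo-*)

  applySign : Sign → Carrier → Carrier
  applySign Sign.+ x = x
  applySign Sign.- x = - x

  fromℤ : ℤ → Carrier
  fromℤ (+ n)    = n × 1#
  fromℤ -[1+ n ] = - (suc n × 1#)

  applySign-cong : ∀ s {x y} → x ≈ y → applySign s x ≈ applySign s y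
  applySign-cong Sign.+ x≈y = x≈y
  applySign-cong Sign.- x≈y = -‿cong x≈y

  applySign-* : ∀ s t x y → applySign (s Sign.* t) (x * y) ≈ applySign s x * applySign t y
  applySign-* Sign.+ Sign.+ x y = refl
  applySign-* Sign.+ Sign.- x y = -‿distribʳ-* x y
  applySign-* Sign.- Sign.+ x y = -‿distribˡ-* x y
  applySign-* Sign.- Sign.- x y = begin
    x * y           ≈⟨ -‿involutive _ ⟨
    - - (x * y)     ≈⟨ -‿cong (-‿distribʳ-* x y) ⟩
    - (x * - y)     ≈⟨ -‿distribˡ-* x (- y) ⟩
    - x * - y       ∎

  fromℤ-◃ : ∀ s n → fromℤ (s ◃ n) ≈ applySign s (n × 1#)
  fromℤ-◃ Sign.+ zero    = refl
  fromℤ-◃ Sign.- zero    = sym -0#≈0#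
  fromℤ-◃ Sign.+ (suc n) = refl
  fromℤ-◃ Sign.- (suc n) = refl

  fromℤ-signAbs : ∀ i → fromℤ i ≡ applySign (sign i) (∣ i ∣ × 1#)
  fromℤ-signAbs (+ n)    = ≡.refl
  fromℤ-signAbs -[1+ n ] = ≡.refl

  fromℤ-⊖ : ∀ m n → fromℤ (m ⊖ n) ≈ m × 1# - n × 1#
  fromℤ-⊖ m       zero    = sym (trans (+-congˡ -0#≈0#) (+-identityʳ _))
  fromℤ-⊖ zero    (suc n) = sym (+-identityˡ _)
  fromℤ-⊖ (suc m) (suc n) = begin
    fromℤ (suc m ⊖ suc n)           ≡⟨ ≡.cong fromℤ ([1+m]⊖[1+n]≡m⊖n m n) ⟩
    fromℤ (m ⊖ n)                   ≈⟨ fromℤ-⊖ m n ⟩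
    u - v                           ≈⟨ +-identityˡ _ ⟨
    0# + (u - v)                    ≈⟨ +-congʳ (-‿inverseʳ 1#) ⟨
    (1# - 1#) + (u - v)             ≈⟨ +-assoc 1# (- 1#) _ ⟩
    1# + (- 1# + (u - v))           ≈⟨ +-congˡ (+-assoc (- 1#) u (- v)) ⟨
    1# + ((- 1# + u) - v)           ≈⟨ +-congˡ (+-congʳ (+-comm (- 1#) u)) ⟩
    1# + ((u - 1#) - v)             ≈⟨ +-congˡ (+-assoc u (- 1#) (- v)) ⟩
    1# + (u + (- 1# - v))           ≈⟨ +-assoc 1# u _ ⟨
    (1# + u) + (- 1# - v)           ≈⟨ +-congˡ (⁻¹-∙-comm 1# v) ⟩
    (1# + u) - (1# + v)             ∎
    where u = m × 1#; v = n × 1#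

  +-homo : ∀ i j → fromℤ (i ℤ.+ j) ≈ fromℤ i + fromℤ j
  +-homo (+ m)    (+ n)    = ×-homo-+ 1# m n
  +-homo (+ m)    -[1+ n ] = fromℤ-⊖ m (suc n)
  +-homo -[1+ m ] (+ n)    = trans (fromℤ-⊖ n (suc m)) (+-comm _ _)
  +-homo -[1+ m ] -[1+ n ] = begin
    - (suc (suc (m ℕ.+ n)) × 1#)          ≡⟨ ≡.cong (λ k → - (suc k × 1#)) (+-suc m n) ⟨
    - ((suc m ℕ.+ suc n) × 1#)            ≈⟨ -‿cong (×-homo-+ 1# (suc m) (suc n)) ⟩
    - (suc m × 1# + suc n × 1#)           ≈⟨ ⁻¹-∙-comm _ _ ⟨
    - (suc m × 1#) - (suc n × 1#)         ∎

  *-homo : ∀ i j → fromℤ (i ℤ.* j) ≈ fromℤ i * fromℤ j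
  *-homo i j = begin
    fromℤ (s ◃ ∣ i ∣ ℕ.* ∣ j ∣)                                  ≈⟨ fromℤ-◃ s (∣ i ∣ ℕ.* ∣ j ∣) ⟩
    applySign s ((∣ i ∣ ℕ.* ∣ j ∣) × 1#)                        ≈⟨ applySign-cong s (×1-homo-* ∣ i ∣ ∣ j ∣) ⟩
    applySign s ((∣ i ∣ × 1#) * (∣ j ∣ × 1#))                    ≈⟨ applySign-* (sign i) (sign j) _ _ ⟩
    applySign (sign i) (∣ i ∣ × 1#) * applySign (sign j) (∣ j ∣ × 1#) ≡⟨ ≡.cong₂ _*_ (fromℤ-signAbs i) (fromℤ-signAbs j) ⟨
    fromℤ i * fromℤ j                                           ∎
    where s = sign i Sign.* sign j

  -‿homo : ∀ i → fromℤ (ℤ.- i) ≈ - fromℤ i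
  -‿homo -[1+ n ]     = sym (-‿involutive _)
  -‿homo (+ zero)     = sym -0#≈0#
  -‿homo (+ (suc n))  = refl

  ℤ-rawRing : RawRing _ _
  ℤ-rawRing = record
    { Carrier = ℤ ; _≈_ = _≡_ ; _+_ = ℤ._+_ ; _*_ = ℤ._*_ ; -_ = ℤ.-_ ; 0# = + 0 ; 1# = + 1 }

  fromℤ-morphism : ℤ-rawRing -Raw-AlmostCommutative⟶ fromCommutativeRing R
  fromℤ-morphism = record
    { ⟦_⟧ = fromℤ ; +-homo = +-homo ; *-homo = *-homo ; -‿homo = -‿homo
    ; 0-homo = refl ; 1-homo = +-identityʳ 1# }

  fromℤ-≟ : ∀ i j → Maybe (fromℤ i ≈ fromℤ j)
  fromℤ-≟ i j with i ℤ.≟ j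
  ... | yes ≡.refl = just refl
  ... | no _       = nothing

  open import Algebra.Solver.Ring ℤ-rawRing (fromCommutativeRing R) fromℤ-morphism fromℤ-≟ public

module NaturalSums where

  open import Data.Nat using (ℕ; zero; suc; _+_; _*_; _<_)
  open import Data.Nat.Properties using (+-identityʳ; +-assoc; +-comm; m<n⇒m<1+n; n<1+n)
  open import Data.Nat.Tactic.RingSolver using (solve-∀)
  open import Relation.Binary.PropositionalEquality using (_≡_; refl; sym; trans; cong; cong₂)
  open import Function using (_∘_)

  sumBelowℕ : ℕ → (ℕ → ℕ) → ℕ
  sumBelowℕ zero    f = 0
  sumBelowℕ (suc n) f = sumBelowℕ n f + f n

  sumBelowℕ-unfoldˡ : ∀ n f → sumBelowℕ (suc n) f ≡ f 0 + sumBelowℕ n (f ∘ suc)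
  sumBelowℕ-unfoldˡ zero    f = sym (+-identityʳ (f 0))
  sumBelowℕ-unfoldˡ (suc n) f = trans (cong (_+ f (suc n)) (sumBelowℕ-unfoldˡ n f)) (+-assoc (f 0) _ _)

  sumBelowℕ-cong : ∀ n {f g : ℕ → ℕ} → (∀ s → s < n → f s ≡ g s) → sumBelowℕ n f ≡ sumBelowℕ n g
  sumBelowℕ-cong zero    f≡g = refl
  sumBelowℕ-cong (suc n) f≡g = cong₂ _+_ (sumBelowℕ-cong n (λ s s<n → f≡g s (m<n⇒m<1+n s<n))) (f≡g n (n<1+n n))

  sumBelowℕ-+ : ∀ n (f g : ℕ → ℕ) → sumBelowℕ n (λ s → f s + g s) ≡ sumBelowℕ n f + sumBelowℕ n g
  sumBelowℕ-+ zero    f g = refl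
  sumBelowℕ-+ (suc n) f g = trans (cong (_+ (f n + g n)) (sumBelowℕ-+ n f g)) (interchange (sumBelowℕ n f) (sumBelowℕ n g) (f n) (g n))
    where
    interchange : ∀ a b c d → a + b + (c + d) ≡ a + c + (b + d)
    interchange = solve-∀

  sumBelowℕ-const : ∀ n v → sumBelowℕ n (λ _ → v) ≡ n * v
  sumBelowℕ-const zero    v = refl
  sumBelowℕ-const (suc n) v = trans (cong (_+ v) (sumBelowℕ-const n v)) (+-comm (n * v) v)

  triangle : ℕ → ℕ
  triangle n = sumBelowℕ n suc

  tetrahedral : ℕ → ℕ
  tetrahedral n = sumBelowℕ n triangle

module Partitions where

  open import Data.Nat as ℕ using (ℕ; zero; suc; _+_; _*_; _<_; _≤_; _≥_; z≤n; s≤s; _∸_)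
  import Data.Nat.Properties as ℕ
  open import Data.Nat.ListAction using (sum)
  open import Data.Nat.ListAction.Properties using (sum-++)
  open import Data.Nat.Tactic.RingSolver using (solve-∀)
  open import Data.List as List using (List; []; _∷_; _++_; _∷ʳ_; [_]; map; concatMap; length)
  import Data.List.Properties as List
  open import Data.List.Membership.Propositional using (_∈_; find)
  open import Data.List.Membership.Propositional.Properties using (∈-map⁻; ∈-upTo⁻)
  open import Data.List.Relation.Unary.Any using (here; there)
  open import Data.List.Relation.Unary.Any.Properties using (concatMap⁻)
  open import Data.List.Relation.Unary.Linked using (Linked; []; [-]; _∷_)
  open import Data.List.Relation.Binary.Pointwise using (Pointwise; []; _∷_)
  open import Relation.Binary.PropositionalEquality as ≡ using (_≡_)
  open import Data.Empty using (⊥)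
  open import Data.Product using (_,_)
  open import Data.Sum using (inj₁; inj₂)
  open import Defs using (strips; allZero; range)
  open NaturalSums

  lookupOr : ∀ {a} {A : Set a} → A → List A → ℕ → A
  lookupOr d []       _       = d
  lookupOr d (x ∷ xs) zero    = x
  lookupOr d (x ∷ xs) (suc i) = lookupOr d xs i

  infixl 9 _!!_
  _!!_ : List ℕ → ℕ → ℕ
  _!!_ = lookupOr 0

  choices : List (List ℕ) → List (List ℕ)
  choices []       = [] ∷ []
  choices (C ∷ Cs) = concatMap (λ m → map (m ∷_) (choices Cs)) C

  interlacingRanges : List ℕ → List (List ℕ)
  interlacingRanges []            = []
  interlacingRanges (l ∷ [])      = range 0 l ∷ []
  interlacingRanges (l ∷ l' ∷ ls) = range l' l ∷ interlacingRanges (l' ∷ ls)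

  innerRanges : List ℕ → List (List ℕ)
  innerRanges []            = []
  innerRanges (l ∷ [])      = []
  innerRanges (l ∷ l' ∷ ls) = range l' l ∷ innerRanges (l' ∷ ls)

  lastPart : List ℕ → ℕ
  lastPart []            = 0
  lastPart (l ∷ [])      = l
  lastPart (l ∷ l' ∷ ls) = lastPart (l' ∷ ls)

  concatMap-[_] : ∀ {A B : Set} (f : A → B) xs → concatMap (λ x → [ f x ]) xs ≡ map f xs
  concatMap-[ f ] xs = ≡.trans (≡.sym (List.concatMap-map [_] f xs)) (List.concatMap-pure (map f xs))

  strips≡choices : ∀ ls → strips ls ≡ choices (interlacingRanges ls)
  strips≡choices []            = ≡.refl
  strips≡choices (l ∷ [])      = ≡.sym (concatMap-[ [_] ] (range 0 l))
  strips≡choices (l ∷ l' ∷ ls) =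
    ≡.cong (λ S → concatMap (λ m → map (m ∷_) S) (range l' l)) (strips≡choices (l' ∷ ls))

  interlacingRanges-∷ʳ : ∀ l ls → interlacingRanges (l ∷ ls) ≡ innerRanges (l ∷ ls) ∷ʳ range 0 (lastPart (l ∷ ls))
  interlacingRanges-∷ʳ l []        = ≡.refl
  interlacingRanges-∷ʳ l (l' ∷ ls) = ≡.cong (range l' l ∷_) (interlacingRanges-∷ʳ l' ls)

  length-innerRanges : ∀ l ls → length (innerRanges (l ∷ ls)) ≡ length ls
  length-innerRanges l []        = ≡.refl
  length-innerRanges l (l' ∷ ls) = ≡.cong suc (length-innerRanges l' ls)

  lookup-innerRanges : ∀ ls c → suc c < length ls → lookupOr [] (innerRanges ls) c ≡ range (ls !! suc c) (ls !! c)
  lookup-innerRanges (l ∷ [])      zero    (s≤s ())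
  lookup-innerRanges (l ∷ l' ∷ ls) zero    _        = ≡.refl
  lookup-innerRanges (l ∷ l' ∷ ls) (suc c) (s≤s lt) = lookup-innerRanges (l' ∷ ls) c lt

  lastPart≡!!length : ∀ l ls → lastPart (l ∷ ls) ≡ (l ∷ ls) !! length ls
  lastPart≡!!length l []        = ≡.refl
  lastPart≡!!length l (l' ∷ ls) = lastPart≡!!length l' ls

  ∈choices⇒Pointwise : ∀ Cs {ms} → ms ∈ choices Cs → Pointwise _∈_ ms Cs
  ∈choices⇒Pointwise []       (here ≡.refl) = []
  ∈choices⇒Pointwise []       (there ())
  ∈choices⇒Pointwise (C ∷ Cs) ms∈           with find (concatMap⁻ (λ m → map (m ∷_) (choices Cs)) {xs = C} ms∈)
  ... | m , m∈C , ms∈mCs with ∈-map⁻ (m ∷_) ms∈mCs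
  ...   | ms' , ms'∈ , ≡.refl = m∈C ∷ ∈choices⇒Pointwise Cs ms'∈

  ∈range⇒≥ : ∀ lo hi {t} → t ∈ range lo hi → lo ≤ t
  ∈range⇒≥ lo hi t∈ with ∈-map⁻ (lo +_) t∈
  ... | k , _ , ≡.refl = ℕ.m≤m+n lo k

  ∈range⇒≤ : ∀ lo hi {t} → lo ≤ hi → t ∈ range lo hi → t ≤ hi
  ∈range⇒≤ lo hi lo≤hi t∈ with ∈-map⁻ (lo +_) t∈
  ... | k , k∈ , ≡.refl =
    ≡.subst (lo + k ≤_) (ℕ.m+[n∸m]≡n lo≤hi) (ℕ.+-monoʳ-≤ lo (ℕ.≤-pred (∈-upTo⁻ k∈)))

  PositiveAt : ℕ → List ℕ → Set
  PositiveAt _       []       = ⊥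
  PositiveAt zero    (l ∷ _)  = 0 < l
  PositiveAt (suc n) (_ ∷ ls) = PositiveAt n ls

  PositiveAt-choice : ∀ n ls {ms} → PositiveAt (suc n) ls → Pointwise _∈_ ms (interlacingRanges ls) → PositiveAt n ms
  PositiveAt-choice n       []            () _
  PositiveAt-choice n       (l ∷ [])      () _
  PositiveAt-choice zero    (l ∷ l' ∷ ls) 0<l' (m∈ ∷ _)  = ℕ.<-≤-trans 0<l' (∈range⇒≥ l' l m∈)
  PositiveAt-choice (suc n) (l ∷ l' ∷ ls) pos  (_ ∷ ms∈) = PositiveAt-choice n (l' ∷ ls) pos ms∈

  PositiveAt-∷ʳ : ∀ ms t → 0 < t → PositiveAt (length ms) (ms ∷ʳ t)
  PositiveAt-∷ʳ []       t 0<t = 0<t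
  PositiveAt-∷ʳ (m ∷ ms) t 0<t = PositiveAt-∷ʳ ms t 0<t

  strips-∷ʳ0 : ∀ ls → strips (ls ∷ʳ 0) ≡ map (_∷ʳ 0) (strips ls)
  strips-∷ʳ0 []            = ≡.refl
  strips-∷ʳ0 (l ∷ [])      = ≡.trans (concatMap-[ (λ m → m ∷ 0 ∷ []) ] (range 0 l)) (List.map-∘ (range 0 l))
  strips-∷ʳ0 (l ∷ l' ∷ ls) = begin
    concatMap (λ m → map (m ∷_) (strips ((l' ∷ ls) ∷ʳ 0))) (range l' l)
      ≡⟨ ≡.cong (λ S → concatMap (λ m → map (m ∷_) S) (range l' l)) (strips-∷ʳ0 (l' ∷ ls)) ⟩
    concatMap (λ m → map (m ∷_) (map (_∷ʳ 0) S)) (range l' l)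
      ≡⟨ List.concatMap-cong (λ m → ≡.trans (≡.sym (List.map-∘ S)) (List.map-∘ S)) (range l' l) ⟩
    concatMap (λ m → map (_∷ʳ 0) (map (m ∷_) S)) (range l' l)
      ≡⟨ List.map-concatMap (_∷ʳ 0) (λ m → map (m ∷_) S) (range l' l) ⟨
    map (_∷ʳ 0) (strips (l ∷ l' ∷ ls)) ∎
    where
    open ≡.≡-Reasoning
    S = strips (l' ∷ ls)

  allZero-∷ʳ0 : ∀ ls → allZero (ls ∷ʳ 0) ≡ allZero ls
  allZero-∷ʳ0 []           = ≡.refl
  allZero-∷ʳ0 (zero ∷ ls)  = allZero-∷ʳ0 ls
  allZero-∷ʳ0 (suc l ∷ ls) = ≡.refl

  sum-∷ʳ0 : ∀ ls → sum (ls ∷ʳ 0) ≡ sum ls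
  sum-∷ʳ0 ls = ≡.trans (sum-++ ls [ 0 ]) (ℕ.+-identityʳ (sum ls))

  !!-suc-≤ : ∀ {ls} c → Linked _≥_ ls → suc c < length ls → ls !! suc c ≤ ls !! c
  !!-suc-≤ c       []          ()
  !!-suc-≤ zero    [-]         (s≤s ())
  !!-suc-≤ (suc c) [-]         (s≤s ())
  !!-suc-≤ zero    (l≥l' ∷ _)  _        = l≥l'
  !!-suc-≤ (suc c) (_ ∷ ls≥)   (s≤s lt) = !!-suc-≤ c ls≥ lt

  !!-antitone : ∀ {ls} → Linked _≥_ ls → ∀ {r s} → r ≤ s → s < length ls → ls !! s ≤ ls !! r
  !!-antitone ls≥ {s = zero}  z≤n    _ = ℕ.≤-refl
  !!-antitone ls≥ {s = suc s} r≤1+s 1+s<len with ℕ.m≤n⇒m<n∨m≡n r≤1+s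
  ... | inj₂ ≡.refl  = ℕ.≤-refl
  ... | inj₁ r<1+s = ℕ.≤-trans (!!-suc-≤ s ls≥ 1+s<len) (!!-antitone ls≥ (ℕ.≤-pred r<1+s) (ℕ.<-trans (ℕ.n<1+n s) 1+s<len))

  record Interlaces (l : ℕ) (ls ms : List ℕ) : Set where
    field
      length≡    : length ms ≡ length ls
      decreasing : Linked _≥_ ms
      ≤above     : ∀ c → c < length ls → ms !! c ≤ (l ∷ ls) !! c
      ≥below     : ∀ c → c < length ls → (l ∷ ls) !! suc c ≤ ms !! c

  choice⇒Interlaces : ∀ l ls {ms} → Linked _≥_ (l ∷ ls) → Pointwise _∈_ ms (innerRanges (l ∷ ls)) → Interlaces l ls ms
  choice⇒Interlaces l []        _            []          = record
    { length≡ = ≡.refl ; decreasing = [] ; ≤above = λ _ () ; ≥below = λ _ () }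
  choice⇒Interlaces l (l' ∷ ls) (l'≤l ∷ ls≥) (m∈ ∷ ms∈) = record
    { length≡    = ≡.cong suc length≡
    ; decreasing = cons decreasing (∈range⇒≥ l' l m∈) (λ 0<len → ≤above 0 (≡.subst (0 <_) length≡ 0<len))
    ; ≤above     = λ { zero _ → ∈range⇒≤ l' l l'≤l m∈ ; (suc c) (s≤s lt) → ≤above c lt }
    ; ≥below     = λ { zero _ → ∈range⇒≥ l' l m∈     ; (suc c) (s≤s lt) → ≥below c lt }
    }
    where
    open Interlaces (choice⇒Interlaces l' ls ls≥ ms∈)
    cons : ∀ {m ms} → Linked _≥_ ms → l' ≤ m → (0 < length ms → ms !! 0 ≤ l') → Linked _≥_ (m ∷ ms)
    cons {ms = []}     _   _     _    = [-]
    cons {ms = _ ∷ _}  ms≥ l'≤m first = ℕ.≤-trans (first (s≤s z≤n)) l'≤m ∷ ms≥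

  sum-interlacing : ∀ l ls ms → length ms ≡ length ls → (∀ c → c < length ls → ms !! c ≤ (l ∷ ls) !! c) →
    sum (l ∷ ls) ≡ lastPart (l ∷ ls) + sumBelowℕ (length ls) (λ c → (l ∷ ls) !! c ∸ ms !! c) + sum ms
  sum-interlacing l []        []       _   _     = ≡.sym (ℕ.+-identityʳ (l + 0))
  sum-interlacing l (l' ∷ ls) (m ∷ ms) len≡ ≤above = begin
    l + sum (l' ∷ ls)
      ≡⟨ ≡.cong (l +_) (sum-interlacing l' ls ms (ℕ.suc-injective len≡) (λ c lt → ≤above (suc c) (s≤s lt))) ⟩
    l + (A + S + B)                               ≡⟨ ≡.cong (_+ (A + S + B)) (ℕ.m∸n+n≡m (≤above 0 (s≤s z≤n))) ⟨
    (l ∸ m) + m + (A + S + B)                     ≡⟨ rearrange (l ∸ m) m A S B ⟩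
    A + ((l ∸ m) + S) + (m + B)
      ≡⟨ ≡.cong (λ z → A + z + (m + B)) (sumBelowℕ-unfoldˡ (length ls) (λ c → (l ∷ l' ∷ ls) !! c ∸ (m ∷ ms) !! c)) ⟨
    A + sumBelowℕ (suc (length ls)) (λ c → (l ∷ l' ∷ ls) !! c ∸ (m ∷ ms) !! c) + (m + B) ∎
    where
    open ≡.≡-Reasoning
    A = lastPart (l' ∷ ls)
    S = sumBelowℕ (length ls) (λ c → (l' ∷ ls) !! c ∸ ms !! c)
    B = sum ms
    rearrange : ∀ d m A S B → d + m + (A + S + B) ≡ A + (d + S) + (m + B)
    rearrange = solve-∀

  n∸c≡1+n∸[1+c] : ∀ n c → c < n → n ∸ c ≡ suc (n ∸ suc c)
  n∸c≡1+n∸[1+c] n c c<n = ℕ.+-∸-assoc 1 c<n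

  shiftedPart : ℕ → List ℕ → ℕ → ℕ
  shiftedPart N ls s = ls !! s + (N ∸ suc s)

  shiftedPart-antitone : ∀ N ls → length ls ≡ N → Linked _≥_ ls → ∀ r s → r < s → s < N →
    shiftedPart N ls s ≤ shiftedPart N ls r
  shiftedPart-antitone N ls len ls≥ r s r<s s<N =
    ℕ.+-mono-≤ (!!-antitone ls≥ (ℕ.<⇒≤ r<s) (≡.subst (s <_) (≡.sym len) s<N)) (ℕ.∸-monoʳ-≤ N (s≤s (ℕ.<⇒≤ r<s)))

  weightedSize : ℕ → List ℕ → ℕ
  weightedSize N ls = sumBelowℕ N (λ s → suc s * ls !! s)

  ∑[1+s]*[N∸[1+s]]≡tetrahedral : ∀ N → sumBelowℕ N (λ s → suc s * (N ∸ suc s)) ≡ tetrahedral N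
  ∑[1+s]*[N∸[1+s]]≡tetrahedral zero    = ≡.refl
  ∑[1+s]*[N∸[1+s]]≡tetrahedral (suc N) = begin
    sumBelowℕ N (λ s → suc s * (suc N ∸ suc s)) + suc N * (N ∸ N)
      ≡⟨ ≡.cong₂ _+_ (sumBelowℕ-cong N split) (≡.cong (suc N *_) (ℕ.n∸n≡0 N)) ⟩
    sumBelowℕ N (λ s → suc s + suc s * (N ∸ suc s)) + suc N * 0
      ≡⟨ ≡.cong₂ _+_ (sumBelowℕ-+ N suc _) (ℕ.*-zeroʳ (suc N)) ⟩
    triangle N + sumBelowℕ N (λ s → suc s * (N ∸ suc s)) + 0
      ≡⟨ ℕ.+-identityʳ _ ⟩
    triangle N + sumBelowℕ N (λ s → suc s * (N ∸ suc s))
      ≡⟨ ≡.cong (triangle N +_) (∑[1+s]*[N∸[1+s]]≡tetrahedral N) ⟩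
    triangle N + tetrahedral N
      ≡⟨ ℕ.+-comm (triangle N) (tetrahedral N) ⟩
    tetrahedral (suc N) ∎
    where
    open ≡.≡-Reasoning
    split : ∀ s → s < N → suc s * (suc N ∸ suc s) ≡ suc s + suc s * (N ∸ suc s)
    split s s<N = ≡.trans (≡.cong (suc s *_) (n∸c≡1+n∸[1+c] N s s<N)) (ℕ.*-suc (suc s) (N ∸ suc s))

  sum-shiftedPart : ∀ N ls →
    sumBelowℕ N (shiftedPart N ls) + sumBelowℕ N (λ s → s * shiftedPart N ls s) ≡ tetrahedral N + weightedSize N ls
  sum-shiftedPart N ls = begin
    sumBelowℕ N ℓ + sumBelowℕ N (λ s → s * ℓ s)         ≡⟨ sumBelowℕ-+ N ℓ _ ⟨
    sumBelowℕ N (λ s → suc s * ℓ s)                      ≡⟨ sumBelowℕ-cong N (λ s _ → ℕ.*-distribˡ-+ (suc s) (ls !! s) (N ∸ suc s)) ⟩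
    sumBelowℕ N (λ s → suc s * ls !! s + suc s * (N ∸ suc s)) ≡⟨ sumBelowℕ-+ N _ _ ⟩
    weightedSize N ls + sumBelowℕ N (λ s → suc s * (N ∸ suc s)) ≡⟨ ≡.cong (weightedSize N ls +_) (∑[1+s]*[N∸[1+s]]≡tetrahedral N) ⟩
    weightedSize N ls + tetrahedral N                     ≡⟨ ℕ.+-comm (weightedSize N ls) (tetrahedral N) ⟩
    tetrahedral N + weightedSize N ls                     ∎
    where
    open ≡.≡-Reasoning
    ℓ = shiftedPart N ls

  !!-++ˡ : ∀ ps qs c → c < length ps → (ps ++ qs) !! c ≡ ps !! c
  !!-++ˡ (p ∷ ps) qs zero    _        = ≡.refl
  !!-++ˡ (p ∷ ps) qs (suc c) (s≤s lt) = !!-++ˡ ps qs c lt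

  !!-++-length : ∀ ps μ qs → (ps ++ μ ∷ qs) !! length ps ≡ μ
  !!-++-length []       μ qs = ≡.refl
  !!-++-length (p ∷ ps) μ qs = !!-++-length ps μ qs

module BigOperators {c ℓ} (R : CommutativeRing c ℓ) where

  open import Data.Nat as ℕ using (ℕ; zero; suc; _<_)
  import Data.Nat.Properties as ℕ
  open import Data.List using (List; []; _∷_; _++_; [_]; map; concatMap; length; reverse; upTo; applyUpTo)
  import Data.List.Properties as List
  open import Data.List.Membership.Propositional using (_∈_)
  open import Data.List.Relation.Unary.Any using (here; there)
  open import Relation.Binary.PropositionalEquality as ≡ using (_≡_; _≢_; ≢-sym)
  open import Relation.Nullary using (yes; no)
  open import Function using (_∘_)

  open import Defs using (pow; sumL; prodTo)
  open NaturalSums using (sumBelowℕ)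
  open Partitions using (_!!_)
  open CommutativeRing R
  open import Relation.Binary.Reasoning.Setoid setoid
  open IntegerRingSolver R public using (solve; _:=_; _:+_; _:*_; _:-_; :-_; con)

  infixr 8 _^_
  _^_ : Carrier → ℕ → Carrier
  _^_ = pow R

  ^-congˡ : ∀ {x y} n → x ≈ y → x ^ n ≈ y ^ n
  ^-congˡ zero    x≈y = refl
  ^-congˡ (suc n) x≈y = *-cong x≈y (^-congˡ n x≈y)

  ^-homo-* : ∀ x m n → x ^ (m ℕ.+ n) ≈ x ^ m * x ^ n
  ^-homo-* x zero    n = sym (*-identityˡ _)
  ^-homo-* x (suc m) n = trans (*-congˡ (^-homo-* x m n)) (sym (*-assoc _ _ _))

  ^-assocʳ : ∀ x m n → (x ^ m) ^ n ≈ x ^ (m ℕ.* n)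
  ^-assocʳ x m zero    = reflexive (≡.cong (x ^_) (≡.sym (ℕ.*-zeroʳ m)))
  ^-assocʳ x m (suc n) = begin
    x ^ m * (x ^ m) ^ n      ≈⟨ *-congˡ (^-assocʳ x m n) ⟩
    x ^ m * x ^ (m ℕ.* n)    ≈⟨ ^-homo-* x m (m ℕ.* n) ⟨
    x ^ (m ℕ.+ m ℕ.* n)      ≡⟨ ≡.cong (x ^_) (ℕ.*-suc m n) ⟨
    x ^ (m ℕ.* suc n)        ∎

  ε : ℕ → Carrier
  ε zero    = 1#
  ε (suc k) = - ε k

  ε-+ : ∀ m n → ε (m ℕ.+ n) ≈ ε m * ε n
  ε-+ zero    n = sym (*-identityˡ _)
  ε-+ (suc m) n = trans (-‿cong (ε-+ m n)) (solve 2 (λ a b → :- (a :* b) := (:- a) :* b) refl (ε m) (ε n))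

  ε-square : ∀ n → ε n * ε n ≈ 1#
  ε-square zero    = *-identityˡ _
  ε-square (suc n) = trans (solve 1 (λ a → (:- a) :* (:- a) := a :* a) refl (ε n)) (ε-square n)

  ε-double : ∀ n → ε (n ℕ.+ n) ≈ 1#
  ε-double n = trans (ε-+ n n) (ε-square n)

  sumBelow : ℕ → (ℕ → Carrier) → Carrier
  sumBelow zero    f = 0#
  sumBelow (suc n) f = sumBelow n f + f n

  prodBelow : ℕ → (ℕ → Carrier) → Carrier
  prodBelow zero    f = 1#
  prodBelow (suc n) f = prodBelow n f * f n

  sumBelow-cong : ∀ n {f g} → (∀ j → j < n → f j ≈ g j) → sumBelow n f ≈ sumBelow n g
  sumBelow-cong zero    f≈g = refl
  sumBelow-cong (suc n) f≈g =
    +-cong (sumBelow-cong n (λ j j<n → f≈g j (ℕ.m<n⇒m<1+n j<n))) (f≈g n (ℕ.n<1+n n))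

  prodBelow-cong : ∀ n {f g} → (∀ j → j < n → f j ≈ g j) → prodBelow n f ≈ prodBelow n g
  prodBelow-cong zero    f≈g = refl
  prodBelow-cong (suc n) f≈g =
    *-cong (prodBelow-cong n (λ j j<n → f≈g j (ℕ.m<n⇒m<1+n j<n))) (f≈g n (ℕ.n<1+n n))

  sumBelow-+ : ∀ n f g → sumBelow n (λ j → f j + g j) ≈ sumBelow n f + sumBelow n g
  sumBelow-+ zero    f g = sym (+-identityˡ _)
  sumBelow-+ (suc n) f g = trans (+-congʳ (sumBelow-+ n f g))
    (solve 4 (λ a b c d → (a :+ b) :+ (c :+ d) := (a :+ c) :+ (b :+ d)) refl (sumBelow n f) (sumBelow n g) (f n) (g n))

  *-distribˡ-sumBelow : ∀ n a f → a * sumBelow n f ≈ sumBelow n (λ j → a * f j)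
  *-distribˡ-sumBelow zero    a f = zeroʳ a
  *-distribˡ-sumBelow (suc n) a f = trans (distribˡ _ _ _) (+-congʳ (*-distribˡ-sumBelow n a f))

  sumBelow-zero : ∀ n f → (∀ j → j < n → f j ≈ 0#) → sumBelow n f ≈ 0#
  sumBelow-zero n f f≈0 = trans (sumBelow-cong n f≈0) (sum-0s n)
    where
    sum-0s : ∀ n → sumBelow n (λ _ → 0#) ≈ 0#
    sum-0s zero    = refl
    sum-0s (suc n) = trans (+-identityʳ _) (sum-0s n)

  sumBelow-swap : ∀ n m (f : ℕ → ℕ → Carrier) →
    sumBelow n (λ i → sumBelow m (f i)) ≈ sumBelow m (λ j → sumBelow n (λ i → f i j))
  sumBelow-swap zero    m f = sym (sumBelow-zero m _ (λ _ _ → refl))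
  sumBelow-swap (suc n) m f = begin
    sumBelow n (λ i → sumBelow m (f i)) + sumBelow m (f n)    ≈⟨ +-congʳ (sumBelow-swap n m f) ⟩
    sumBelow m (λ j → sumBelow n (λ i → f i j)) + sumBelow m (f n) ≈⟨ sumBelow-+ m _ _ ⟨
    sumBelow m (λ j → sumBelow n (λ i → f i j) + f n j)         ∎

  sumBelow-unfoldˡ : ∀ n f → sumBelow (suc n) f ≈ f 0 + sumBelow n (f ∘ suc)
  sumBelow-unfoldˡ zero    f = trans (+-identityˡ _) (sym (+-identityʳ _))
  sumBelow-unfoldˡ (suc n) f = trans (+-congʳ (sumBelow-unfoldˡ n f)) (+-assoc _ _ _)

  prodBelow-unfoldˡ : ∀ n f → prodBelow (suc n) f ≈ f 0 * prodBelow n (f ∘ suc)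
  prodBelow-unfoldˡ zero    f = trans (*-identityˡ _) (sym (*-identityʳ _))
  prodBelow-unfoldˡ (suc n) f = trans (*-congʳ (prodBelow-unfoldˡ n f)) (*-assoc _ _ _)

  prodBelow-* : ∀ n f g → prodBelow n (λ j → f j * g j) ≈ prodBelow n f * prodBelow n g
  prodBelow-* zero    f g = sym (*-identityˡ _)
  prodBelow-* (suc n) f g = trans (*-congʳ (prodBelow-* n f g))
    (solve 4 (λ a b c d → (a :* b) :* (c :* d) := (a :* c) :* (b :* d)) refl (prodBelow n f) (prodBelow n g) (f n) (g n))
  prodBelow-^ : ∀ n x f → prodBelow n (λ j → x ^ f j) ≈ x ^ sumBelowℕ n f
  prodBelow-^ zero    x f = refl
  prodBelow-^ (suc n) x f = trans (*-congʳ (prodBelow-^ n x f)) (sym (^-homo-* x (sumBelowℕ n f) (f n)))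

  sumBelow-single : ∀ n k f → k < n → (∀ j → j < n → j ≢ k → f j ≈ 0#) → sumBelow n f ≈ f k
  sumBelow-single (suc n) k f k<1+n others with k ℕ.≟ n
  ... | yes ≡.refl = trans (+-congʳ (sumBelow-zero n f (λ j j<n → others j (ℕ.m<n⇒m<1+n j<n) (ℕ.<⇒≢ j<n))))
                           (+-identityˡ _)
  ... | no k≢n = trans (+-cong (sumBelow-single n k f k<n (λ j j<n → others j (ℕ.m<n⇒m<1+n j<n)))
                               (others n (ℕ.n<1+n n) (≢-sym k≢n)))
                       (+-identityʳ _)
    where k<n = ℕ.≤∧≢⇒< (ℕ.≤-pred k<1+n) k≢n

  sumBelow-cancellingPair : ∀ n k f → suc k < n →
    (∀ j → j < n → j ≢ k → j ≢ suc k → f j ≈ 0#) → f k + f (suc k) ≈ 0# → sumBelow n f ≈ 0#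
  sumBelow-cancellingPair (suc n) k f 1+k<1+n others pair with suc k ℕ.≟ n
  ... | yes ≡.refl = begin
    sumBelow k f + f k + f (suc k)        ≈⟨ +-assoc _ _ _ ⟩
    sumBelow k f + (f k + f (suc k))      ≈⟨ +-cong (sumBelow-zero k f below) pair ⟩
    0# + 0#                               ≈⟨ +-identityˡ _ ⟩
    0#                                    ∎
    where
    below : ∀ j → j < k → f j ≈ 0#
    below j j<k = others j (ℕ.<-trans j<k (ℕ.<-trans (ℕ.n<1+n k) (ℕ.n<1+n (suc k))))
                           (ℕ.<⇒≢ j<k) (ℕ.<⇒≢ (ℕ.m<n⇒m<1+n j<k))
  ... | no 1+k≢n = trans (+-cong (sumBelow-cancellingPair n k f 1+k<n (λ j j<n → others j (ℕ.m<n⇒m<1+n j<n)) pair)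
                                 (others n (ℕ.n<1+n n) (ℕ.>⇒≢ (ℕ.<-trans (ℕ.n<1+n k) 1+k<n)) (ℕ.>⇒≢ 1+k<n)))
                         (+-identityʳ _)
    where 1+k<n = ℕ.≤∧≢⇒< (ℕ.≤-pred 1+k<1+n) 1+k≢n

  sumL-map-cong : ∀ {a} {A : Set a} (xs : List A) {f g : A → Carrier} →
    (∀ x → x ∈ xs → f x ≈ g x) → sumL R (map f xs) ≈ sumL R (map g xs)
  sumL-map-cong []       f≈g = refl
  sumL-map-cong (x ∷ xs) f≈g = +-cong (f≈g x (here ≡.refl)) (sumL-map-cong xs (λ y y∈xs → f≈g y (there y∈xs)))

  sumL-++ : ∀ xs ys → sumL R (xs ++ ys) ≈ sumL R xs + sumL R ys
  sumL-++ []       ys = sym (+-identityˡ _)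
  sumL-++ (x ∷ xs) ys = trans (+-congˡ (sumL-++ xs ys)) (sym (+-assoc _ _ _))

  sumL-map-∘ : ∀ {a b} {A : Set a} {B : Set b} (xs : List A) (g : A → B) (f : B → Carrier) →
    sumL R (map f (map g xs)) ≡ sumL R (map (f ∘ g) xs)
  sumL-map-∘ xs g f = ≡.cong (sumL R) (≡.sym (List.map-∘ xs))

  sumL-concatMap : ∀ {a b} {A : Set a} {B : Set b} (xs : List A) (g : A → List B) (f : B → Carrier) →
    sumL R (map f (concatMap g xs)) ≈ sumL R (map (λ x → sumL R (map f (g x))) xs)
  sumL-concatMap []       g f = refl
  sumL-concatMap (x ∷ xs) g f = begin
    sumL R (map f (g x ++ concatMap g xs))                ≡⟨ ≡.cong (sumL R) (List.map-++ f (g x) (concatMap g xs)) ⟩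
    sumL R (map f (g x) ++ map f (concatMap g xs))        ≈⟨ sumL-++ (map f (g x)) _ ⟩
    sumL R (map f (g x)) + sumL R (map f (concatMap g xs)) ≈⟨ +-congˡ (sumL-concatMap xs g f) ⟩
    _                                                     ∎

  *-distribˡ-sumL : ∀ {a} {A : Set a} (xs : List A) y (f : A → Carrier) →
    y * sumL R (map f xs) ≈ sumL R (map (λ x → y * f x) xs)
  *-distribˡ-sumL []       y f = zeroʳ y
  *-distribˡ-sumL (x ∷ xs) y f = trans (distribˡ _ _ _) (+-congˡ (*-distribˡ-sumL xs y f))

  sumL-applyUpTo : ∀ n (g : ℕ → ℕ) (f : ℕ → Carrier) → sumL R (map f (applyUpTo g n)) ≈ sumBelow n (f ∘ g)
  sumL-applyUpTo zero    g f = refl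
  sumL-applyUpTo (suc n) g f = trans (+-congˡ (sumL-applyUpTo n (g ∘ suc) f)) (sym (sumBelow-unfoldˡ n (f ∘ g)))

  sumL-upTo : ∀ n (f : ℕ → Carrier) → sumL R (map f (upTo n)) ≈ sumBelow n f
  sumL-upTo n f = sumL-applyUpTo n (λ x → x) f

  x-xy≈x[1-y] : ∀ x y → x - x * y ≈ x * (1# - y)
  x-xy≈x[1-y] x y = trans (+-congʳ (sym (*-identityʳ x))) (solve 3 (λ x y o → x :* o :- x :* y := x :* (o :- y)) refl x y 1#)

  prodOver : ∀ {a} {A : Set a} → List A → (A → Carrier) → Carrier
  prodOver []       f = 1#
  prodOver (x ∷ xs) f = f x * prodOver xs f

  prodOver-cong : ∀ {a} {A : Set a} (xs : List A) {f g : A → Carrier} → (∀ x → x ∈ xs → f x ≈ g x) → prodOver xs f ≈ prodOver xs g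
  prodOver-cong []       f≈g = refl
  prodOver-cong (x ∷ xs) f≈g = *-cong (f≈g x (here ≡.refl)) (prodOver-cong xs (λ y y∈xs → f≈g y (there y∈xs)))

  prodOver-++ : ∀ {a} {A : Set a} (xs ys : List A) f → prodOver (xs ++ ys) f ≈ prodOver xs f * prodOver ys f
  prodOver-++ []       ys f = sym (*-identityˡ _)
  prodOver-++ (x ∷ xs) ys f = trans (*-congˡ (prodOver-++ xs ys f)) (sym (*-assoc _ _ _))

  prodOver-map : ∀ {a b} {A : Set a} {B : Set b} (h : A → B) xs f → prodOver (map h xs) f ≡ prodOver xs (f ∘ h)
  prodOver-map h []       f = ≡.refl
  prodOver-map h (x ∷ xs) f = ≡.cong (f (h x) *_) (prodOver-map h xs f)

  prodOver-* : ∀ {a} {A : Set a} (xs : List A) f g → prodOver xs (λ x → f x * g x) ≈ prodOver xs f * prodOver xs g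
  prodOver-* []       f g = sym (*-identityˡ _)
  prodOver-* (x ∷ xs) f g = trans (*-congˡ (prodOver-* xs f g))
    (solve 4 (λ a b c d → (a :* b) :* (c :* d) := (a :* c) :* (b :* d)) refl (f x) (g x) (prodOver xs f) (prodOver xs g))

  prodOver-reverse : ∀ {a} {A : Set a} (xs : List A) f → prodOver (reverse xs) f ≈ prodOver xs f
  prodOver-reverse []       f = refl
  prodOver-reverse (x ∷ xs) f = begin
    prodOver (reverse (x ∷ xs)) f           ≡⟨ ≡.cong (λ z → prodOver z f) (List.unfold-reverse x xs) ⟩
    prodOver (reverse xs ++ [ x ]) f        ≈⟨ prodOver-++ (reverse xs) [ x ] f ⟩
    prodOver (reverse xs) f * (f x * 1#)    ≈⟨ *-cong (prodOver-reverse xs f) (*-identityʳ _) ⟩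
    prodOver xs f * f x                     ≈⟨ *-comm _ _ ⟩
    prodOver (x ∷ xs) f                     ∎

  prodOver-swap : ∀ {a b} {A : Set a} {B : Set b} (xs : List A) (ys : List B) (f : A → B → Carrier) →
    prodOver xs (λ x → prodOver ys (f x)) ≈ prodOver ys (λ y → prodOver xs (λ x → f x y))
  prodOver-swap []       ys f = sym (ones ys)
    where
    ones : ∀ ys → prodOver ys (λ _ → 1#) ≈ 1#
    ones []       = refl
    ones (y ∷ ys) = trans (*-identityˡ _) (ones ys)
  prodOver-swap (x ∷ xs) ys f = trans (*-congˡ (prodOver-swap xs ys f)) (sym (prodOver-* ys (f x) (λ y → prodOver xs (λ x' → f x' y))))

  prodOver-applyUpTo : ∀ n (g : ℕ → ℕ) (f : ℕ → Carrier) → prodOver (applyUpTo g n) f ≈ prodBelow n (f ∘ g)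
  prodOver-applyUpTo zero    g f = refl
  prodOver-applyUpTo (suc n) g f = trans (*-congˡ (prodOver-applyUpTo n (g ∘ suc) f)) (sym (prodBelow-unfoldˡ n (f ∘ g)))

  prodOver-upTo : ∀ n (f : ℕ → Carrier) → prodOver (upTo n) f ≈ prodBelow n f
  prodOver-upTo n f = prodOver-applyUpTo n (λ x → x) f

  prodBelow-!! : ∀ zs (h : ℕ → Carrier) → prodBelow (length zs) (λ r → h (zs !! r)) ≈ prodOver zs h
  prodBelow-!! []       h = refl
  prodBelow-!! (z ∷ zs) h = trans (prodBelow-unfoldˡ (length zs) _) (*-congˡ (prodBelow-!! zs h))

  prodTo≈prodBelow : ∀ n (h : ℕ → Carrier) → prodTo R n h ≈ prodBelow n (h ∘ suc)
  prodTo≈prodBelow zero    h = refl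
  prodTo≈prodBelow (suc n) h = *-congʳ (prodTo≈prodBelow n h)

  prodOver-upTo-suc : ∀ n f → prodOver (upTo (suc n)) f ≈ f 0 * prodOver (upTo n) (f ∘ suc)
  prodOver-upTo-suc n f = *-congˡ (reflexive (≡.trans (≡.cong (λ z → prodOver z f) (≡.sym (List.map-upTo suc n))) (prodOver-map suc (upTo n) f)))

module PunchIn where

  open import Data.Nat as ℕ using (ℕ; zero; suc; _<_; _≤_; z≤n; s≤s)
  import Data.Nat.Properties as ℕ
  open import Relation.Binary.PropositionalEquality as ≡ using (_≡_; _≢_)
  open import Data.Empty using (⊥-elim)
  open import Function using (_∘_)

  punchIn : ℕ → ℕ → ℕ
  punchIn zero    c       = suc c
  punchIn (suc j) zero    = zero
  punchIn (suc j) (suc c) = suc (punchIn j c)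

  punchOut : ℕ → ℕ → ℕ
  punchOut zero    k       = ℕ.pred k
  punchOut (suc j) zero    = zero
  punchOut (suc j) (suc k) = suc (punchOut j k)

  punchIn-below : ∀ j c → c < j → punchIn j c ≡ c
  punchIn-below (suc j) zero    _         = ≡.refl
  punchIn-below (suc j) (suc c) (s≤s c<j) = ≡.cong suc (punchIn-below j c c<j)

  punchIn-above : ∀ j c → j ≤ c → punchIn j c ≡ suc c
  punchIn-above zero    c       _         = ≡.refl
  punchIn-above (suc j) (suc c) (s≤s j≤c) = ≡.cong suc (punchIn-above j c j≤c)

  punchIn-≤ : ∀ j c → punchIn j c ≤ suc c
  punchIn-≤ zero    c       = ℕ.≤-refl
  punchIn-≤ (suc j) zero    = z≤n
  punchIn-≤ (suc j) (suc c) = s≤s (punchIn-≤ j c)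

  punchIn<1+n : ∀ j c n → c < n → punchIn j c < suc n
  punchIn<1+n j c n c<n = s≤s (ℕ.≤-trans (punchIn-≤ j c) c<n)

  punchIn-≢ : ∀ j c → punchIn j c ≢ j
  punchIn-≢ zero    c       ()
  punchIn-≢ (suc j) zero    ()
  punchIn-≢ (suc j) (suc c) eq = punchIn-≢ j c (ℕ.suc-injective eq)

  punchIn-injective : ∀ j c c' → punchIn j c ≡ punchIn j c' → c ≡ c'
  punchIn-injective zero    c       c'       eq = ℕ.suc-injective eq
  punchIn-injective (suc j) zero    zero     eq = ≡.refl
  punchIn-injective (suc j) (suc c) (suc c') eq = ≡.cong suc (punchIn-injective j c c' (ℕ.suc-injective eq))

  punchIn-punchOut : ∀ j k → k ≢ j → punchIn j (punchOut j k) ≡ k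
  punchIn-punchOut zero    zero    k≢j = ⊥-elim (k≢j ≡.refl)
  punchIn-punchOut zero    (suc k) _   = ≡.refl
  punchIn-punchOut (suc j) zero    _   = ≡.refl
  punchIn-punchOut (suc j) (suc k) k≢j = ≡.cong suc (punchIn-punchOut j k (k≢j ∘ ≡.cong suc))

  punchOut<n : ∀ j k n → k < suc n → j < suc n → k ≢ j → punchOut j k < n
  punchOut<n zero    zero    n       _           _           k≢j = ⊥-elim (k≢j ≡.refl)
  punchOut<n zero    (suc k) n       (s≤s k<n)   _           _   = k<n
  punchOut<n (suc j) zero    (suc n) _           _           _   = s≤s z≤n
  punchOut<n (suc j) zero    zero    _           (s≤s ())    _
  punchOut<n (suc j) (suc k) (suc n) (s≤s k<1+n) (s≤s j<1+n) k≢j = s≤s (punchOut<n j k n k<1+n j<1+n (k≢j ∘ ≡.cong suc))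
  punchOut<n (suc j) (suc k) zero    (s≤s ())    _           _

  punchIn-suc : ∀ k c → c ≢ k → punchIn k c ≡ punchIn (suc k) c
  punchIn-suc zero    zero    c≢k = ⊥-elim (c≢k ≡.refl)
  punchIn-suc zero    (suc c) _   = ≡.refl
  punchIn-suc (suc k) zero    _   = ≡.refl
  punchIn-suc (suc k) (suc c) c≢k = ≡.cong suc (punchIn-suc k c (c≢k ∘ ≡.cong suc))

module Determinant {c ℓ} (R : CommutativeRing c ℓ) where

  open import Data.Nat as ℕ using (ℕ; zero; suc; _<_; _≤_; z≤n; s≤s; _∸_)
  import Data.Nat.Properties as ℕ
  open import Data.List using (List; []; _∷_; _++_; _∷ʳ_; [_]; map; length)
  import Data.List.Properties as List
  open import Relation.Binary.PropositionalEquality as ≡ using (_≡_; _≢_; ≢-sym)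
  open import Relation.Binary.Definitions using (tri<; tri≈; tri>)
  open import Relation.Nullary using (yes; no)
  open import Data.Empty using (⊥-elim)
  open import Data.Sum using (_⊎_; inj₁; inj₂; [_,_]′)
  open import Function using (_∘_)
  open import Defs using (sumL)
  import Data.Integer as ℤ

  open CommutativeRing R hiding (zero)
  open BigOperators R
  open PunchIn
  open Partitions using (_!!_; lookupOr; choices; !!-++ˡ; !!-++-length)
  open import Relation.Binary.Reasoning.Setoid setoid

  Matrix : Set c
  Matrix = ℕ → ℕ → Carrier

  deleteCol : ℕ → Matrix → Matrix
  deleteCol j M r c = M r (punchIn j c)

  deleteRow : ℕ → Matrix → Matrix
  deleteRow i M r c = M (punchIn i r) c

  transpose : Matrix → Matrix
  transpose M r c = M c r

  det : ℕ → Matrix → Carrier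
  laplaceTerm : ℕ → Matrix → ℕ → Carrier

  det zero    M = 1#
  det (suc n) M = sumBelow (suc n) (laplaceTerm n M)

  laplaceTerm n M j = ε (n ℕ.+ j) * (M n j * det n (deleteCol j M))

  det-cong : ∀ n {M M' : Matrix} → (∀ r c → r < n → c < n → M r c ≈ M' r c) → det n M ≈ det n M'
  det-cong zero    M≈M' = refl
  det-cong (suc n) M≈M' = sumBelow-cong (suc n) (λ j j<1+n → *-congˡ (*-cong (M≈M' n j (ℕ.n<1+n n) j<1+n)
    (det-cong n (λ r c r<n c<n → M≈M' r (punchIn j c) (ℕ.m<n⇒m<1+n r<n) (punchIn<1+n j c n c<n)))))

  det-linearInColumn : ∀ n k (M M₁ M₂ : Matrix) a b → k < n →
    (∀ r c → r < n → c < n → c ≢ k → M₁ r c ≈ M r c) →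
    (∀ r c → r < n → c < n → c ≢ k → M₂ r c ≈ M r c) →
    (∀ r → r < n → M r k ≈ a * M₁ r k + b * M₂ r k) →
    det n M ≈ a * det n M₁ + b * det n M₂
  det-linearInColumn (suc n) k M M₁ M₂ a b k<1+n M₁≈M M₂≈M colₖ = begin
    sumBelow (suc n) (laplaceTerm n M)                                        ≈⟨ sumBelow-cong (suc n) termwise ⟩
    sumBelow (suc n) (λ j → a * laplaceTerm n M₁ j + b * laplaceTerm n M₂ j)  ≈⟨ sumBelow-+ (suc n) _ _ ⟩
    sumBelow (suc n) (λ j → a * laplaceTerm n M₁ j) + sumBelow (suc n) (λ j → b * laplaceTerm n M₂ j)
      ≈⟨ +-cong (*-distribˡ-sumBelow (suc n) a _) (*-distribˡ-sumBelow (suc n) b _) ⟨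
    a * det (suc n) M₁ + b * det (suc n) M₂                                   ∎
    where
    minors≈ : ∀ j (N : Matrix) → (∀ r c → r < suc n → c < suc n → c ≢ k → N r c ≈ M r c) →
      (∀ r c → r < n → c < n → punchIn j c ≢ k → deleteCol j N r c ≈ deleteCol j M r c)
    minors≈ j N N≈M r c r<n c<n ≢k = N≈M r (punchIn j c) (ℕ.m<n⇒m<1+n r<n) (punchIn<1+n j c n c<n) ≢k
    termwise : ∀ j → j < suc n → laplaceTerm n M j ≈ a * laplaceTerm n M₁ j + b * laplaceTerm n M₂ j
    termwise j j<1+n with j ℕ.≟ k
    ... | yes ≡.refl = begin
      ε (n ℕ.+ j) * (M n j * det n (deleteCol j M))
        ≈⟨ *-congˡ (*-cong (colₖ n (ℕ.n<1+n n)) (det-cong n (λ r c r<n c<n → sym (minors≈ j M₁ M₁≈M r c r<n c<n (punchIn-≢ j c))))) ⟩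
      ε (n ℕ.+ j) * ((a * M₁ n j + b * M₂ n j) * det n (deleteCol j M₁))
        ≈⟨ solve 6 (λ e a b x y d → e :* ((a :* x :+ b :* y) :* d) := a :* (e :* (x :* d)) :+ b :* (e :* (y :* d))) refl
             (ε (n ℕ.+ j)) a b (M₁ n j) (M₂ n j) (det n (deleteCol j M₁)) ⟩
      a * laplaceTerm n M₁ j + b * (ε (n ℕ.+ j) * (M₂ n j * det n (deleteCol j M₁)))
        ≈⟨ +-congˡ (*-congˡ (*-congˡ (*-congˡ (det-cong n (λ r c r<n c<n →
             trans (minors≈ j M₁ M₁≈M r c r<n c<n (punchIn-≢ j c)) (sym (minors≈ j M₂ M₂≈M r c r<n c<n (punchIn-≢ j c)))))))) ⟩
      a * laplaceTerm n M₁ j + b * laplaceTerm n M₂ j ∎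
    ... | no j≢k = begin
      ε (n ℕ.+ j) * (M n j * det n (deleteCol j M))
        ≈⟨ *-congˡ (*-congˡ minor-linear) ⟩
      ε (n ℕ.+ j) * (M n j * (a * det n (deleteCol j M₁) + b * det n (deleteCol j M₂)))
        ≈⟨ solve 6 (λ e a b x d₁ d₂ → e :* (x :* (a :* d₁ :+ b :* d₂)) := a :* (e :* (x :* d₁)) :+ b :* (e :* (x :* d₂))) refl
             (ε (n ℕ.+ j)) a b (M n j) (det n (deleteCol j M₁)) (det n (deleteCol j M₂)) ⟩
      a * (ε (n ℕ.+ j) * (M n j * det n (deleteCol j M₁))) + b * (ε (n ℕ.+ j) * (M n j * det n (deleteCol j M₂)))
        ≈⟨ +-cong (*-congˡ (*-congˡ (*-congʳ (sym (M₁≈M n j (ℕ.n<1+n n) j<1+n j≢k)))))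
                  (*-congˡ (*-congˡ (*-congʳ (sym (M₂≈M n j (ℕ.n<1+n n) j<1+n j≢k))))) ⟩
      a * laplaceTerm n M₁ j + b * laplaceTerm n M₂ j ∎
      where
      k' = punchOut j k
      punchIn-k' : punchIn j k' ≡ k
      punchIn-k' = punchIn-punchOut j k (≢-sym j≢k)
      ≢k' : ∀ {c} → c ≢ k' → punchIn j c ≢ k
      ≢k' c≢k' eq = c≢k' (punchIn-injective j _ k' (≡.trans eq (≡.sym punchIn-k')))
      minor-linear : det n (deleteCol j M) ≈ a * det n (deleteCol j M₁) + b * det n (deleteCol j M₂)
      minor-linear = det-linearInColumn n k' (deleteCol j M) (deleteCol j M₁) (deleteCol j M₂) a b
        (punchOut<n j k n k<1+n j<1+n (≢-sym j≢k))
        (λ r c r<n c<n c≢k' → minors≈ j M₁ M₁≈M r c r<n c<n (≢k' c≢k'))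
        (λ r c r<n c<n c≢k' → minors≈ j M₂ M₂≈M r c r<n c<n (≢k' c≢k'))
        (λ r r<n → ≡.subst (λ z → M r z ≈ a * M₁ r z + b * M₂ r z) (≡.sym punchIn-k') (colₖ r (ℕ.m<n⇒m<1+n r<n)))

  det-equalAdjacentColumns : ∀ n k (M : Matrix) → suc k < n → (∀ r → r < n → M r k ≈ M r (suc k)) → det n M ≈ 0#
  det-equalAdjacentColumns (suc n) k M 1+k<1+n same =
    sumBelow-cancellingPair (suc n) k (laplaceTerm n M) 1+k<1+n others pair
    where
    k<n : k < n
    k<n = ℕ.≤-pred 1+k<1+n
    minorBelow : ∀ j k → j < k → suc k < suc n → (∀ r → r < suc n → M r k ≈ M r (suc k)) → det n (deleteCol j M) ≈ 0#
    minorBelow j (suc k₀) (s≤s j≤k₀) 2+k₀<1+n same₀ = det-equalAdjacentColumns n k₀ (deleteCol j M) (ℕ.≤-pred 2+k₀<1+n)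
      (λ r r<n → ≡.subst₂ (λ u v → M r u ≈ M r v) (≡.sym (punchIn-above j k₀ j≤k₀)) (≡.sym (punchIn-above j (suc k₀) (ℕ.m≤n⇒m≤1+n j≤k₀)))
                          (same₀ r (ℕ.m<n⇒m<1+n r<n)))
    minorAbove : ∀ j → suc k < j → j < suc n → det n (deleteCol j M) ≈ 0#
    minorAbove j 1+k<j j<1+n = det-equalAdjacentColumns n k (deleteCol j M) (ℕ.<-≤-trans 1+k<j (ℕ.≤-pred j<1+n))
      (λ r r<n → ≡.subst₂ (λ u v → M r u ≈ M r v) (≡.sym (punchIn-below j k (ℕ.<-trans (ℕ.n<1+n k) 1+k<j)))
                          (≡.sym (punchIn-below j (suc k) 1+k<j)) (same r (ℕ.m<n⇒m<1+n r<n)))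
    minor≈0 : ∀ j → j < suc n → j ≢ k → j ≢ suc k → det n (deleteCol j M) ≈ 0#
    minor≈0 j j<1+n j≢k j≢1+k with ℕ.<-cmp j k
    ... | tri< j<k _ _ = minorBelow j k j<k 1+k<1+n same
    ... | tri≈ _ j≡k _ = ⊥-elim (j≢k j≡k)
    ... | tri> _ _ k<j with ℕ.<-cmp (suc k) j
    ...   | tri< 1+k<j _ _ = minorAbove j 1+k<j j<1+n
    ...   | tri≈ _ 1+k≡j _ = ⊥-elim (j≢1+k (≡.sym 1+k≡j))
    ...   | tri> _ _ j<1+k = ⊥-elim (ℕ.<-irrefl ≡.refl (ℕ.<-≤-trans k<j (ℕ.≤-pred j<1+k)))
    others : ∀ j → j < suc n → j ≢ k → j ≢ suc k → laplaceTerm n M j ≈ 0#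
    others j j<1+n j≢k j≢1+k = trans (*-congˡ (trans (*-congˡ (minor≈0 j j<1+n j≢k j≢1+k)) (zeroʳ _))) (zeroʳ _)
    sameMinors : det n (deleteCol k M) ≈ det n (deleteCol (suc k) M)
    sameMinors = det-cong n (λ r c r<n c<n → entry r c r<n)
      where
      entry : ∀ r c → r < n → M r (punchIn k c) ≈ M r (punchIn (suc k) c)
      entry r c r<n with c ℕ.≟ k
      ... | yes ≡.refl = ≡.subst₂ (λ u v → M r u ≈ M r v) (≡.sym (punchIn-above c c ℕ.≤-refl)) (≡.sym (punchIn-below (suc c) c (ℕ.n<1+n c)))
                                 (sym (same r (ℕ.m<n⇒m<1+n r<n)))
      ... | no c≢k     = reflexive (≡.cong (M r) (punchIn-suc k c c≢k))
    pair : laplaceTerm n M k + laplaceTerm n M (suc k) ≈ 0#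
    pair = begin
      ε (n ℕ.+ k) * (M n k * det n (deleteCol k M)) + ε (n ℕ.+ suc k) * (M n (suc k) * det n (deleteCol (suc k) M))
        ≡⟨ ≡.cong (λ z → laplaceTerm n M k + ε z * (M n (suc k) * det n (deleteCol (suc k) M))) (ℕ.+-suc n k) ⟩
      ε (n ℕ.+ k) * (M n k * det n (deleteCol k M)) + (- ε (n ℕ.+ k)) * (M n (suc k) * det n (deleteCol (suc k) M))
        ≈⟨ +-congˡ (*-congˡ (*-cong (sym (same n (ℕ.n<1+n n))) (sym sameMinors))) ⟩
      ε (n ℕ.+ k) * (M n k * det n (deleteCol k M)) + (- ε (n ℕ.+ k)) * (M n k * det n (deleteCol k M))
        ≈⟨ solve 2 (λ e x → e :* x :+ (:- e) :* x := con (ℤ.+ 0)) refl (ε (n ℕ.+ k)) (M n k * det n (deleteCol k M)) ⟩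
      0# ∎

  det-expandLastColumn : ∀ n M → det (suc n) M ≈ sumBelow (suc n) (λ i → ε (n ℕ.+ i) * (M i n * det n (deleteRow i M)))
  det-expandLastColumn zero    M = refl
  det-expandLastColumn (suc n) M = +-cong swapOrder lastTerm
    where
    minor₂ : ℕ → ℕ → Matrix
    minor₂ i j r c = M (punchIn i r) (punchIn j c)
    rowFirst colFirst : ℕ → ℕ → Carrier
    rowFirst j i = ε (suc n ℕ.+ j) * (M (suc n) j * (ε (n ℕ.+ i) * (M i (suc n) * det n (minor₂ i j))))
    colFirst i j = ε (suc n ℕ.+ i) * (M i (suc n) * (ε (n ℕ.+ j) * (M (suc n) j * det n (minor₂ i j))))
    distrib₂ : ∀ n x y f → x * (y * sumBelow n f) ≈ sumBelow n (λ i → x * (y * f i))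
    distrib₂ n x y f = trans (*-congˡ (*-distribˡ-sumBelow n y f)) (*-distribˡ-sumBelow n x _)
    swapOrder : sumBelow (suc n) (laplaceTerm (suc n) M)
              ≈ sumBelow (suc n) (λ i → ε (suc n ℕ.+ i) * (M i (suc n) * det (suc n) (deleteRow i M)))
    swapOrder = begin
      sumBelow (suc n) (laplaceTerm (suc n) M)
        ≈⟨ sumBelow-cong (suc n) (λ j j<1+n → trans (*-congˡ (*-congˡ (det-expandLastColumn n (deleteCol j M))))
             (trans (*-congˡ (*-congˡ (sumBelow-cong (suc n) (λ i _ →
               *-congˡ (*-congʳ (reflexive (≡.cong (M i) (punchIn-above j n (ℕ.≤-pred j<1+n))))))))) (distrib₂ (suc n) _ _ _))) ⟩
      sumBelow (suc n) (λ j → sumBelow (suc n) (rowFirst j))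
        ≈⟨ sumBelow-swap (suc n) (suc n) rowFirst ⟩
      sumBelow (suc n) (λ i → sumBelow (suc n) (λ j → rowFirst j i))
        ≈⟨ sumBelow-cong (suc n) (λ i _ → sumBelow-cong (suc n) (λ j _ →
             solve 5 (λ e₁ e₂ x y d → :- e₁ :* (x :* (e₂ :* (y :* d))) := :- e₂ :* (y :* (e₁ :* (x :* d)))) refl
               (ε (n ℕ.+ j)) (ε (n ℕ.+ i)) (M (suc n) j) (M i (suc n)) (det n (minor₂ i j)))) ⟩
      sumBelow (suc n) (λ i → sumBelow (suc n) (colFirst i))
        ≈⟨ sumBelow-cong (suc n) (λ i i<1+n → trans (*-congˡ (*-congˡ (sumBelow-cong (suc n) (λ j _ →
             *-congˡ (*-congʳ (reflexive (≡.cong (λ z → M z j) (punchIn-above i n (ℕ.≤-pred i<1+n))))))))) (distrib₂ (suc n) _ _ _)) ⟨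
      sumBelow (suc n) (λ i → ε (suc n ℕ.+ i) * (M i (suc n) * det (suc n) (deleteRow i M))) ∎
    lastTerm : laplaceTerm (suc n) M (suc n) ≈ ε (suc n ℕ.+ suc n) * (M (suc n) (suc n) * det (suc n) (deleteRow (suc n) M))
    lastTerm = *-congˡ (*-congˡ (det-cong (suc n) (λ r c r<1+n c<1+n →
      reflexive (≡.trans (≡.cong (M r) (punchIn-below (suc n) c c<1+n)) (≡.cong (λ z → M z c) (≡.sym (punchIn-below (suc n) r r<1+n)))))))

  det-transpose : ∀ n M → det n (transpose M) ≈ det n M
  det-transpose zero    M = refl
  det-transpose (suc n) M =
    trans (sumBelow-cong (suc n) (λ j _ → *-congˡ (*-congˡ (det-transpose n (deleteRow j M))))) (sym (det-expandLastColumn n M))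

  det-scaleRows : ∀ n (M M₁ : Matrix) (a : ℕ → Carrier) → (∀ r c → r < n → c < n → M r c ≈ a r * M₁ r c) →
    det n M ≈ prodBelow n a * det n M₁
  det-scaleRows zero    M M₁ a M≈aM₁ = sym (*-identityˡ _)
  det-scaleRows (suc n) M M₁ a M≈aM₁ = begin
    sumBelow (suc n) (laplaceTerm n M)
      ≈⟨ sumBelow-cong (suc n) (λ j j<1+n → trans
           (*-congˡ (*-cong (M≈aM₁ n j (ℕ.n<1+n n) j<1+n)
             (det-scaleRows n (deleteCol j M) (deleteCol j M₁) a (λ r c r<n c<n → M≈aM₁ r (punchIn j c) (ℕ.m<n⇒m<1+n r<n) (punchIn<1+n j c n c<n)))))
           (solve 5 (λ e a x p d → e :* ((a :* x) :* (p :* d)) := (p :* a) :* (e :* (x :* d))) refl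
             (ε (n ℕ.+ j)) (a n) (M₁ n j) (prodBelow n a) (det n (deleteCol j M₁)))) ⟩
    sumBelow (suc n) (λ j → (prodBelow n a * a n) * laplaceTerm n M₁ j)
      ≈⟨ *-distribˡ-sumBelow (suc n) _ _ ⟨
    (prodBelow n a * a n) * det (suc n) M₁ ∎

  det-scaleColumns : ∀ n (M M₁ : Matrix) (b : ℕ → Carrier) → (∀ r c → r < n → c < n → M r c ≈ b c * M₁ r c) →
    det n M ≈ prodBelow n b * det n M₁
  det-scaleColumns n M M₁ b M≈M₁b = begin
    det n M                            ≈⟨ det-transpose n M ⟨
    det n (transpose M)                ≈⟨ det-scaleRows n (transpose M) (transpose M₁) b (λ r c r<n c<n → M≈M₁b c r c<n r<n) ⟩
    prodBelow n b * det n (transpose M₁) ≈⟨ *-congˡ (det-transpose n M₁) ⟩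
    prodBelow n b * det n M₁           ∎

  replaceColumn : ℕ → (ℕ → Carrier) → Matrix → Matrix
  replaceColumn k v M r c with c ℕ.≟ k
  ... | yes _ = v r
  ... | no  _ = M r c

  replaceColumn-≡ : ∀ k v M r → replaceColumn k v M r k ≡ v r
  replaceColumn-≡ k v M r with k ℕ.≟ k
  ... | yes _  = ≡.refl
  ... | no k≢k = ⊥-elim (k≢k ≡.refl)

  replaceColumn-≢ : ∀ k v M r c → c ≢ k → replaceColumn k v M r c ≡ M r c
  replaceColumn-≢ k v M r c c≢k with c ℕ.≟ k
  ... | yes c≡k = ⊥-elim (c≢k c≡k)
  ... | no  _   = ≡.refl

  det-addAdjacentColumn : ∀ n k k' (M M' : Matrix) a → k < n → k' < n → k' ≡ suc k ⊎ k ≡ suc k' →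
    (∀ r c → r < n → c < n → c ≢ k → M' r c ≈ M r c) →
    (∀ r → r < n → M' r k ≈ M r k + a * M r k') → det n M' ≈ det n M
  det-addAdjacentColumn n k k' M M' a k<n k'<n adjacent M'≈M colₖ = begin
    det n M'                        ≈⟨ det-linearInColumn n k M' M M₂ 1# a k<n
                                         (λ r c r<n c<n c≢k → sym (M'≈M r c r<n c<n c≢k))
                                         (λ r c r<n c<n c≢k → trans (reflexive (replaceColumn-≢ k _ M r c c≢k)) (sym (M'≈M r c r<n c<n c≢k)))
                                         (λ r r<n → trans (colₖ r r<n) (+-cong (sym (*-identityˡ _)) (*-congˡ (reflexive (≡.sym (replaceColumn-≡ k _ M r)))))) ⟩
    1# * det n M + a * det n M₂     ≈⟨ +-cong (*-identityˡ _) (trans (*-congˡ (M₂-singular adjacent)) (zeroʳ _)) ⟩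
    det n M + 0#                    ≈⟨ +-identityʳ _ ⟩
    det n M                         ∎
    where
    M₂ = replaceColumn k (λ r → M r k') M
    k'≢k : k' ≢ k
    k'≢k k'≡k = [ (λ k'≡1+k → ℕ.1+n≢n (≡.trans (≡.sym k'≡1+k) k'≡k)) , (λ k≡1+k' → ℕ.1+n≢n (≡.trans (≡.sym k≡1+k') (≡.sym k'≡k))) ]′ adjacent
    columns-k-k' : ∀ r → M₂ r k ≡ M₂ r k'
    columns-k-k' r = ≡.trans (replaceColumn-≡ k _ M r) (≡.sym (replaceColumn-≢ k _ M r k' k'≢k))
    M₂-singular : k' ≡ suc k ⊎ k ≡ suc k' → det n M₂ ≈ 0#
    M₂-singular (inj₁ ≡.refl) = det-equalAdjacentColumns n k M₂ k'<n (λ r _ → reflexive (columns-k-k' r))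
    M₂-singular (inj₂ ≡.refl) = det-equalAdjacentColumns n k' M₂ k<n (λ r _ → reflexive (≡.sym (columns-k-k' r)))

  addNextColumns : ℕ → (ℕ → Carrier) → Matrix → Matrix
  addNextColumns k a M r c with c ℕ.<? k
  ... | yes _ = M r c + a c * M r (suc c)
  ... | no  _ = M r c

  addNextColumns-< : ∀ k a M r c → c < k → addNextColumns k a M r c ≡ M r c + a c * M r (suc c)
  addNextColumns-< k a M r c c<k with c ℕ.<? k
  ... | yes _  = ≡.refl
  ... | no c≮k = ⊥-elim (c≮k c<k)

  addNextColumns-≥ : ∀ k a M r c → k ≤ c → addNextColumns k a M r c ≡ M r c
  addNextColumns-≥ k a M r c k≤c with c ℕ.<? k
  ... | yes c<k = ⊥-elim (ℕ.<⇒≱ c<k k≤c)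
  ... | no _    = ≡.refl

  det-addNextColumns : ∀ n k a M → k < n → det n (addNextColumns k a M) ≈ det n M
  det-addNextColumns n zero    a M _      = det-cong n (λ r c _ _ → reflexive (addNextColumns-≥ zero a M r c z≤n))
  det-addNextColumns n (suc k) a M 1+k<n = trans lastOperation (det-addNextColumns n k a M (ℕ.<-trans (ℕ.n<1+n k) 1+k<n))
    where
    lastOperation : det n (addNextColumns (suc k) a M) ≈ det n (addNextColumns k a M)
    lastOperation = det-addAdjacentColumn n k (suc k) (addNextColumns k a M) (addNextColumns (suc k) a M) (a k)
      (ℕ.<-trans (ℕ.n<1+n k) 1+k<n) 1+k<n (inj₁ ≡.refl) (λ r c _ _ c≢k → unchanged r c c≢k)
      (λ r _ → reflexive (≡.trans (addNextColumns-< (suc k) a M r k (ℕ.n<1+n k))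
        (≡.sym (≡.cong₂ (λ u v → u + a k * v) (addNextColumns-≥ k a M r k ℕ.≤-refl) (addNextColumns-≥ k a M r (suc k) (ℕ.n≤1+n k))))))
      where
      unchanged : ∀ r c → c ≢ k → addNextColumns (suc k) a M r c ≈ addNextColumns k a M r c
      unchanged r c c≢k with ℕ.<-cmp c k
      ... | tri< c<k _ _ = reflexive (≡.trans (addNextColumns-< (suc k) a M r c (ℕ.m<n⇒m<1+n c<k)) (≡.sym (addNextColumns-< k a M r c c<k)))
      ... | tri≈ _ c≡k _ = ⊥-elim (c≢k c≡k)
      ... | tri> _ _ k<c = reflexive (≡.trans (addNextColumns-≥ (suc k) a M r c k<c) (≡.sym (addNextColumns-≥ k a M r c (ℕ.<⇒≤ k<c))))

  addPreviousColumns : ℕ → (ℕ → Carrier) → Matrix → Matrix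
  addPreviousColumns k a M r c with k ℕ.<? c
  ... | yes _ = M r c + a c * M r (ℕ.pred c)
  ... | no  _ = M r c

  addPreviousColumns-> : ∀ k a M r c → k < c → addPreviousColumns k a M r c ≡ M r c + a c * M r (ℕ.pred c)
  addPreviousColumns-> k a M r c k<c with k ℕ.<? c
  ... | yes _  = ≡.refl
  ... | no k≮c = ⊥-elim (k≮c k<c)

  addPreviousColumns-≤ : ∀ k a M r c → c ≤ k → addPreviousColumns k a M r c ≡ M r c
  addPreviousColumns-≤ k a M r c c≤k with k ℕ.<? c
  ... | yes k<c = ⊥-elim (ℕ.<⇒≱ k<c c≤k)
  ... | no _    = ≡.refl

  det-addPreviousColumns-from : ∀ n d k a M → k ℕ.+ d ≡ n → det (suc n) (addPreviousColumns k a M) ≈ det (suc n) M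
  det-addPreviousColumns-from n zero    k a M k+0≡n = det-cong (suc n) (λ r c _ c<1+n →
    reflexive (addPreviousColumns-≤ k a M r c (≡.subst (c ≤_) (≡.trans (≡.sym k+0≡n) (ℕ.+-identityʳ k)) (ℕ.≤-pred c<1+n))))
  det-addPreviousColumns-from n (suc d) k a M k+1+d≡n =
    trans firstOperation (det-addPreviousColumns-from n d (suc k) a M (≡.trans (≡.sym (ℕ.+-suc k d)) k+1+d≡n))
    where
    1+k<1+n : suc k < suc n
    1+k<1+n = s≤s (≡.subst (suc k ≤_) k+1+d≡n (≡.subst (suc k ≤_) (≡.sym (ℕ.+-suc k d)) (s≤s (ℕ.m≤m+n k d))))
    firstOperation : det (suc n) (addPreviousColumns k a M) ≈ det (suc n) (addPreviousColumns (suc k) a M)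
    firstOperation = det-addAdjacentColumn (suc n) (suc k) k (addPreviousColumns (suc k) a M) (addPreviousColumns k a M) (a (suc k))
      1+k<1+n (ℕ.<-trans (ℕ.n<1+n k) 1+k<1+n) (inj₂ ≡.refl) (λ r c _ _ c≢1+k → unchanged r c c≢1+k)
      (λ r _ → reflexive (≡.trans (addPreviousColumns-> k a M r (suc k) (ℕ.n<1+n k))
        (≡.sym (≡.cong₂ (λ u v → u + a (suc k) * v) (addPreviousColumns-≤ (suc k) a M r (suc k) ℕ.≤-refl)
                                                      (addPreviousColumns-≤ (suc k) a M r k (ℕ.n≤1+n k))))))
      where
      unchanged : ∀ r c → c ≢ suc k → addPreviousColumns k a M r c ≈ addPreviousColumns (suc k) a M r c
      unchanged r c c≢1+k with ℕ.<-cmp c (suc k)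
      ... | tri< c<1+k _ _ = reflexive (≡.trans (addPreviousColumns-≤ k a M r c (ℕ.≤-pred c<1+k)) (≡.sym (addPreviousColumns-≤ (suc k) a M r c (ℕ.<⇒≤ c<1+k))))
      ... | tri≈ _ c≡1+k _ = ⊥-elim (c≢1+k c≡1+k)
      ... | tri> _ _ 1+k<c = reflexive (≡.trans (addPreviousColumns-> k a M r c (ℕ.<-trans (ℕ.n<1+n k) 1+k<c)) (≡.sym (addPreviousColumns-> (suc k) a M r c 1+k<c)))

  det-addPreviousColumns : ∀ n a M → det (suc n) (addPreviousColumns 0 a M) ≈ det (suc n) M
  det-addPreviousColumns n a M = det-addPreviousColumns-from n n 0 a M ≡.refl

  det-sumInColumn : ∀ n k {A : Set} (D : List A) (Mᵘ : A → Matrix) (M : Matrix) → k < n →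
    (∀ μ r c → r < n → c < n → c ≢ k → Mᵘ μ r c ≈ M r c) →
    (∀ r → r < n → M r k ≈ sumL R (map (λ μ → Mᵘ μ r k) D)) →
    det n M ≈ sumL R (map (λ μ → det n (Mᵘ μ)) D)
  det-sumInColumn n k []      Mᵘ M k<n _ colₖ = begin
    det n M                       ≈⟨ det-linearInColumn n k M M M 0# 0# k<n (λ _ _ _ _ _ → refl) (λ _ _ _ _ _ → refl)
                                       (λ r r<n → trans (colₖ r r<n) (sym 0*x+0*y≈0)) ⟩
    0# * det n M + 0# * det n M   ≈⟨ 0*x+0*y≈0 ⟩
    0#                            ∎
    where
    0*x+0*y≈0 : ∀ {x y} → 0# * x + 0# * y ≈ 0#
    0*x+0*y≈0 = trans (+-cong (zeroˡ _) (zeroˡ _)) (+-identityˡ _)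
  det-sumInColumn n k (μ ∷ D) Mᵘ M k<n Mᵘ≈M colₖ = begin
    det n M                               ≈⟨ det-linearInColumn n k M (Mᵘ μ) Mrest 1# 1# k<n (Mᵘ≈M μ)
                                               (λ r c r<n c<n c≢k → reflexive (replaceColumn-≢ k _ M r c c≢k))
                                               (λ r r<n → trans (colₖ r r<n) (+-cong (sym (*-identityˡ _))
                                                  (trans (reflexive (≡.sym (replaceColumn-≡ k _ M r))) (sym (*-identityˡ _))))) ⟩
    1# * det n (Mᵘ μ) + 1# * det n Mrest   ≈⟨ +-cong (*-identityˡ _) (*-identityˡ _) ⟩
    det n (Mᵘ μ) + det n Mrest             ≈⟨ +-congˡ (det-sumInColumn n k D Mᵘ Mrest k<n
                                               (λ μ' r c r<n c<n c≢k → trans (Mᵘ≈M μ' r c r<n c<n c≢k) (sym (reflexive (replaceColumn-≢ k _ M r c c≢k))))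
                                               (λ r r<n → reflexive (replaceColumn-≡ k _ M r))) ⟩
    det n (Mᵘ μ) + sumL R (map (λ μ → det n (Mᵘ μ)) D) ∎
    where
    Mrest = replaceColumn k (λ r → sumL R (map (λ μ → Mᵘ μ r k) D)) M

  module Multilinear (G : ℕ → ℕ → ℕ → Carrier) where

    chosenMatrix : List ℕ → Matrix
    chosenMatrix μs r c = G c (μs !! c) r

    partlyChosenMatrix : List ℕ → List (List ℕ) → Matrix
    partlyChosenMatrix ps Ds r c with c ℕ.<? length ps
    ... | yes _ = G c (ps !! c) r
    ... | no  _ = sumL R (map (λ μ → G c μ r) (lookupOr [] Ds (c ∸ length ps)))

    partlyChosen-< : ∀ ps Ds r c → c < length ps → partlyChosenMatrix ps Ds r c ≡ G c (ps !! c) r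
    partlyChosen-< ps Ds r c c<len with c ℕ.<? length ps
    ... | yes _  = ≡.refl
    ... | no c≮ = ⊥-elim (c≮ c<len)

    partlyChosen-≥ : ∀ ps Ds r c → length ps ≤ c →
      partlyChosenMatrix ps Ds r c ≡ sumL R (map (λ μ → G c μ r) (lookupOr [] Ds (c ∸ length ps)))
    partlyChosen-≥ ps Ds r c len≤c with c ℕ.<? length ps
    ... | yes c<len = ⊥-elim (ℕ.<⇒≱ c<len len≤c)
    ... | no _      = ≡.refl

    det-partlyChosen : ∀ n Ds ps → length ps ℕ.+ length Ds ≡ n →
      det n (partlyChosenMatrix ps Ds) ≈ sumL R (map (λ ms → det n (chosenMatrix (ps ++ ms))) (choices Ds))
    det-partlyChosen n []       ps len≡ = trans
      (det-cong n (λ r c _ c<n → reflexive (partlyChosen-< ps [] r c (≡.subst (c <_) (≡.trans (≡.sym len≡) (ℕ.+-identityʳ _)) c<n))))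
      (sym (trans (+-identityʳ _) (reflexive (≡.cong (λ z → det n (chosenMatrix z)) (List.++-identityʳ ps)))))
    det-partlyChosen n (D ∷ Ds) ps len≡ = begin
      det n (partlyChosenMatrix ps (D ∷ Ds))
        ≈⟨ det-sumInColumn n k D (λ μ → partlyChosenMatrix (ps ∷ʳ μ) Ds) (partlyChosenMatrix ps (D ∷ Ds)) k<n otherColumns columnₖ ⟩
      sumL R (map (λ μ → det n (partlyChosenMatrix (ps ∷ʳ μ) Ds)) D)
        ≈⟨ sumL-map-cong D (λ μ _ → trans (det-partlyChosen n Ds (ps ∷ʳ μ) (≡.trans (≡.cong (ℕ._+ length Ds) (length-∷ʳ μ)) (≡.trans (≡.sym (ℕ.+-suc k (length Ds))) len≡)))
             (trans (sumL-map-cong (choices Ds) (λ ms _ → reflexive (≡.cong (λ z → det n (chosenMatrix z)) (List.++-assoc ps [ μ ] ms))))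
               (reflexive (≡.sym (sumL-map-∘ (choices Ds) (μ ∷_) (λ ms → det n (chosenMatrix (ps ++ ms)))))))) ⟩
      sumL R (map (λ μ → sumL R (map (λ ms → det n (chosenMatrix (ps ++ ms))) (map (μ ∷_) (choices Ds)))) D)
        ≈⟨ sumL-concatMap D (λ m → map (m ∷_) (choices Ds)) (λ ms → det n (chosenMatrix (ps ++ ms))) ⟨
      sumL R (map (λ ms → det n (chosenMatrix (ps ++ ms))) (choices (D ∷ Ds))) ∎
      where
      k = length ps
      length-∷ʳ : ∀ μ → length (ps ∷ʳ μ) ≡ suc k
      length-∷ʳ μ = ≡.trans (List.length-++ ps) (ℕ.+-comm k 1)
      k<n : k < n
      k<n = ≡.subst (suc k ≤_) len≡ (≡.subst (suc k ≤_) (≡.sym (ℕ.+-suc k (length Ds))) (s≤s (ℕ.m≤m+n k (length Ds))))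
      otherColumns : ∀ μ r c → r < n → c < n → c ≢ k → partlyChosenMatrix (ps ∷ʳ μ) Ds r c ≈ partlyChosenMatrix ps (D ∷ Ds) r c
      otherColumns μ r c _ _ c≢k with ℕ.<-cmp c k
      ... | tri< c<k _ _ = reflexive (≡.trans (partlyChosen-< (ps ∷ʳ μ) Ds r c (≡.subst (c <_) (≡.sym (length-∷ʳ μ)) (ℕ.m<n⇒m<1+n c<k)))
                             (≡.trans (≡.cong (λ z → G c z r) (!!-++ˡ ps [ μ ] c c<k)) (≡.sym (partlyChosen-< ps (D ∷ Ds) r c c<k))))
      ... | tri≈ _ c≡k _ = ⊥-elim (c≢k c≡k)
      ... | tri> _ _ k<c = reflexive (≡.trans (partlyChosen-≥ (ps ∷ʳ μ) Ds r c (≡.subst (_≤ c) (≡.sym (length-∷ʳ μ)) k<c))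
                             (≡.trans (≡.cong (λ z → sumL R (map (λ μ → G c μ r) (lookupOr [] Ds (c ∸ z)))) (length-∷ʳ μ))
                             (≡.trans (≡.cong (λ z → sumL R (map (λ μ → G c μ r) (lookupOr [] (D ∷ Ds) z))) (≡.sym (ℕ.+-∸-assoc 1 k<c)))
                               (≡.sym (partlyChosen-≥ ps (D ∷ Ds) r c (ℕ.<⇒≤ k<c))))))
      columnₖ : ∀ r → r < n → partlyChosenMatrix ps (D ∷ Ds) r k ≈ sumL R (map (λ μ → partlyChosenMatrix (ps ∷ʳ μ) Ds r k) D)
      columnₖ r _ = reflexive (≡.trans (partlyChosen-≥ ps (D ∷ Ds) r k ℕ.≤-refl)
         (≡.trans (≡.cong (λ z → sumL R (map (λ μ → G k μ r) (lookupOr [] (D ∷ Ds) z))) (ℕ.n∸n≡0 k))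
           (≡.cong (sumL R) (List.map-cong chosenₖ D))))
        where
        chosenₖ : ∀ μ → G k μ r ≡ partlyChosenMatrix (ps ∷ʳ μ) Ds r k
        chosenₖ μ = ≡.sym (≡.trans (partlyChosen-< (ps ∷ʳ μ) Ds r k (≡.subst (k <_) (≡.sym (length-∷ʳ μ)) (ℕ.n<1+n k)))
                                   (≡.cong (λ z → G k z r) (!!-++-length ps μ [])))

    det-multilinear : ∀ n Ds → length Ds ≡ n →
      det n (λ r c → sumL R (map (λ μ → G c μ r) (lookupOr [] Ds c))) ≈ sumL R (map (λ ms → det n (chosenMatrix ms)) (choices Ds))
    det-multilinear n Ds len≡ =
      trans (det-cong n (λ r c _ _ → reflexive (≡.sym (partlyChosen-≥ [] Ds r c z≤n)))) (det-partlyChosen n Ds [] len≡)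

module Bialternant {c ℓ} (R : CommutativeRing c ℓ) where

  open import Data.Nat as ℕ using (ℕ; zero; suc; _<_; _≤_; _≥_; z≤n; s≤s; _∸_)
  import Data.Nat.Properties as ℕ
  open import Data.Nat.ListAction using (sum)
  open import Data.Nat.Tactic.RingSolver using (solve-∀)
  open import Data.Bool using (if_then_else_)
  open import Data.List using (List; []; _∷_; _∷ʳ_; [_]; map; concatMap; length; upTo; applyUpTo)
  open import Data.List.Membership.Propositional using (_∈_)
  open import Data.List.Relation.Unary.Linked using (Linked)
  open import Relation.Binary.PropositionalEquality as ≡ using (_≡_; _≢_)
  open import Function using (_∘_)
  import Data.Integer as ℤ
  open import Defs using (schur; strips; range; sumL)

  open CommutativeRing R hiding (zero)
  open BigOperators R
  open NaturalSums
  open Partitions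
  open PunchIn using (punchIn; punchIn-below)
  open Determinant R
  open import Relation.Binary.Reasoning.Setoid setoid

  sumL-zeros : ∀ {A : Set} (xs : List A) → sumL R (map (λ _ → 0#) xs) ≈ 0#
  sumL-zeros []       = refl
  sumL-zeros (x ∷ xs) = trans (+-identityˡ _) (sumL-zeros xs)

  schur-PositiveAt : ∀ n ls x → PositiveAt n ls → schur R ls n x ≈ 0#
  schur-PositiveAt zero    []           x ()
  schur-PositiveAt zero    (zero ∷ ls)  x ()
  schur-PositiveAt zero    (suc l ∷ ls) x _   = refl
  schur-PositiveAt (suc n) ls           x pos = trans (sumL-map-cong (strips ls) (λ μ μ∈ →
    trans (*-congˡ (schur-PositiveAt n μ x (PositiveAt-choice n ls pos (∈choices⇒Pointwise (interlacingRanges ls) (≡.subst (μ ∈_) (strips≡choices ls) μ∈)))))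
          (zeroʳ _))) (sumL-zeros (strips ls))

  schur-∷ʳ0 : ∀ n ls x → schur R (ls ∷ʳ 0) n x ≈ schur R ls n x
  schur-∷ʳ0 zero    ls x = reflexive (≡.cong (λ b → if b then 1# else 0#) (allZero-∷ʳ0 ls))
  schur-∷ʳ0 (suc n) ls x = begin
    sumL R (map (λ μ → X ^ (sum (ls ∷ʳ 0) ∸ sum μ) * schur R μ n x) (strips (ls ∷ʳ 0)))
      ≡⟨ ≡.cong (λ S → sumL R (map (λ μ → X ^ (sum (ls ∷ʳ 0) ∸ sum μ) * schur R μ n x) S)) (strips-∷ʳ0 ls) ⟩
    sumL R (map (λ μ → X ^ (sum (ls ∷ʳ 0) ∸ sum μ) * schur R μ n x) (map (_∷ʳ 0) (strips ls)))
      ≡⟨ sumL-map-∘ (strips ls) (_∷ʳ 0) _ ⟩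
    sumL R (map (λ μ → X ^ (sum (ls ∷ʳ 0) ∸ sum (μ ∷ʳ 0)) * schur R (μ ∷ʳ 0) n x) (strips ls))
      ≈⟨ sumL-map-cong (strips ls) (λ μ _ → *-cong (reflexive (≡.cong₂ (λ u v → X ^ (u ∸ v)) (sum-∷ʳ0 ls) (sum-∷ʳ0 μ))) (schur-∷ʳ0 n μ x)) ⟩
    sumL R (map (λ μ → X ^ (sum ls ∸ sum μ) * schur R μ n x) (strips ls)) ∎
    where X = x (suc n)

  sumL-choices-∷ʳ : ∀ Cs D (f : List ℕ → Carrier) →
    sumL R (map f (choices (Cs ∷ʳ D))) ≈ sumL R (map (λ ms → sumL R (map (λ t → f (ms ∷ʳ t)) D)) (choices Cs))
  sumL-choices-∷ʳ []       D f = begin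
    sumL R (map f (concatMap (λ m → [ m ∷ [] ]) D)) ≈⟨ sumL-concatMap D (λ m → [ m ∷ [] ]) f ⟩
    sumL R (map (λ m → f [ m ] + 0#) D)            ≈⟨ sumL-map-cong D (λ m _ → +-identityʳ _) ⟩
    sumL R (map (λ m → f [ m ]) D)                 ≈⟨ +-identityʳ _ ⟨
    sumL R (map (λ m → f [ m ]) D) + 0#            ∎
  sumL-choices-∷ʳ (C ∷ Cs) D f = begin
    sumL R (map f (concatMap (λ m → map (m ∷_) (choices (Cs ∷ʳ D))) C))
      ≈⟨ sumL-concatMap C _ f ⟩
    sumL R (map (λ m → sumL R (map f (map (m ∷_) (choices (Cs ∷ʳ D))))) C)
      ≈⟨ sumL-map-cong C (λ m _ → trans (reflexive (sumL-map-∘ (choices (Cs ∷ʳ D)) (m ∷_) f)) (sumL-choices-∷ʳ Cs D (f ∘ (m ∷_)))) ⟩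
    sumL R (map (λ m → sumL R (map (λ ms → sumL R (map (λ t → f (m ∷ ms ∷ʳ t)) D)) (choices Cs))) C)
      ≈⟨ sumL-map-cong C (λ m _ → reflexive (≡.sym (sumL-map-∘ (choices Cs) (m ∷_) _))) ⟩
    sumL R (map (λ m → sumL R (map (λ ms → sumL R (map (λ t → f (ms ∷ʳ t)) D)) (map (m ∷_) (choices Cs)))) C)
      ≈⟨ sumL-concatMap C _ _ ⟨
    sumL R (map (λ ms → sumL R (map (λ t → f (ms ∷ʳ t)) D)) (choices (C ∷ Cs))) ∎

  [a-b]*∑bᵏaᵉ⁺ᵏ : ∀ a b e D →
    (a - b) * sumBelow D (λ k → b ^ (D ∸ suc k) * a ^ (e ℕ.+ k)) ≈ a ^ (D ℕ.+ e) - b ^ D * a ^ e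
  [a-b]*∑bᵏaᵉ⁺ᵏ a b e zero = begin
    (a - b) * 0#         ≈⟨ zeroʳ _ ⟩
    0#                   ≈⟨ -‿inverseʳ (a ^ e) ⟨
    a ^ e - a ^ e        ≈⟨ +-congˡ (-‿cong (*-identityˡ _)) ⟨
    a ^ e - 1# * a ^ e   ∎
  [a-b]*∑bᵏaᵉ⁺ᵏ a b e (suc D) = begin
    (a - b) * (sumBelow D f + f D)  ≈⟨ *-congˡ (+-cong (trans (sumBelow-cong D factor-b) (sym (*-distribˡ-sumBelow D b g))) lastTerm) ⟩
    (a - b) * (b * S + A)           ≈⟨ solve 4 (λ a b S A → (a :- b) :* (b :* S :+ A) := b :* ((a :- b) :* S) :+ (a :- b) :* A) refl a b S A ⟩
    b * ((a - b) * S) + (a - b) * A ≈⟨ +-congʳ (*-congˡ ([a-b]*∑bᵏaᵉ⁺ᵏ a b e D)) ⟩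
    b * (A - B * E) + (a - b) * A   ≈⟨ solve 5 (λ a b A B E → b :* (A :- B :* E) :+ (a :- b) :* A := a :* A :- (b :* B) :* E) refl a b A B E ⟩
    a * A - (b * B) * E             ∎
    where
    f g : ℕ → Carrier
    f k = b ^ (suc D ∸ suc k) * a ^ (e ℕ.+ k)
    g k = b ^ (D ∸ suc k) * a ^ (e ℕ.+ k)
    S = sumBelow D g
    A = a ^ (D ℕ.+ e)
    B = b ^ D
    E = a ^ e
    factor-b : ∀ k → k < D → f k ≈ b * g k
    factor-b k k<D = trans (*-congʳ (reflexive (≡.cong (b ^_) (n∸c≡1+n∸[1+c] D k k<D)))) (*-assoc _ _ _)
    lastTerm : f D ≈ A
    lastTerm = trans (*-cong (reflexive (≡.cong (b ^_) (ℕ.n∸n≡0 D))) (reflexive (≡.cong (a ^_) (ℕ.+-comm e D)))) (*-identityˡ _)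

  sumL-lastRange : ∀ n ms X x k (w : List ℕ → ℕ) → length ms ≡ n →
    sumL R (map (λ t → X ^ w (ms ∷ʳ t) * schur R (ms ∷ʳ t) n x) (range 0 k)) ≈ X ^ w (ms ∷ʳ 0) * schur R ms n x
  sumL-lastRange n ms X x k w len = begin
    G 0 + sumL R (map G (map (0 ℕ.+_) (applyUpTo suc k))) ≡⟨ ≡.cong (G 0 +_) (sumL-map-∘ (applyUpTo suc k) (0 ℕ.+_) G) ⟩
    G 0 + sumL R (map G (applyUpTo suc k))                ≈⟨ +-congˡ (sumL-applyUpTo k suc G) ⟩
    G 0 + sumBelow k (G ∘ suc)                             ≈⟨ +-congˡ (sumBelow-zero k _ (λ i _ → trans (*-congˡ (schur-PositiveAt n (ms ∷ʳ suc i) x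
                                                               (≡.subst (λ z → PositiveAt z (ms ∷ʳ suc i)) len (PositiveAt-∷ʳ ms (suc i) (s≤s z≤n))))) (zeroʳ _))) ⟩
    G 0 + 0#                                               ≈⟨ +-identityʳ _ ⟩
    X ^ w (ms ∷ʳ 0) * schur R (ms ∷ʳ 0) n x                ≈⟨ *-congˡ (schur-∷ʳ0 n ms x) ⟩
    X ^ w (ms ∷ʳ 0) * schur R ms n x                       ∎
    where
    G : ℕ → Carrier
    G t = X ^ w (ms ∷ʳ t) * schur R (ms ∷ʳ t) n x

  alternant : List ℕ → ℕ → (ℕ → Carrier) → Matrix
  alternant ls n x r c = x (suc r) ^ shiftedPart n ls c

  vandermonde : ℕ → (ℕ → Carrier) → Carrier
  vandermonde zero    x = 1#
  vandermonde (suc n) x = vandermonde n x * prodBelow n (λ r → x (suc r) - x (suc n))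

  -- Both sides reduce to one sum over the first n parts of the strips μ of λ: a
  -- strip with a positive (n+1)-st part contributes nothing in n variables. On the
  -- determinant side, subtracting X^(gap j) times column j + 1 from column j
  -- clears the last row except for the corner X^(λ_{n+1}), and every other entry
  -- becomes (x_r − X) times a geometric sum over the admissible values of μ_c,
  -- which then expands multilinearly.
  module BialternantStep (n l : ℕ) (ls' : List ℕ) (x : ℕ → Carrier) (len : length ls' ≡ n) (ls≥ : Linked _≥_ (l ∷ ls'))
    (hyp : ∀ ms → length ms ≡ n → Linked _≥_ ms → vandermonde n x * schur R ms n x ≈ det n (alternant ms n x)) where

    ls : List ℕ
    ls = l ∷ ls'

    X P : Carrier
    X = x (suc n)
    P = prodBelow n (λ r → x (suc r) - X)

    Cs : List (List ℕ)
    Cs = innerRanges ls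

    excess : List ℕ → ℕ
    excess ms = sumBelowℕ n (λ c → ls !! c ∸ ms !! c)

    reducedForm : Carrier
    reducedForm = P * sumL R (map (λ ms → X ^ lastPart ls * (X ^ excess ms * det n (alternant ms n x))) (choices Cs))

    interlaces : ∀ {ms} → ms ∈ choices Cs → Interlaces l ls' ms
    interlaces ms∈ = choice⇒Interlaces l ls' ls≥ (∈choices⇒Pointwise Cs ms∈)

    length-choice : ∀ {ms} → ms ∈ choices Cs → length ms ≡ n
    length-choice ms∈ = ≡.trans (Interlaces.length≡ (interlaces ms∈)) len

    X^removed : ∀ {ms} → ms ∈ choices Cs → X ^ (sum ls ∸ sum ms) ≈ X ^ lastPart ls * X ^ excess ms
    X^removed {ms} ms∈ = trans (reflexive (≡.cong (X ^_) removed≡)) (^-homo-* X (lastPart ls) (excess ms))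
      where
      open Interlaces (interlaces ms∈)
      removed≡ : sum ls ∸ sum ms ≡ lastPart ls ℕ.+ excess ms
      removed≡ = ≡.trans (≡.cong (_∸ sum ms) (sum-interlacing l ls' ms length≡ ≤above))
                   (≡.trans (ℕ.m+n∸n≡m _ (sum ms)) (≡.cong (λ z → lastPart ls ℕ.+ sumBelowℕ z (λ c → ls !! c ∸ ms !! c)) len))

    branchingSide : vandermonde (suc n) x * schur R ls (suc n) x ≈ reducedForm
    branchingSide = begin
      (vandermonde n x * P) * sumL R (map F (strips ls))
        ≡⟨ ≡.cong (λ S → (vandermonde n x * P) * sumL R (map F S)) (≡.trans (strips≡choices ls) (≡.cong choices (interlacingRanges-∷ʳ l ls'))) ⟩
      (vandermonde n x * P) * sumL R (map F (choices (Cs ∷ʳ range 0 (lastPart ls))))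
        ≈⟨ *-congˡ (sumL-choices-∷ʳ Cs (range 0 (lastPart ls)) F) ⟩
      (vandermonde n x * P) * sumL R (map (λ ms → sumL R (map (λ t → F (ms ∷ʳ t)) (range 0 (lastPart ls)))) (choices Cs))
        ≈⟨ *-congˡ (sumL-map-cong (choices Cs) (λ ms ms∈ → trans (sumL-lastRange n ms X x (lastPart ls) (λ μ → sum ls ∸ sum μ) (length-choice ms∈))
              (*-congʳ (reflexive (≡.cong (λ z → X ^ (sum ls ∸ z)) (sum-∷ʳ0 ms)))))) ⟩
      (vandermonde n x * P) * sumL R (map F (choices Cs))
        ≈⟨ trans (*-congʳ (*-comm _ _)) (trans (*-assoc _ _ _) (*-congˡ (*-distribˡ-sumL (choices Cs) (vandermonde n x) F))) ⟩
      P * sumL R (map (λ ms → vandermonde n x * F ms) (choices Cs))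
        ≈⟨ *-congˡ (sumL-map-cong (choices Cs) (λ ms ms∈ → begin
              vandermonde n x * (X ^ (sum ls ∸ sum ms) * schur R ms n x)
                ≈⟨ solve 3 (λ v p s → v :* (p :* s) := p :* (v :* s)) refl (vandermonde n x) _ _ ⟩
              X ^ (sum ls ∸ sum ms) * (vandermonde n x * schur R ms n x)
                ≈⟨ *-cong (X^removed ms∈) (hyp ms (length-choice ms∈) (Interlaces.decreasing (interlaces ms∈))) ⟩
              (X ^ lastPart ls * X ^ excess ms) * det n (alternant ms n x)
                ≈⟨ *-assoc _ _ _ ⟩
              X ^ lastPart ls * (X ^ excess ms * det n (alternant ms n x)) ∎)) ⟩
      reducedForm ∎
      where
      F : List ℕ → Carrier
      F μ = X ^ (sum ls ∸ sum μ) * schur R μ n x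

    A : Matrix
    A = alternant ls (suc n) x

    gap : ℕ → ℕ
    gap j = suc (ls !! j ∸ ls !! suc j)

    M' : Matrix
    M' = addNextColumns n (λ j → - X ^ gap j) A

    shiftedPart-gap : ∀ j → j < n → shiftedPart (suc n) ls j ≡ gap j ℕ.+ shiftedPart (suc n) ls (suc j)
    shiftedPart-gap j j<n = ≡.trans (≡.cong (ls !! j ℕ.+_) (n∸c≡1+n∸[1+c] n j j<n)) (rearrange lo≤hi)
      where
      lo≤hi : ls !! suc j ≤ ls !! j
      lo≤hi = !!-suc-≤ j ls≥ (s≤s (≡.subst (suc j ≤_) (≡.sym len) j<n))
      rearrange : ∀ {hi lo m} → lo ≤ hi → hi ℕ.+ suc m ≡ suc (hi ∸ lo) ℕ.+ (lo ℕ.+ m)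
      rearrange {hi} {lo} {m} lo≤hi = ≡.sym (≡.trans (≡.cong suc (≡.sym (ℕ.+-assoc (hi ∸ lo) lo m)))
        (≡.trans (≡.cong (λ z → suc (z ℕ.+ m)) (ℕ.m∸n+n≡m lo≤hi)) (≡.sym (ℕ.+-suc hi m))))

    lastRow-vanishes : ∀ j → j < n → M' n j ≈ 0#
    lastRow-vanishes j j<n = begin
      M' n j                                      ≡⟨ addNextColumns-< n _ A n j j<n ⟩
      X ^ shiftedPart (suc n) ls j + (- X ^ gap j) * X ^ e ≡⟨ ≡.cong (λ z → X ^ z + (- X ^ gap j) * X ^ e) (shiftedPart-gap j j<n) ⟩
      X ^ (gap j ℕ.+ e) + (- X ^ gap j) * X ^ e   ≈⟨ +-congʳ (^-homo-* X (gap j) e) ⟩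
      X ^ gap j * X ^ e + (- X ^ gap j) * X ^ e   ≈⟨ solve 2 (λ b e → b :* e :+ (:- b) :* e := con (ℤ.+ 0)) refl (X ^ gap j) (X ^ e) ⟩
      0#                                          ∎
      where e = shiftedPart (suc n) ls (suc j)

    G : ℕ → ℕ → ℕ → Carrier
    G c μ r = X ^ (ls !! c ∸ μ) * x (suc r) ^ (μ ℕ.+ (n ∸ suc c))

    H : Matrix
    H r c = sumL R (map (λ μ → G c μ r) (lookupOr [] Cs c))

    minor-factor : ∀ r c → r < n → c < n → deleteCol n M' r c ≈ (x (suc r) - X) * H r c
    minor-factor r c r<n c<n = begin
      M' r (punchIn n c)                  ≡⟨ ≡.cong (M' r) (punchIn-below n c c<n) ⟩
      M' r c                                      ≡⟨ addNextColumns-< n _ A r c c<n ⟩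
      y ^ shiftedPart (suc n) ls c + (- X ^ gap c) * y ^ e ≡⟨ ≡.cong (λ z → y ^ z + (- X ^ gap c) * y ^ e) (shiftedPart-gap c c<n) ⟩
      y ^ (gap c ℕ.+ e) + (- X ^ gap c) * y ^ e
        ≈⟨ solve 3 (λ u b v → u :+ (:- b) :* v := u :- b :* v) refl (y ^ (gap c ℕ.+ e)) (X ^ gap c) (y ^ e) ⟩
      y ^ (gap c ℕ.+ e) - X ^ gap c * y ^ e       ≈⟨ [a-b]*∑bᵏaᵉ⁺ᵏ y X e (gap c) ⟨
      (y - X) * sumBelow (gap c) (λ k → X ^ (gap c ∸ suc k) * y ^ (e ℕ.+ k)) ≈⟨ *-congˡ H-geometric ⟨
      (y - X) * H r c                             ∎
      where
      y = x (suc r)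
      lo = ls !! suc c
      e = shiftedPart (suc n) ls (suc c)
      H-geometric : H r c ≈ sumBelow (gap c) (λ k → X ^ (gap c ∸ suc k) * y ^ (e ℕ.+ k))
      H-geometric = begin
        sumL R (map (λ μ → G c μ r) (lookupOr [] Cs c))
          ≡⟨ ≡.cong (λ z → sumL R (map (λ μ → G c μ r) z)) (lookup-innerRanges ls c (s≤s (≡.subst (suc c ≤_) (≡.sym len) c<n))) ⟩
        sumL R (map (λ μ → G c μ r) (map (lo ℕ.+_) (upTo (gap c)))) ≡⟨ sumL-map-∘ (upTo (gap c)) (lo ℕ.+_) (λ μ → G c μ r) ⟩
        sumL R (map (λ k → G c (lo ℕ.+ k) r) (upTo (gap c))) ≈⟨ sumL-upTo (gap c) _ ⟩
        sumBelow (gap c) (λ k → G c (lo ℕ.+ k) r)       ≈⟨ sumBelow-cong (gap c) (λ k _ → reflexive (≡.cong₂ (λ u v → X ^ u * y ^ v)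
                                                              (≡.sym (ℕ.∸-+-assoc (ls !! c) lo k)) (swap₂₃ lo k (n ∸ suc c)))) ⟩
        sumBelow (gap c) (λ k → X ^ (gap c ∸ suc k) * y ^ (e ℕ.+ k)) ∎
        where
        swap₂₃ : ∀ a b m → a ℕ.+ b ℕ.+ m ≡ a ℕ.+ m ℕ.+ b
        swap₂₃ = solve-∀

    open Multilinear G

    determinantSide : det (suc n) A ≈ reducedForm
    determinantSide = begin
      det (suc n) A
        ≈⟨ det-addNextColumns (suc n) n _ A (ℕ.n<1+n n) ⟨
      det (suc n) M'
        ≈⟨ sumBelow-single (suc n) n (laplaceTerm n M') (ℕ.n<1+n n) (λ j j<1+n j≢n →
             trans (*-congˡ (trans (*-congʳ (lastRow-vanishes j (ℕ.≤∧≢⇒< (ℕ.≤-pred j<1+n) j≢n))) (zeroˡ _))) (zeroʳ _)) ⟩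
      ε (n ℕ.+ n) * (M' n n * det n (deleteCol n M'))
        ≈⟨ trans (*-congʳ (ε-double n)) (*-identityˡ _) ⟩
      M' n n * det n (deleteCol n M')
        ≈⟨ *-congʳ (reflexive (≡.trans (addNextColumns-≥ n _ A n n ℕ.≤-refl) (≡.cong (X ^_) cornerExponent))) ⟩
      X ^ lastPart ls * det n (deleteCol n M')
        ≈⟨ *-congˡ (det-scaleRows n (deleteCol n M') H (λ r → x (suc r) - X) minor-factor) ⟩
      X ^ lastPart ls * (P * det n H)
        ≈⟨ *-congˡ (*-congˡ (det-multilinear n Cs (≡.trans (length-innerRanges l ls') len))) ⟩
      X ^ lastPart ls * (P * sumL R (map (λ ms → det n (chosenMatrix ms)) (choices Cs)))
        ≈⟨ *-congˡ (*-congˡ (sumL-map-cong (choices Cs) (λ ms _ →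
             trans (det-scaleColumns n (chosenMatrix ms) (alternant ms n x) (λ c → X ^ (ls !! c ∸ ms !! c)) (λ _ _ _ _ → refl))
                   (*-congʳ (prodBelow-^ n X (λ c → ls !! c ∸ ms !! c)))))) ⟩
      X ^ lastPart ls * (P * sumL R (map (λ ms → X ^ excess ms * det n (alternant ms n x)) (choices Cs)))
        ≈⟨ trans (sym (*-assoc _ _ _)) (trans (*-congʳ (*-comm _ _)) (trans (*-assoc _ _ _) (*-congˡ (*-distribˡ-sumL (choices Cs) (X ^ lastPart ls) _)))) ⟩
      reducedForm ∎
      where
      cornerExponent : shiftedPart (suc n) ls n ≡ lastPart ls
      cornerExponent = ≡.trans (≡.cong (ls !! n ℕ.+_) (ℕ.n∸n≡0 n))
        (≡.trans (ℕ.+-identityʳ _) (≡.sym (≡.trans (lastPart≡!!length l ls') (≡.cong (ls !!_) len))))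

  bialternant : ∀ n ls x → length ls ≡ n → Linked _≥_ ls → vandermonde n x * schur R ls n x ≈ det n (alternant ls n x)
  bialternant zero    []        x _   _   = *-identityˡ _
  bialternant (suc n) (l ∷ ls') x len ls≥ = trans branchingSide (sym determinantSide)
    where open BialternantStep n l ls' x (ℕ.suc-injective len) ls≥ (λ ms → bialternant n ms x)

module GeometricSpecialisation {c ℓ} (R : CommutativeRing c ℓ) where

  open import Data.Nat as ℕ using (ℕ; zero; suc; _<_; _≤_; _≥_; z≤n; s≤s; _∸_)
  import Data.Nat.Properties as ℕ
  open import Data.List using (List; length)
  open import Data.List.Relation.Unary.Linked using (Linked)
  open import Relation.Binary.PropositionalEquality as ≡ using (_≡_; _≢_)
  open import Data.Empty using (⊥-elim)
  open import Function using (_∘_)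
  import Data.Integer as ℤ
  open import Defs using (schur; qPoch; Hq; prodTo)

  open CommutativeRing R hiding (zero)
  open BigOperators R
  open NaturalSums
  open Partitions using (shiftedPart; shiftedPart-antitone; weightedSize; sum-shiftedPart)
  open Determinant R
  open Bialternant R
  open import Relation.Binary.Reasoning.Setoid setoid

  ascendingVandermonde : ℕ → (ℕ → Carrier) → Carrier
  ascendingVandermonde zero    y = 1#
  ascendingVandermonde (suc n) y = ascendingVandermonde n y * prodBelow n (λ r → y n - y r)

  ε*prodBelow : ∀ k (f g : ℕ → Carrier) → (∀ r → r < k → g r ≈ - f r) → ε k * prodBelow k f ≈ prodBelow k g
  ε*prodBelow zero    f g g≈-f = *-identityˡ _
  ε*prodBelow (suc k) f g g≈-f = begin
    (- ε k) * (prodBelow k f * f k)  ≈⟨ solve 3 (λ e p x → (:- e) :* (p :* x) := (e :* p) :* (:- x)) refl (ε k) (prodBelow k f) (f k) ⟩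
    (ε k * prodBelow k f) * (- f k)  ≈⟨ *-cong (ε*prodBelow k f g (λ r r<k → g≈-f r (ℕ.m<n⇒m<1+n r<k))) (sym (g≈-f k (ℕ.n<1+n k))) ⟩
    prodBelow k g * g k              ∎

  det-vandermonde : ∀ n (y : ℕ → Carrier) → det n (λ r c → y r ^ c) ≈ ascendingVandermonde n y
  det-vandermonde zero    y = refl
  det-vandermonde (suc n) y = begin
    det (suc n) M                                   ≈⟨ det-addPreviousColumns n (λ _ → - y n) M ⟨
    det (suc n) M'                                  ≈⟨ sumBelow-single (suc n) 0 (laplaceTerm n M') (s≤s z≤n) lastRowOff ⟩
    ε (n ℕ.+ 0) * (M' n 0 * det n (deleteCol 0 M')) ≈⟨ *-congˡ (*-identityˡ _) ⟩
    ε (n ℕ.+ 0) * det n (deleteCol 0 M')            ≈⟨ *-congˡ (det-scaleRows n (deleteCol 0 M') (λ r c → y r ^ c) (λ r → y r - y n) minor-factor) ⟩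
    ε (n ℕ.+ 0) * (D * det n (λ r c → y r ^ c))     ≈⟨ *-congˡ (*-congˡ (det-vandermonde n y)) ⟩
    ε (n ℕ.+ 0) * (D * ascendingVandermonde n y)    ≈⟨ *-assoc _ _ _ ⟨
    (ε (n ℕ.+ 0) * D) * ascendingVandermonde n y    ≈⟨ *-congʳ (trans (reflexive (≡.cong (λ z → ε z * D) (ℕ.+-identityʳ n)))
                                                          (ε*prodBelow n _ _ (λ r _ → solve 2 (λ a b → b :- a := :- (a :- b)) refl (y r) (y n)))) ⟩
    prodBelow n (λ r → y n - y r) * ascendingVandermonde n y ≈⟨ *-comm _ _ ⟩
    ascendingVandermonde (suc n) y                  ∎
    where
    M : Matrix
    M r c = y r ^ c
    M' = addPreviousColumns 0 (λ _ → - y n) M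
    D = prodBelow n (λ r → y r - y n)
    lastRowOff : ∀ j → j < suc n → j ≢ 0 → laplaceTerm n M' j ≈ 0#
    lastRowOff zero    _ j≢0 = ⊥-elim (j≢0 ≡.refl)
    lastRowOff (suc j) _ _   = trans (*-congˡ (trans (*-congʳ entry≈0) (zeroˡ _))) (zeroʳ _)
      where
      entry≈0 : M' n (suc j) ≈ 0#
      entry≈0 = trans (reflexive (addPreviousColumns-> 0 (λ _ → - y n) M n (suc j) (s≤s z≤n)))
        (solve 2 (λ u v → u :* v :+ (:- u) :* v := con (ℤ.+ 0)) refl (y n) (y n ^ j))
    minor-factor : ∀ r c → r < n → c < n → deleteCol 0 M' r c ≈ (y r - y n) * y r ^ c
    minor-factor r c _ _ = trans (reflexive (addPreviousColumns-> 0 (λ _ → - y n) M r (suc c) (s≤s z≤n)))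
      (solve 3 (λ u w v → u :* v :+ (:- w) :* v := (u :- w) :* v) refl (y r) (y n) (y r ^ c))

  module _ (t : Carrier) where

    pairFactors : ℕ → (ℕ → ℕ) → Carrier
    pairFactors N f = prodBelow N (λ s → prodBelow s (λ r → 1# - t ^ (f r ∸ f s)))

    vandermondeRow-geometric : ∀ n → prodBelow n (λ r → t ^ suc r - t ^ suc n) ≈ t ^ triangle n * qPoch R t t n
    vandermondeRow-geometric n = begin
      prodBelow n (λ r → t ^ suc r - t ^ suc n)                    ≈⟨ prodBelow-cong n (λ r r<n → factor r r<n) ⟩
      prodBelow n (λ r → t ^ suc r * (1# - t ^ (n ∸ r)))            ≈⟨ prodBelow-* n _ _ ⟩
      prodBelow n (λ r → t ^ suc r) * prodBelow n (λ r → 1# - t ^ (n ∸ r)) ≈⟨ *-cong (prodBelow-^ n t suc) (reversed n) ⟩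
      t ^ triangle n * qPoch R t t n                               ∎
      where
      factor : ∀ r → r < n → t ^ suc r - t ^ suc n ≈ t ^ suc r * (1# - t ^ (n ∸ r))
      factor r r<n = begin
        t ^ suc r - t ^ suc n                    ≡⟨ ≡.cong (λ z → t ^ suc r - t ^ z) (≡.sym (ℕ.m+[n∸m]≡n (ℕ.<⇒≤ (s≤s r<n)))) ⟩
        t ^ suc r - t ^ (suc r ℕ.+ (n ∸ r))      ≈⟨ +-congˡ (-‿cong (^-homo-* t (suc r) (n ∸ r))) ⟩
        t ^ suc r - t ^ suc r * t ^ (n ∸ r)      ≈⟨ x-xy≈x[1-y] (t ^ suc r) (t ^ (n ∸ r)) ⟩
        t ^ suc r * (1# - t ^ (n ∸ r))           ∎
      reversed : ∀ n → prodBelow n (λ r → 1# - t ^ (n ∸ r)) ≈ qPoch R t t n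
      reversed zero    = refl
      reversed (suc n) = trans (prodBelow-unfoldˡ n _) (trans (*-comm _ _) (*-congʳ (reversed n)))

    vandermonde-geometric : ∀ n → vandermonde n (t ^_) ≈ t ^ tetrahedral n * prodBelow n (qPoch R t t)
    vandermonde-geometric zero    = sym (*-identityˡ _)
    vandermonde-geometric (suc n) = begin
      vandermonde n (t ^_) * prodBelow n (λ r → t ^ suc r - t ^ suc n)
        ≈⟨ *-cong (vandermonde-geometric n) (vandermondeRow-geometric n) ⟩
      (t ^ tetrahedral n * prodBelow n (qPoch R t t)) * (t ^ triangle n * qPoch R t t n)
        ≈⟨ solve 4 (λ a b c d → (a :* b) :* (c :* d) := (a :* c) :* (b :* d)) refl _ _ _ _ ⟩
      (t ^ tetrahedral n * t ^ triangle n) * (prodBelow n (qPoch R t t) * qPoch R t t n)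
        ≈⟨ *-congʳ (^-homo-* t (tetrahedral n) (triangle n)) ⟨
      t ^ tetrahedral (suc n) * prodBelow (suc n) (qPoch R t t) ∎

    prodBelow-qPoch≈Hq : ∀ N → prodBelow N (qPoch R t t) ≈ Hq R t N
    prodBelow-qPoch≈Hq zero    = refl
    prodBelow-qPoch≈Hq (suc N) = trans (prodBelow-unfoldˡ N (qPoch R t t)) (trans (*-identityˡ _) (shifted N))
      where
      shifted : ∀ M → prodBelow M (qPoch R t t ∘ suc) ≈ prodTo R M (qPoch R t t)
      shifted zero    = refl
      shifted (suc M) = *-congʳ (shifted M)

    det-alternant-geometric : ∀ N ls →
      det N (alternant ls N (t ^_)) ≈ prodBelow N (λ s → t ^ shiftedPart N ls s) * ascendingVandermonde N (λ s → t ^ shiftedPart N ls s)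
    det-alternant-geometric N ls = begin
      det N (transpose B)             ≈⟨ det-transpose N B ⟩
      det N B                         ≈⟨ det-scaleRows N B (λ r c → y r ^ c) y (λ r c _ _ → entry r c) ⟩
      prodBelow N y * det N (λ r c → y r ^ c) ≈⟨ *-congˡ (det-vandermonde N y) ⟩
      prodBelow N y * ascendingVandermonde N y ∎
      where
      y : ℕ → Carrier
      y s = t ^ shiftedPart N ls s
      B : Matrix
      B r c = (t ^ suc c) ^ shiftedPart N ls r
      entry : ∀ r c → B r c ≈ y r * y r ^ c
      entry r c = begin
        (t ^ suc c) ^ shiftedPart N ls r    ≈⟨ ^-assocʳ t (suc c) (shiftedPart N ls r) ⟩
        t ^ (suc c ℕ.* shiftedPart N ls r)  ≡⟨ ≡.cong (t ^_) (ℕ.*-comm (suc c) (shiftedPart N ls r)) ⟩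
        t ^ (shiftedPart N ls r ℕ.* suc c)  ≈⟨ ^-assocʳ t (shiftedPart N ls r) (suc c) ⟨
        y r ^ suc c                         ∎

    ascendingVandermonde-powers : ∀ n (f : ℕ → ℕ) → (∀ r s → r < s → s < n → f s ≤ f r) →
      ascendingVandermonde n (λ s → t ^ f s) ≈ t ^ sumBelowℕ n (λ s → s ℕ.* f s) * pairFactors n f
    ascendingVandermonde-powers zero    f f↓ = sym (*-identityˡ _)
    ascendingVandermonde-powers (suc n) f f↓ = begin
      ascendingVandermonde n (λ s → t ^ f s) * prodBelow n (λ r → t ^ f n - t ^ f r)
        ≈⟨ *-cong (ascendingVandermonde-powers n f (λ r s r<s s<n → f↓ r s r<s (ℕ.m<n⇒m<1+n s<n))) (prodBelow-cong n factor) ⟩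
      (t ^ E * pairFactors n f) * prodBelow n (λ r → t ^ f n * (1# - t ^ (f r ∸ f n)))
        ≈⟨ *-congˡ (prodBelow-* n _ _) ⟩
      (t ^ E * pairFactors n f) * (prodBelow n (λ _ → t ^ f n) * prodBelow n (λ r → 1# - t ^ (f r ∸ f n)))
        ≈⟨ *-congˡ (*-congʳ (trans (prodBelow-^ n t (λ _ → f n)) (reflexive (≡.cong (t ^_) (sumBelowℕ-const n (f n)))))) ⟩
      (t ^ E * pairFactors n f) * (t ^ (n ℕ.* f n) * prodBelow n (λ r → 1# - t ^ (f r ∸ f n)))
        ≈⟨ solve 4 (λ a b c d → (a :* b) :* (c :* d) := (a :* c) :* (b :* d)) refl _ _ _ _ ⟩
      (t ^ E * t ^ (n ℕ.* f n)) * pairFactors (suc n) f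
        ≈⟨ *-congʳ (^-homo-* t E (n ℕ.* f n)) ⟨
      t ^ sumBelowℕ (suc n) (λ s → s ℕ.* f s) * pairFactors (suc n) f ∎
      where
      E = sumBelowℕ n (λ s → s ℕ.* f s)
      factor : ∀ r → r < n → t ^ f n - t ^ f r ≈ t ^ f n * (1# - t ^ (f r ∸ f n))
      factor r r<n = begin
        t ^ f n - t ^ f r                      ≡⟨ ≡.cong (λ z → t ^ f n - t ^ z) (≡.sym (ℕ.m+[n∸m]≡n (f↓ r n r<n (ℕ.n<1+n n)))) ⟩
        t ^ f n - t ^ (f n ℕ.+ (f r ∸ f n))    ≈⟨ +-congˡ (-‿cong (^-homo-* t (f n) _)) ⟩
        t ^ f n - t ^ f n * t ^ (f r ∸ f n)    ≈⟨ x-xy≈x[1-y] _ _ ⟩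
        t ^ f n * (1# - t ^ (f r ∸ f n))       ∎

    t^tetrahedral*principalSpecialisation : ∀ N ls → length ls ≡ N → Linked _≥_ ls →
      t ^ tetrahedral N * (Hq R t N * schur R ls N (t ^_)) ≈ t ^ tetrahedral N * (t ^ weightedSize N ls * pairFactors N (shiftedPart N ls))
    t^tetrahedral*principalSpecialisation N ls len ls≥ = begin
      t ^ T * (Hq R t N * schur R ls N (t ^_))                  ≈⟨ *-congˡ (*-congʳ (prodBelow-qPoch≈Hq N)) ⟨
      t ^ T * (prodBelow N (qPoch R t t) * schur R ls N (t ^_)) ≈⟨ *-assoc _ _ _ ⟨
      (t ^ T * prodBelow N (qPoch R t t)) * schur R ls N (t ^_) ≈⟨ *-congʳ (vandermonde-geometric N) ⟨
      vandermonde N (t ^_) * schur R ls N (t ^_)                ≈⟨ bialternant N ls (t ^_) len ls≥ ⟩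
      det N (alternant ls N (t ^_))                             ≈⟨ det-alternant-geometric N ls ⟩
      prodBelow N y * ascendingVandermonde N y                  ≈⟨ *-cong (prodBelow-^ N t f)
                                                                     (ascendingVandermonde-powers N f (shiftedPart-antitone N ls len ls≥)) ⟩
      t ^ sumBelowℕ N f * (t ^ sumBelowℕ N (λ s → s ℕ.* f s) * pairFactors N f) ≈⟨ *-assoc _ _ _ ⟨
      (t ^ sumBelowℕ N f * t ^ sumBelowℕ N (λ s → s ℕ.* f s)) * pairFactors N f
        ≈⟨ *-congʳ (^-homo-* t (sumBelowℕ N f) (sumBelowℕ N (λ s → s ℕ.* f s))) ⟨
      t ^ (sumBelowℕ N f ℕ.+ sumBelowℕ N (λ s → s ℕ.* f s)) * pairFactors N f  ≡⟨ ≡.cong (λ e → t ^ e * pairFactors N f) (sum-shiftedPart N ls) ⟩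
      t ^ (T ℕ.+ weightedSize N ls) * pairFactors N f         ≈⟨ *-congʳ (^-homo-* t T (weightedSize N ls)) ⟩
      (t ^ T * t ^ weightedSize N ls) * pairFactors N f       ≈⟨ *-assoc _ _ _ ⟩
      t ^ T * (t ^ weightedSize N ls * pairFactors N f)       ∎
      where
      T = tetrahedral N
      f = shiftedPart N ls
      y : ℕ → Carrier
      y s = t ^ f s

-- q may be a zero divisor in R, so the power of q that specialising the
-- bialternant formula puts on both sides is cancelled in R[t] instead.
module Polynomials {c ℓ} (R : CommutativeRing c ℓ) where

  open import Data.Nat using (ℕ; zero; suc)
  open import Data.List using (List; []; _∷_; map)
  open import Data.Product using (_,_)
  import Data.Integer as ℤ
  open import Defs using (pow)

  open CommutativeRing R renaming (Carrier to A) hiding (zero)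
  open import Algebra.Properties.Ring ring using (-0#≈0#)
  open IntegerRingSolver R using (solve; _:=_; _:+_; _:*_; :-_; con)
  open import Relation.Binary.Reasoning.Setoid setoid

  Poly : Set c
  Poly = List A

  coeff : Poly → ℕ → A
  coeff []      _       = 0#
  coeff (a ∷ p) zero    = a
  coeff (a ∷ p) (suc n) = coeff p n

  infix 4 _≈ₚ_
  record _≈ₚ_ (p r : Poly) : Set ℓ where
    constructor coeffwise
    field at : ∀ n → coeff p n ≈ coeff r n
  open _≈ₚ_

  infixl 6 _+ₚ_
  infixl 7 _*ₚ_ _·ₛ_

  _+ₚ_ : Poly → Poly → Poly
  []      +ₚ r       = r
  (a ∷ p) +ₚ []      = a ∷ p
  (a ∷ p) +ₚ (b ∷ r) = a + b ∷ p +ₚ r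

  -ₚ_ : Poly → Poly
  -ₚ p = map -_ p

  _·ₛ_ : A → Poly → Poly
  a ·ₛ p = map (a *_) p

  _*ₚ_ : Poly → Poly → Poly
  []      *ₚ r = []
  (a ∷ p) *ₚ r = a ·ₛ r +ₚ (0# ∷ p *ₚ r)

  1ₚ Xₚ : Poly
  1ₚ = 1# ∷ []
  Xₚ = 0# ∷ 1# ∷ []

  coeff-+ : ∀ p r n → coeff (p +ₚ r) n ≈ coeff p n + coeff r n
  coeff-+ []      r       n       = sym (+-identityˡ _)
  coeff-+ (a ∷ p) []      zero    = sym (+-identityʳ _)
  coeff-+ (a ∷ p) []      (suc n) = sym (+-identityʳ _)
  coeff-+ (a ∷ p) (b ∷ r) zero    = refl
  coeff-+ (a ∷ p) (b ∷ r) (suc n) = coeff-+ p r n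

  coeff-‿ : ∀ p n → coeff (-ₚ p) n ≈ - coeff p n
  coeff-‿ []      n       = sym -0#≈0#
  coeff-‿ (a ∷ p) zero    = refl
  coeff-‿ (a ∷ p) (suc n) = coeff-‿ p n

  coeff-·ₛ : ∀ a p n → coeff (a ·ₛ p) n ≈ a * coeff p n
  coeff-·ₛ a []      n       = sym (zeroʳ a)
  coeff-·ₛ a (b ∷ p) zero    = refl
  coeff-·ₛ a (b ∷ p) (suc n) = coeff-·ₛ a p n

  coeff-*ₚ-zero : ∀ a p r → coeff ((a ∷ p) *ₚ r) zero ≈ a * coeff r zero
  coeff-*ₚ-zero a p r = trans (coeff-+ (a ·ₛ r) (0# ∷ p *ₚ r) zero) (trans (+-identityʳ _) (coeff-·ₛ a r zero))

  coeff-*ₚ-suc : ∀ a p r n → coeff ((a ∷ p) *ₚ r) (suc n) ≈ a * coeff r (suc n) + coeff (p *ₚ r) n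
  coeff-*ₚ-suc a p r n = trans (coeff-+ (a ·ₛ r) (0# ∷ p *ₚ r) (suc n)) (+-congʳ (coeff-·ₛ a r (suc n)))

  ≈ₚ-refl : ∀ {p} → p ≈ₚ p
  ≈ₚ-refl = coeffwise λ _ → refl

  ≈ₚ-sym : ∀ {p r} → p ≈ₚ r → r ≈ₚ p
  ≈ₚ-sym p≈r = coeffwise λ n → sym (at p≈r n)

  ≈ₚ-trans : ∀ {p r s} → p ≈ₚ r → r ≈ₚ s → p ≈ₚ s
  ≈ₚ-trans p≈r r≈s = coeffwise λ n → trans (at p≈r n) (at r≈s n)

  tailₚ : Poly → Poly
  tailₚ []      = []
  tailₚ (_ ∷ p) = p

  tail-≈ₚ : ∀ {p r} → p ≈ₚ r → tailₚ p ≈ₚ tailₚ r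
  tail-≈ₚ {[]}    {[]}    e = coeffwise λ n → at e (suc n)
  tail-≈ₚ {[]}    {_ ∷ _} e = coeffwise λ n → at e (suc n)
  tail-≈ₚ {_ ∷ _} {[]}    e = coeffwise λ n → at e (suc n)
  tail-≈ₚ {_ ∷ _} {_ ∷ _} e = coeffwise λ n → at e (suc n)

  ∷-cong : ∀ {a b p r} → a ≈ b → p ≈ₚ r → a ∷ p ≈ₚ b ∷ r
  ∷-cong a≈b p≈r = coeffwise λ { zero → a≈b ; (suc n) → at p≈r n }

  +ₚ-cong : ∀ {p p' r r'} → p ≈ₚ p' → r ≈ₚ r' → p +ₚ r ≈ₚ p' +ₚ r'
  +ₚ-cong {p} {p'} {r} {r'} p≈p' r≈r' =
    coeffwise λ n → trans (coeff-+ p r n) (trans (+-cong (at p≈p' n) (at r≈r' n)) (sym (coeff-+ p' r' n)))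

  -ₚ-cong : ∀ {p p'} → p ≈ₚ p' → -ₚ p ≈ₚ -ₚ p'
  -ₚ-cong {p} {p'} p≈p' = coeffwise λ n → trans (coeff-‿ p n) (trans (-‿cong (at p≈p' n)) (sym (coeff-‿ p' n)))

  ·ₛ-cong : ∀ {a b p p'} → a ≈ b → p ≈ₚ p' → a ·ₛ p ≈ₚ b ·ₛ p'
  ·ₛ-cong {a} {b} {p} {p'} a≈b p≈p' = coeffwise λ n → trans (coeff-·ₛ a p n) (trans (*-cong a≈b (at p≈p' n)) (sym (coeff-·ₛ b p' n)))

  zero-*ₚ : ∀ {p} r → p ≈ₚ [] → p *ₚ r ≈ₚ []
  zero-*ₚ {[]}    r p≈0 = ≈ₚ-refl
  zero-*ₚ {b ∷ p} r p≈0 = coeffwise λ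
    { zero    → trans (coeff-*ₚ-zero b p r) (b*≈0 _)
    ; (suc n) → trans (coeff-*ₚ-suc b p r n) (trans (+-cong (b*≈0 _) (at (zero-*ₚ {p} r (tail-≈ₚ p≈0)) n)) (+-identityˡ _)) }
    where
    b*≈0 : ∀ x → b * x ≈ 0#
    b*≈0 x = trans (*-congʳ (at p≈0 zero)) (zeroˡ x)

  *ₚ-congʳ : ∀ {p p'} r → p ≈ₚ p' → p *ₚ r ≈ₚ p' *ₚ r
  *ₚ-congʳ {[]}    {p'}     r p≈p' = ≈ₚ-sym (zero-*ₚ r (≈ₚ-sym p≈p'))
  *ₚ-congʳ {a ∷ p} {[]}     r p≈p' = zero-*ₚ r p≈p'
  *ₚ-congʳ {a ∷ p} {b ∷ p'} r p≈p' = +ₚ-cong (·ₛ-cong (at p≈p' zero) ≈ₚ-refl) (∷-cong refl (*ₚ-congʳ {p} {p'} r (tail-≈ₚ p≈p')))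

  *ₚ-congˡ : ∀ p {r r'} → r ≈ₚ r' → p *ₚ r ≈ₚ p *ₚ r'
  *ₚ-congˡ []      r≈r' = ≈ₚ-refl
  *ₚ-congˡ (a ∷ p) r≈r' = +ₚ-cong (·ₛ-cong refl r≈r') (∷-cong refl (*ₚ-congˡ p r≈r'))

  +ₚ-assoc : ∀ p r s → (p +ₚ r) +ₚ s ≈ₚ p +ₚ (r +ₚ s)
  +ₚ-assoc p r s = coeffwise λ n → begin
    coeff ((p +ₚ r) +ₚ s) n            ≈⟨ trans (coeff-+ (p +ₚ r) s n) (+-congʳ (coeff-+ p r n)) ⟩
    coeff p n + coeff r n + coeff s n  ≈⟨ +-assoc _ _ _ ⟩
    coeff p n + (coeff r n + coeff s n) ≈⟨ trans (coeff-+ p (r +ₚ s) n) (+-congˡ (coeff-+ r s n)) ⟨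
    coeff (p +ₚ (r +ₚ s)) n            ∎

  +ₚ-comm : ∀ p r → p +ₚ r ≈ₚ r +ₚ p
  +ₚ-comm p r = coeffwise λ n → trans (coeff-+ p r n) (trans (+-comm _ _) (sym (coeff-+ r p n)))

  +ₚ-identityʳ : ∀ p → p +ₚ [] ≈ₚ p
  +ₚ-identityʳ p = coeffwise λ n → trans (coeff-+ p [] n) (+-identityʳ _)

  -ₚ-inverseˡ : ∀ p → -ₚ p +ₚ p ≈ₚ []
  -ₚ-inverseˡ p = coeffwise λ n → trans (coeff-+ (-ₚ p) p n) (trans (+-congʳ (coeff-‿ p n)) (-‿inverseˡ _))

  -ₚ-inverseʳ : ∀ p → p +ₚ -ₚ p ≈ₚ []
  -ₚ-inverseʳ p = coeffwise λ n → trans (coeff-+ p (-ₚ p) n) (trans (+-congˡ (coeff-‿ p n)) (-‿inverseʳ _))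

  *ₚ-zeroʳ : ∀ p → p *ₚ [] ≈ₚ []
  *ₚ-zeroʳ []      = ≈ₚ-refl
  *ₚ-zeroʳ (a ∷ p) = coeffwise λ
    { zero    → trans (coeff-*ₚ-zero a p []) (zeroʳ a)
    ; (suc n) → trans (coeff-*ₚ-suc a p [] n) (trans (+-cong (zeroʳ a) (at (*ₚ-zeroʳ p) n)) (+-identityˡ _)) }

  *ₚ-distribʳ : ∀ r p s → (p +ₚ s) *ₚ r ≈ₚ p *ₚ r +ₚ s *ₚ r
  *ₚ-distribʳ r []      s       = ≈ₚ-refl
  *ₚ-distribʳ r (a ∷ p) []      = ≈ₚ-sym (+ₚ-identityʳ ((a ∷ p) *ₚ r))
  *ₚ-distribʳ r (a ∷ p) (b ∷ s) = coeffwise λ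
    { zero    → trans (coeff-*ₚ-zero (a + b) (p +ₚ s) r) (trans (distribʳ _ _ _)
                  (sym (trans (coeff-+ ((a ∷ p) *ₚ r) ((b ∷ s) *ₚ r) zero) (+-cong (coeff-*ₚ-zero a p r) (coeff-*ₚ-zero b s r)))))
    ; (suc n) → trans (coeff-*ₚ-suc (a + b) (p +ₚ s) r n)
                  (trans (+-cong (distribʳ _ _ _) (trans (at (*ₚ-distribʳ r p s) n) (coeff-+ (p *ₚ r) (s *ₚ r) n)))
                  (trans (interchange _ _ _ _)
                  (sym (trans (coeff-+ ((a ∷ p) *ₚ r) ((b ∷ s) *ₚ r) (suc n)) (+-cong (coeff-*ₚ-suc a p r n) (coeff-*ₚ-suc b s r n)))))) }
    where
    interchange : ∀ x y u v → (x + y) + (u + v) ≈ (x + u) + (y + v)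
    interchange = solve 4 (λ x y u v → (x :+ y) :+ (u :+ v) := (x :+ u) :+ (y :+ v)) refl

  *ₚ-distribˡ : ∀ p r s → p *ₚ (r +ₚ s) ≈ₚ p *ₚ r +ₚ p *ₚ s
  *ₚ-distribˡ []      r s = ≈ₚ-refl
  *ₚ-distribˡ (a ∷ p) r s = ≈ₚ-trans (+ₚ-cong (·ₛ-+ₚ a r s) (∷-cong (sym (+-identityʳ 0#)) (*ₚ-distribˡ p r s)))
                                     (+ₚ-interchange (a ·ₛ r) (a ·ₛ s) (0# ∷ p *ₚ r) (0# ∷ p *ₚ s))
    where
    ·ₛ-+ₚ : ∀ a r s → a ·ₛ (r +ₚ s) ≈ₚ a ·ₛ r +ₚ a ·ₛ s
    ·ₛ-+ₚ a r s = coeffwise λ n → trans (coeff-·ₛ a (r +ₚ s) n) (trans (*-congˡ (coeff-+ r s n)) (trans (distribˡ _ _ _)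
                    (sym (trans (coeff-+ (a ·ₛ r) (a ·ₛ s) n) (+-cong (coeff-·ₛ a r n) (coeff-·ₛ a s n))))))
    +ₚ-interchange : ∀ w x y z → (w +ₚ x) +ₚ (y +ₚ z) ≈ₚ (w +ₚ y) +ₚ (x +ₚ z)
    +ₚ-interchange w x y z = coeffwise λ n → trans (coeff-+ (w +ₚ x) (y +ₚ z) n) (trans (+-cong (coeff-+ w x n) (coeff-+ y z n))
      (trans (solve 4 (λ w x y z → (w :+ x) :+ (y :+ z) := (w :+ y) :+ (x :+ z)) refl _ _ _ _)
        (sym (trans (coeff-+ (w +ₚ y) (x +ₚ z) n) (+-cong (coeff-+ w y n) (coeff-+ x z n))))))

  ·ₛ-*ₚ : ∀ a p r → (a ·ₛ p) *ₚ r ≈ₚ a ·ₛ (p *ₚ r)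
  ·ₛ-*ₚ a []      r = ≈ₚ-refl
  ·ₛ-*ₚ a (b ∷ p) r = coeffwise λ
    { zero    → trans (coeff-*ₚ-zero (a * b) (a ·ₛ p) r) (trans (*-assoc _ _ _)
                  (sym (trans (coeff-·ₛ a ((b ∷ p) *ₚ r) zero) (*-congˡ (coeff-*ₚ-zero b p r)))))
    ; (suc n) → trans (coeff-*ₚ-suc (a * b) (a ·ₛ p) r n) (trans (+-cong (*-assoc _ _ _) (trans (at (·ₛ-*ₚ a p r) n) (coeff-·ₛ a (p *ₚ r) n)))
                  (sym (trans (coeff-·ₛ a ((b ∷ p) *ₚ r) (suc n)) (trans (*-congˡ (coeff-*ₚ-suc b p r n)) (distribˡ _ _ _))))) }

  0∷-*ₚ : ∀ p r → (0# ∷ p) *ₚ r ≈ₚ 0# ∷ p *ₚ r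
  0∷-*ₚ p r = coeffwise λ
    { zero    → trans (coeff-*ₚ-zero 0# p r) (zeroˡ _)
    ; (suc n) → trans (coeff-*ₚ-suc 0# p r n) (trans (+-congʳ (zeroˡ _)) (+-identityˡ _)) }

  *ₚ-assoc : ∀ p q r → (p *ₚ q) *ₚ r ≈ₚ p *ₚ (q *ₚ r)
  *ₚ-assoc []      q r = ≈ₚ-refl
  *ₚ-assoc (a ∷ p) q r = ≈ₚ-trans (*ₚ-distribʳ r (a ·ₛ q) (0# ∷ p *ₚ q))
    (+ₚ-cong (·ₛ-*ₚ a q r) (≈ₚ-trans (0∷-*ₚ (p *ₚ q) r) (∷-cong refl (*ₚ-assoc p q r))))

  *ₚ-∷ : ∀ r a p → r *ₚ (a ∷ p) ≈ₚ a ·ₛ r +ₚ (0# ∷ r *ₚ p)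
  *ₚ-∷ []      a p = coeffwise λ { zero → refl ; (suc n) → refl }
  *ₚ-∷ (b ∷ r) a p = coeffwise λ
    { zero    → trans (coeff-*ₚ-zero b r (a ∷ p))
                  (sym (trans (coeff-+ (a ·ₛ (b ∷ r)) (0# ∷ (b ∷ r) *ₚ p) zero) (trans (+-identityʳ _) (*-comm _ _))))
    ; (suc n) → trans (coeff-*ₚ-suc b r (a ∷ p) n)
                  (trans (+-congˡ (trans (at (*ₚ-∷ r a p) n) (trans (coeff-+ (a ·ₛ r) (0# ∷ r *ₚ p) n) (+-congʳ (coeff-·ₛ a r n)))))
                  (trans (solve 3 (λ x y z → x :+ (y :+ z) := y :+ (x :+ z)) refl (b * coeff p n) (a * coeff r n) (coeff (0# ∷ r *ₚ p) n))
                  (sym (trans (coeff-+ (a ·ₛ (b ∷ r)) (0# ∷ (b ∷ r) *ₚ p) (suc n)) (+-cong (coeff-·ₛ a r n) (shifted n)))))) }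
    where
    shifted : ∀ n → coeff ((b ∷ r) *ₚ p) n ≈ b * coeff p n + coeff (0# ∷ r *ₚ p) n
    shifted zero    = trans (coeff-*ₚ-zero b r p) (sym (+-identityʳ _))
    shifted (suc n) = coeff-*ₚ-suc b r p n

  *ₚ-comm : ∀ p r → p *ₚ r ≈ₚ r *ₚ p
  *ₚ-comm []      r = ≈ₚ-sym (*ₚ-zeroʳ r)
  *ₚ-comm (a ∷ p) r = ≈ₚ-trans (+ₚ-cong ≈ₚ-refl (∷-cong refl (*ₚ-comm p r))) (≈ₚ-sym (*ₚ-∷ r a p))

  *ₚ-identityˡ : ∀ p → 1ₚ *ₚ p ≈ₚ p
  *ₚ-identityˡ p = coeffwise λ
    { zero    → trans (coeff-*ₚ-zero 1# [] p) (*-identityˡ _)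
    ; (suc n) → trans (coeff-*ₚ-suc 1# [] p n) (trans (+-identityʳ _) (*-identityˡ _)) }

  polynomialRing : CommutativeRing c ℓ
  polynomialRing = record
    { Carrier = Poly ; _≈_ = _≈ₚ_ ; _+_ = _+ₚ_ ; _*_ = _*ₚ_ ; -_ = -ₚ_ ; 0# = [] ; 1# = 1ₚ
    ; isCommutativeRing = record
      { isRing = record
        { +-isAbelianGroup = record
          { isGroup = record
            { isMonoid = record
              { isSemigroup = record
                { isMagma = record
                  { isEquivalence = record { refl = ≈ₚ-refl ; sym = ≈ₚ-sym ; trans = ≈ₚ-trans }
                  ; ∙-cong = +ₚ-cong }
                ; assoc = +ₚ-assoc }
              ; identity = (λ _ → ≈ₚ-refl) , +ₚ-identityʳ }
            ; inverse = -ₚ-inverseˡ , -ₚ-inverseʳ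
            ; ⁻¹-cong = -ₚ-cong }
          ; comm = +ₚ-comm }
        ; *-cong = λ {p} {p'} {r} p≈p' r≈r' → ≈ₚ-trans (*ₚ-congʳ r p≈p') (*ₚ-congˡ p' r≈r')
        ; *-assoc = *ₚ-assoc
        ; *-identity = *ₚ-identityˡ , (λ p → ≈ₚ-trans (*ₚ-comm p 1ₚ) (*ₚ-identityˡ p))
        ; distrib = *ₚ-distribˡ , *ₚ-distribʳ }
      ; *-comm = *ₚ-comm } }

  Xₚ*ₚ : ∀ p → Xₚ *ₚ p ≈ₚ 0# ∷ p
  Xₚ*ₚ p = ≈ₚ-trans (0∷-*ₚ (1ₚ) p) (∷-cong refl (*ₚ-identityˡ p))

  Xₚ^-cancelˡ : ∀ k p r → pow polynomialRing Xₚ k *ₚ p ≈ₚ pow polynomialRing Xₚ k *ₚ r → p ≈ₚ r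
  Xₚ^-cancelˡ zero    p r 1p≈1r = ≈ₚ-trans (≈ₚ-sym (*ₚ-identityˡ p)) (≈ₚ-trans 1p≈1r (*ₚ-identityˡ r))
  Xₚ^-cancelˡ (suc k) p r e = Xₚ^-cancelˡ k p r (tail-≈ₚ (≈ₚ-trans (≈ₚ-sym (shift p)) (≈ₚ-trans e (shift r))))
    where
    shift : ∀ s → (Xₚ *ₚ pow polynomialRing Xₚ k) *ₚ s ≈ₚ 0# ∷ pow polynomialRing Xₚ k *ₚ s
    shift s = ≈ₚ-trans (*ₚ-assoc Xₚ (pow polynomialRing Xₚ k) s) (Xₚ*ₚ (pow polynomialRing Xₚ k *ₚ s))

  module Evaluation (q : A) where

    eval : Poly → A
    eval []      = 0#
    eval (a ∷ p) = a + q * eval p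

    eval-cong : ∀ {p r} → p ≈ₚ r → eval p ≈ eval r
    eval-cong {[]}    {[]}    _   = refl
    eval-cong {[]}    {b ∷ r} p≈r = sym (trans (+-cong (sym (at p≈r zero)) (trans (*-congˡ (sym (eval-cong {[]} {r} (tail-≈ₚ p≈r)))) (zeroʳ q))) (+-identityˡ _))
    eval-cong {a ∷ p} {[]}    p≈r = trans (+-cong (at p≈r zero) (trans (*-congˡ (eval-cong {p} {[]} (tail-≈ₚ p≈r))) (zeroʳ q))) (+-identityˡ _)
    eval-cong {a ∷ p} {b ∷ r} p≈r = +-cong (at p≈r zero) (*-congˡ (eval-cong {p} {r} (tail-≈ₚ p≈r)))

    eval-+ : ∀ p r → eval (p +ₚ r) ≈ eval p + eval r
    eval-+ []      r       = sym (+-identityˡ _)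
    eval-+ (a ∷ p) []      = sym (+-identityʳ _)
    eval-+ (a ∷ p) (b ∷ r) = trans (+-congˡ (*-congˡ (eval-+ p r)))
      (solve 5 (λ a b q x y → a :+ b :+ q :* (x :+ y) := a :+ q :* x :+ (b :+ q :* y)) refl a b q (eval p) (eval r))

    eval-‿ : ∀ p → eval (-ₚ p) ≈ - eval p
    eval-‿ []      = sym -0#≈0#
    eval-‿ (a ∷ p) = trans (+-congˡ (*-congˡ (eval-‿ p))) (solve 3 (λ a q x → :- a :+ q :* (:- x) := :- (a :+ q :* x)) refl a q (eval p))

    eval-·ₛ : ∀ a p → eval (a ·ₛ p) ≈ a * eval p
    eval-·ₛ a []      = sym (zeroʳ a)
    eval-·ₛ a (b ∷ p) = trans (+-congˡ (*-congˡ (eval-·ₛ a p))) (solve 4 (λ a b q x → a :* b :+ q :* (a :* x) := a :* (b :+ q :* x)) refl a b q (eval p))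

    eval-* : ∀ p r → eval (p *ₚ r) ≈ eval p * eval r
    eval-* []      r = sym (zeroˡ _)
    eval-* (a ∷ p) r = trans (eval-+ (a ·ₛ r) (0# ∷ p *ₚ r)) (trans (+-cong (eval-·ₛ a r) (+-congˡ (*-congˡ (eval-* p r))))
      (solve 4 (λ a q x y → a :* y :+ (con (ℤ.+ 0) :+ q :* (x :* y)) := (a :+ q :* x) :* y) refl a q (eval p) (eval r)))

    eval-1 : eval 1ₚ ≈ 1#
    eval-1 = trans (+-congˡ (zeroʳ q)) (+-identityʳ _)

    eval-Xₚ : eval Xₚ ≈ q
    eval-Xₚ = trans (+-identityˡ _) (trans (*-congˡ eval-1) (*-identityʳ q))

module PrincipalSpecialisation {c ℓ} (R : CommutativeRing c ℓ) where

  open import Data.Nat using (ℕ; zero; suc; _≥_; _∸_)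
  open import Data.Nat.ListAction using (sum)
  open import Data.Bool using (true; false)
  open import Data.List using (List; []; _∷_; map; length)
  open import Data.List.Relation.Unary.Linked using (Linked)
  open import Relation.Binary.PropositionalEquality using (_≡_)
  open import Function using (_∘_)
  open import Defs using (schur; strips; allZero; sumL; prodTo; qPoch; Hq)

  open CommutativeRing R renaming (Carrier to A) hiding (zero)
  open BigOperators R
  open NaturalSums using (tetrahedral)
  open Partitions using (shiftedPart; weightedSize)
  open Polynomials R
  open GeometricSpecialisation R using (pairFactors)
  module ℙ = BigOperators polynomialRing
  module ℙ-geometric = GeometricSpecialisation polynomialRing
  open import Relation.Binary.Reasoning.Setoid setoid

  prodTo-cong : ∀ n {f g : ℕ → A} → (∀ i → f i ≈ g i) → prodTo R n f ≈ prodTo R n g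
  prodTo-cong zero    f≈g = refl
  prodTo-cong (suc n) f≈g = *-cong (prodTo-cong n f≈g) (f≈g (suc n))

  qPoch-cong : ∀ {x x' y y'} k → x ≈ x' → y ≈ y' → qPoch R x y k ≈ qPoch R x' y' k
  qPoch-cong zero    x≈x' y≈y' = refl
  qPoch-cong (suc k) x≈x' y≈y' = *-cong (qPoch-cong k x≈x' y≈y') (+-congˡ (-‿cong (*-cong x≈x' (^-congˡ k y≈y'))))

  Hq-cong : ∀ {y y'} N → y ≈ y' → Hq R y N ≈ Hq R y' N
  Hq-cong N y≈y' = prodTo-cong (N ∸ 1) (λ k → qPoch-cong k y≈y' y≈y')

  schur-cong : ∀ N ls {x x' : ℕ → A} → (∀ i → x i ≈ x' i) → schur R ls N x ≈ schur R ls N x'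
  schur-cong zero    ls x≈x' = refl
  schur-cong (suc N) ls x≈x' = sumL-map-cong (strips ls) (λ μ _ → *-cong (^-congˡ (sum ls ∸ sum μ) (x≈x' (suc N))) (schur-cong N μ x≈x'))

  module _ (q : A) where
    open Evaluation q

    eval-- : ∀ p r → eval (p +ₚ (-ₚ r)) ≈ eval p - eval r
    eval-- p r = trans (eval-+ p (-ₚ r)) (+-congˡ (eval-‿ r))

    eval-^ : ∀ p n → eval (p ℙ.^ n) ≈ eval p ^ n
    eval-^ p zero    = eval-1
    eval-^ p (suc n) = trans (eval-* p (p ℙ.^ n)) (*-congˡ (eval-^ p n))

    eval-Xₚ^ : ∀ n → eval (Xₚ ℙ.^ n) ≈ q ^ n
    eval-Xₚ^ n = trans (eval-^ Xₚ n) (^-congˡ n eval-Xₚ)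

    eval-prodBelow : ∀ n f → eval (ℙ.prodBelow n f) ≈ prodBelow n (eval ∘ f)
    eval-prodBelow zero    f = eval-1
    eval-prodBelow (suc n) f = trans (eval-* (ℙ.prodBelow n f) (f n)) (*-congʳ (eval-prodBelow n f))

    eval-prodTo : ∀ n f → eval (prodTo polynomialRing n f) ≈ prodTo R n (eval ∘ f)
    eval-prodTo zero    f = eval-1
    eval-prodTo (suc n) f = trans (eval-* (prodTo polynomialRing n f) (f (suc n))) (*-congʳ (eval-prodTo n f))

    eval-qPoch : ∀ x y k → eval (qPoch polynomialRing x y k) ≈ qPoch R (eval x) (eval y) k
    eval-qPoch x y zero    = eval-1
    eval-qPoch x y (suc k) = trans (eval-* (qPoch polynomialRing x y k) _) (*-cong (eval-qPoch x y k)
      (trans (eval-- 1ₚ (x *ₚ y ℙ.^ k)) (+-cong eval-1 (-‿cong (trans (eval-* x (y ℙ.^ k)) (*-congˡ (eval-^ y k)))))))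

    eval-Hq : ∀ y N → eval (Hq polynomialRing y N) ≈ Hq R (eval y) N
    eval-Hq y N = trans (eval-prodTo (N ∸ 1) _) (prodTo-cong (N ∸ 1) (λ k → eval-qPoch y y k))

    eval-sumL : ∀ xs → eval (sumL polynomialRing xs) ≈ sumL R (map eval xs)
    eval-sumL []       = refl
    eval-sumL (p ∷ xs) = trans (eval-+ p (sumL polynomialRing xs)) (+-congˡ (eval-sumL xs))

    eval-schur : ∀ N ls f → eval (schur polynomialRing ls N f) ≈ schur R ls N (eval ∘ f)
    eval-schur zero    ls f with allZero ls
    ... | true  = eval-1
    ... | false = refl
    eval-schur (suc N) ls f = begin
      eval (sumL polynomialRing (map term (strips ls))) ≈⟨ eval-sumL (map term (strips ls)) ⟩
      sumL R (map eval (map term (strips ls)))          ≡⟨ sumL-map-∘ (strips ls) term eval ⟩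
      sumL R (map (eval ∘ term) (strips ls))            ≈⟨ sumL-map-cong (strips ls) (λ μ _ →
                                                            trans (eval-* (f (suc N) ℙ.^ (sum ls ∸ sum μ)) (schur polynomialRing μ N f))
                                                                  (*-cong (eval-^ (f (suc N)) (sum ls ∸ sum μ)) (eval-schur N μ f))) ⟩
      schur R ls (suc N) (eval ∘ f)                     ∎
      where
      term : List ℕ → Poly
      term μ = f (suc N) ℙ.^ (sum ls ∸ sum μ) *ₚ schur polynomialRing μ N f

    eval-pairFactors : ∀ N f → eval (ℙ-geometric.pairFactors Xₚ N f) ≈ pairFactors q N f
    eval-pairFactors N f = trans (eval-prodBelow N _) (prodBelow-cong N (λ s _ → trans (eval-prodBelow s _) (prodBelow-cong s (λ r _ →
      trans (eval-- 1ₚ (Xₚ ℙ.^ (f r ∸ f s))) (+-cong eval-1 (-‿cong (eval-Xₚ^ (f r ∸ f s))))))))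

    principalSpecialisation : ∀ N ls → length ls ≡ N → Linked _≥_ ls →
      Hq R q N * schur R ls N (q ^_) ≈ q ^ weightedSize N ls * pairFactors q N (shiftedPart N ls)
    principalSpecialisation N ls len ls≥ = begin
      Hq R q N * schur R ls N (q ^_)
        ≈⟨ *-cong (trans (eval-Hq Xₚ N) (Hq-cong N eval-Xₚ)) (trans (eval-schur N ls (Xₚ ℙ.^_)) (schur-cong N ls eval-Xₚ^)) ⟨
      eval (Hq polynomialRing Xₚ N) * eval (schur polynomialRing ls N (Xₚ ℙ.^_))
        ≈⟨ eval-* (Hq polynomialRing Xₚ N) (schur polynomialRing ls N (Xₚ ℙ.^_)) ⟨
      eval (Hq polynomialRing Xₚ N *ₚ schur polynomialRing ls N (Xₚ ℙ.^_))
        ≈⟨ eval-cong (Xₚ^-cancelˡ (tetrahedral N) _ _ (ℙ-geometric.t^tetrahedral*principalSpecialisation Xₚ N ls len ls≥)) ⟩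
      eval (Xₚ ℙ.^ weightedSize N ls *ₚ ℙ-geometric.pairFactors Xₚ N (shiftedPart N ls))
        ≈⟨ eval-* (Xₚ ℙ.^ weightedSize N ls) (ℙ-geometric.pairFactors Xₚ N (shiftedPart N ls)) ⟩
      eval (Xₚ ℙ.^ weightedSize N ls) * eval (ℙ-geometric.pairFactors Xₚ N (shiftedPart N ls))
        ≈⟨ *-cong (eval-Xₚ^ (weightedSize N ls)) (eval-pairFactors N (shiftedPart N ls)) ⟩
      q ^ weightedSize N ls * pairFactors q N (shiftedPart N ls) ∎

module Subsets where

  open import Data.Nat as ℕ using (ℕ; zero; suc; _+_; _*_; _<_; _≤_; _≥_; z≤n; s≤s; _∸_)
  import Data.Nat.Properties as ℕ
  open import Data.Nat.ListAction using (sum)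
  open import Data.Nat.Combinatorics using (_C_; nC1≡n; nCk+nC[k+1]≡[n+1]C[k+1])
  open import Data.Nat.Tactic.RingSolver using (solve-∀)
  open import Data.Bool using (Bool; true; false; not; _∧_; _∨_)
  open import Data.List as List using (List; []; _∷_; _++_; _∷ʳ_; [_]; map; length; upTo; reverse; reverseAcc; replicate)
  import Data.List.Properties as List
  open import Data.List.Membership.Propositional using (_∈_)
  open import Data.List.Membership.Propositional.Properties using (∈-map⁻)
  open import Data.List.Relation.Unary.Any using (here; there)
  open import Data.List.Relation.Unary.Linked using (Linked; []; [-]; _∷_)
  open import Data.Vec as Vec using (Vec; []; _∷_)
  import Data.Vec.Properties as Vec
  open import Data.Fin.Subset using (Subset; ∣_∣; ∁; _∩_; _∪_; ⊤) renaming (⊥ to ∅)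
  open import Data.Product using (_,_)
  open import Relation.Binary.PropositionalEquality as ≡ using (_≡_)
  open import Data.Sum using (inj₁; inj₂)
  open import Function using (_∘′_)
  open import Data.Fin.Subset.Properties using (∣⊤∣≡n; ∣∁p∣≡n∸∣p∣)
  open ≡.≡-Reasoning
  open import Defs using (lam; elems)
  open NaturalSums
  open Partitions using (_!!_; !!-++ˡ; !!-++-length; shiftedPart; weightedSize; n∸c≡1+n∸[1+c])

  -- Defs keeps the index shift inside lam private. Abstracting over the rest of
  -- the unfolding of lam leaves the pattern constraint  subtractIndices i xs = shift i xs,
  -- which unification solves with the private shift.
  mutual
    subtractIndices : ℕ → List ℕ → List ℕ
    subtractIndices = _

    lam-unfold : ∀ {N} (X : Vec Bool N) → lam X ≡ reverse (subtractIndices 1 (elems X))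
    lam-unfold X with elems X | 1 | List.foldl {A = List ℕ} {B = ℕ} (λ ys y → y ∷ ys) []
    ... | xs | i | rev = ≡.refl

  -- 0-based, unlike Defs.elems.
  positions : ∀ {L} → Vec Bool L → List ℕ
  positions []          = []
  positions (true ∷ X)  = 0 ∷ map suc (positions X)
  positions (false ∷ X) = map suc (positions X)

  gapsBefore : ∀ {L} → Vec Bool L → List ℕ
  gapsBefore []          = []
  gapsBefore (true ∷ X)  = 0 ∷ gapsBefore X
  gapsBefore (false ∷ X) = map suc (gapsBefore X)

  addIndices : ℕ → List ℕ → List ℕ
  addIndices i []       = []
  addIndices i (y ∷ ys) = y + i ∷ addIndices (suc i) ys

  elems≡map-suc-positions : ∀ {L} (X : Vec Bool L) → elems X ≡ map suc (positions X)
  elems≡map-suc-positions []          = ≡.refl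
  elems≡map-suc-positions (true ∷ X)  = ≡.cong (λ z → 1 ∷ map suc z) (elems≡map-suc-positions X)
  elems≡map-suc-positions (false ∷ X) = ≡.cong (map suc) (elems≡map-suc-positions X)

  addIndices-suc : ∀ i ys → addIndices (suc i) ys ≡ map suc (addIndices i ys)
  addIndices-suc i []       = ≡.refl
  addIndices-suc i (y ∷ ys) = ≡.cong₂ _∷_ (ℕ.+-suc y i) (addIndices-suc (suc i) ys)

  addIndices-map-suc : ∀ i ys → addIndices i (map suc ys) ≡ map suc (addIndices i ys)
  addIndices-map-suc i []       = ≡.refl
  addIndices-map-suc i (y ∷ ys) = ≡.cong (suc (y + i) ∷_) (addIndices-map-suc (suc i) ys)

  addIndices-gapsBefore : ∀ {L} (X : Vec Bool L) → addIndices 0 (gapsBefore X) ≡ positions X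
  addIndices-gapsBefore []          = ≡.refl
  addIndices-gapsBefore (true ∷ X)  = ≡.cong (0 ∷_) (≡.trans (addIndices-suc 0 (gapsBefore X)) (≡.cong (map suc) (addIndices-gapsBefore X)))
  addIndices-gapsBefore (false ∷ X) = ≡.trans (addIndices-map-suc 0 (gapsBefore X)) (≡.cong (map suc) (addIndices-gapsBefore X))

  subtractIndices-map-suc : ∀ i xs → subtractIndices (suc i) (map suc xs) ≡ subtractIndices i xs
  subtractIndices-map-suc i []       = ≡.refl
  subtractIndices-map-suc i (x ∷ xs) = ≡.cong (x ∸ i ∷_) (subtractIndices-map-suc (suc i) xs)

  subtractIndices-addIndices : ∀ i ys → subtractIndices i (addIndices i ys) ≡ ys
  subtractIndices-addIndices i []       = ≡.refl
  subtractIndices-addIndices i (y ∷ ys) = ≡.cong₂ _∷_ (ℕ.m+n∸n≡m y i) (subtractIndices-addIndices (suc i) ys)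

  lam≡reverse-gapsBefore : ∀ {L} (X : Vec Bool L) → lam X ≡ reverse (gapsBefore X)
  lam≡reverse-gapsBefore X = begin
    lam X                                                      ≡⟨ lam-unfold X ⟩
    reverse (subtractIndices 1 (elems X))                      ≡⟨ ≡.cong (reverse ∘′ subtractIndices 1) (elems≡map-suc-positions X) ⟩
    reverse (subtractIndices 1 (map suc (positions X)))        ≡⟨ ≡.cong reverse (subtractIndices-map-suc 0 (positions X)) ⟩
    reverse (subtractIndices 0 (positions X))                  ≡⟨ ≡.cong (reverse ∘′ subtractIndices 0) (addIndices-gapsBefore X) ⟨
    reverse (subtractIndices 0 (addIndices 0 (gapsBefore X)))  ≡⟨ ≡.cong reverse (subtractIndices-addIndices 0 (gapsBefore X)) ⟩
    reverse (gapsBefore X)                                     ∎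

  length-gapsBefore : ∀ {L} (X : Vec Bool L) → length (gapsBefore X) ≡ ∣ X ∣
  length-gapsBefore []          = ≡.refl
  length-gapsBefore (true ∷ X)  = ≡.cong suc (length-gapsBefore X)
  length-gapsBefore (false ∷ X) = ≡.trans (List.length-map suc (gapsBefore X)) (length-gapsBefore X)

  length-addIndices : ∀ i ys → length (addIndices i ys) ≡ length ys
  length-addIndices i []       = ≡.refl
  length-addIndices i (y ∷ ys) = ≡.cong suc (length-addIndices (suc i) ys)

  gapsBefore-increasing : ∀ {L} (X : Vec Bool L) → Linked _≤_ (gapsBefore X)
  gapsBefore-increasing []          = []
  gapsBefore-increasing (true ∷ X)  with gapsBefore X | gapsBefore-increasing X
  ... | []     | _  = [-]
  ... | y ∷ ys | ys≤ = z≤n ∷ ys≤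
  gapsBefore-increasing (false ∷ X) = map-suc (gapsBefore-increasing X)
    where
    map-suc : ∀ {ys} → Linked _≤_ ys → Linked _≤_ (map suc ys)
    map-suc []          = []
    map-suc [-]         = [-]
    map-suc (y≤y' ∷ ys≤) = s≤s y≤y' ∷ map-suc ys≤

  reverse-increasing : ∀ {ys} → Linked _≤_ ys → Linked _≥_ (reverse ys)
  reverse-increasing []          = []
  reverse-increasing [-]         = [-]
  reverse-increasing (y≤y' ∷ ys≤) = onto ys≤ (y≤y' ∷ [-])
    where
    onto : ∀ {x xs acc} → Linked _≤_ (x ∷ xs) → Linked _≥_ (x ∷ acc) → Linked _≥_ (reverseAcc (x ∷ acc) xs)
    onto [-]          acc≥ = acc≥
    onto (x≤x' ∷ xs≤) acc≥ = onto xs≤ (x≤x' ∷ acc≥)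

  revWeight : List ℕ → ℕ
  revWeight []       = 0
  revWeight (y ∷ ys) = suc (length ys) * y + revWeight ys

  weightedSize-reverse : ∀ ys → weightedSize (length ys) (reverse ys) ≡ revWeight ys
  weightedSize-reverse []       = ≡.refl
  weightedSize-reverse (y ∷ ys) = begin
    sumBelowℕ k (λ s → suc s * reverse (y ∷ ys) !! s) + suc k * reverse (y ∷ ys) !! k
      ≡⟨ ≡.cong₂ _+_ (sumBelowℕ-cong k (λ s s<k → ≡.cong (suc s *_) (≡.trans (≡.cong (_!! s) (List.unfold-reverse y ys))
                                                   (!!-++ˡ (reverse ys) [ y ] s (≡.subst (s <_) (≡.sym (List.length-reverse ys)) s<k)))))
                     (≡.cong (suc k *_) (≡.trans (≡.cong (_!! k) (List.unfold-reverse y ys))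
                                                  (≡.subst (λ j → (reverse ys ∷ʳ y) !! j ≡ y) (List.length-reverse ys) (!!-++-length (reverse ys) y [])))) ⟩
    weightedSize k (reverse ys) + suc k * y  ≡⟨ ≡.cong (_+ suc k * y) (weightedSize-reverse ys) ⟩
    revWeight ys + suc k * y                 ≡⟨ ℕ.+-comm (revWeight ys) _ ⟩
    revWeight (y ∷ ys)                       ∎
    where k = length ys

  revWeight-++ : ∀ xs ys → revWeight (xs ++ ys) ≡ revWeight xs + length ys * sum xs + revWeight ys
  revWeight-++ []       ys = ≡.cong (_+ revWeight ys) (≡.sym (ℕ.*-zeroʳ (length ys)))
  revWeight-++ (x ∷ xs) ys = ≡.trans (≡.cong₂ (λ u v → suc u * x + v) (List.length-++ xs) (revWeight-++ xs ys))
    (rearrange (length xs) (length ys) x (revWeight xs) (sum xs) (revWeight ys))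
    where
    rearrange : ∀ a b x e s f → suc (a + b) * x + (e + b * s + f) ≡ suc a * x + e + b * (x + s) + f
    rearrange = solve-∀

  revWeight-replicate : ∀ n b → revWeight (replicate n b) ≡ triangle n * b
  revWeight-replicate zero    b = ≡.refl
  revWeight-replicate (suc n) b = begin
    suc (length (replicate n b)) * b + revWeight (replicate n b)
      ≡⟨ ≡.cong₂ (λ u v → suc u * b + v) (List.length-replicate n) (revWeight-replicate n b) ⟩
    suc n * b + triangle n * b                                  ≡⟨ ℕ.+-comm (suc n * b) _ ⟩
    triangle n * b + suc n * b                                  ≡⟨ ℕ.*-distribʳ-+ b (triangle n) (suc n) ⟨
    triangle (suc n) * b                                        ∎

  triangle≡C : ∀ n → triangle n ≡ (n + 1) C 2
  triangle≡C n = ≡.trans (go n) (≡.cong (_C 2) (ℕ.+-comm 1 n))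
    where
    go : ∀ n → triangle n ≡ suc n C 2
    go zero    = ≡.refl
    go (suc n) = ≡.trans (ℕ.+-comm (triangle n) (suc n))
                   (≡.trans (≡.cong₂ _+_ (≡.sym (nC1≡n (suc n))) (go n)) (nCk+nC[k+1]≡[n+1]C[k+1] (suc n) 1))

  reverse-!! : ∀ ys s → s < length ys → reverse ys !! s ≡ ys !! (length ys ∸ suc s)
  reverse-!! (y ∷ ys) s s<1+k with ℕ.m≤n⇒m<n∨m≡n (ℕ.≤-pred s<1+k)
  ... | inj₁ s<k = begin
    reverse (y ∷ ys) !! s        ≡⟨ ≡.cong (_!! s) (List.unfold-reverse y ys) ⟩
    (reverse ys ∷ʳ y) !! s       ≡⟨ !!-++ˡ (reverse ys) [ y ] s (≡.subst (s <_) (≡.sym (List.length-reverse ys)) s<k) ⟩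
    reverse ys !! s              ≡⟨ reverse-!! ys s s<k ⟩
    ys !! (length ys ∸ suc s)    ≡⟨ ≡.cong ((y ∷ ys) !!_) (n∸c≡1+n∸[1+c] (length ys) s s<k) ⟨
    (y ∷ ys) !! (length ys ∸ s)  ∎
  ... | inj₂ ≡.refl = begin
    reverse (y ∷ ys) !! length ys        ≡⟨ ≡.cong (_!! length ys) (List.unfold-reverse y ys) ⟩
    (reverse ys ∷ʳ y) !! length ys       ≡⟨ ≡.subst (λ j → (reverse ys ∷ʳ y) !! j ≡ y) (List.length-reverse ys) (!!-++-length (reverse ys) y []) ⟩
    y                                    ≡⟨ ≡.cong ((y ∷ ys) !!_) (ℕ.n∸n≡0 (length ys)) ⟨
    (y ∷ ys) !! (length ys ∸ length ys)  ∎

  addIndices-!! : ∀ i ys s → s < length ys → addIndices i ys !! s ≡ ys !! s + (i + s)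
  addIndices-!! i (y ∷ ys) zero    _        = ≡.cong (y +_) (≡.sym (ℕ.+-identityʳ i))
  addIndices-!! i (y ∷ ys) (suc s) (s≤s lt) = ≡.trans (addIndices-!! (suc i) ys s lt) (≡.cong (ys !! s +_) (≡.sym (ℕ.+-suc i s)))

  shiftedPart-reverse : ∀ ys s → s < length ys → shiftedPart (length ys) (reverse ys) s ≡ reverse (addIndices 0 ys) !! s
  shiftedPart-reverse ys s s<k = begin
    reverse ys !! s + j                            ≡⟨ ≡.cong (_+ j) (reverse-!! ys s s<k) ⟩
    ys !! j + j                                    ≡⟨ addIndices-!! 0 ys j (ℕ.∸-monoʳ-< (s≤s z≤n) s<k) ⟨
    addIndices 0 ys !! j                           ≡⟨ ≡.cong (λ k → addIndices 0 ys !! (k ∸ suc s)) (length-addIndices 0 ys) ⟨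
    addIndices 0 ys !! (length (addIndices 0 ys) ∸ suc s) ≡⟨ reverse-!! (addIndices 0 ys) s (≡.subst (s <_) (≡.sym (length-addIndices 0 ys)) s<k) ⟨
    reverse (addIndices 0 ys) !! s                 ∎
    where j = length ys ∸ suc s

  ∣++∣ : ∀ {k L} (u : Vec Bool k) (v : Vec Bool L) → ∣ u Vec.++ v ∣ ≡ ∣ u ∣ + ∣ v ∣
  ∣++∣ []          v = ≡.refl
  ∣++∣ (true ∷ u)  v = ≡.cong suc (∣++∣ u v)
  ∣++∣ (false ∷ u) v = ∣++∣ u v

  ∣∁⊤∣≡0 : ∀ m → ∣ ∁ (Vec.replicate m true) ∣ ≡ 0
  ∣∁⊤∣≡0 m = ≡.trans (∣∁p∣≡n∸∣p∣ (Vec.replicate m true)) (≡.trans (≡.cong (m ∸_) (∣⊤∣≡n m)) (ℕ.n∸n≡0 m))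

  ∁-involutive : ∀ {L} (A : Vec Bool L) → ∁ (∁ A) ≡ A
  ∁-involutive []          = ≡.refl
  ∁-involutive (true ∷ A)  = ≡.cong (true ∷_) (∁-involutive A)
  ∁-involutive (false ∷ A) = ≡.cong (false ∷_) (∁-involutive A)

  complement-unique : ∀ {L} (A B : Vec Bool L) → A ∩ B ≡ ∅ → A ∪ B ≡ ⊤ → B ≡ ∁ A
  complement-unique []      []      _ _ = ≡.refl
  complement-unique (a ∷ A) (b ∷ B) A∩B≡∅ A∪B≡⊤ =
    ≡.cong₂ _∷_ (bit a b (Vec.∷-injectiveˡ A∩B≡∅) (Vec.∷-injectiveˡ A∪B≡⊤))
                (complement-unique A B (Vec.∷-injectiveʳ A∩B≡∅) (Vec.∷-injectiveʳ A∪B≡⊤))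
    where
    bit : ∀ a b → a ∧ b ≡ false → a ∨ b ≡ true → b ≡ not a
    bit true  true  () _
    bit true  false _  _ = ≡.refl
    bit false true  _  _ = ≡.refl
    bit false false _  ()

  positions-++ : ∀ {k L} (u : Vec Bool k) (v : Vec Bool L) → positions (u Vec.++ v) ≡ positions u ++ map (k +_) (positions v)
  positions-++ []               v = ≡.sym (List.map-id (positions v))
  positions-++ {suc k} (true ∷ u)  v = ≡.cong (0 ∷_) (≡.trans (≡.cong (map suc) (positions-++ u v))
    (≡.trans (List.map-++ suc (positions u) _) (≡.cong (map suc (positions u) ++_) (≡.sym (List.map-∘ (positions v))))))
  positions-++ {suc k} (false ∷ u) v = ≡.trans (≡.cong (map suc) (positions-++ u v))
    (≡.trans (List.map-++ suc (positions u) _) (≡.cong (map suc (positions u) ++_) (≡.sym (List.map-∘ (positions v)))))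

  positions-⊤ : ∀ m → positions (Vec.replicate m true) ≡ upTo m
  positions-⊤ zero    = ≡.refl
  positions-⊤ (suc m) = ≡.cong (0 ∷_) (≡.trans (≡.cong (map suc) (positions-⊤ m)) (List.map-upTo suc m))

  positions-< : ∀ {L} (X : Vec Bool L) {x} → x ∈ positions X → x < L
  positions-< (true ∷ X)  (here ≡.refl) = s≤s z≤n
  positions-< (true ∷ X)  (there x∈)    = map-suc-< X x∈
    where
    map-suc-< : ∀ {L} (X : Vec Bool L) {x} → x ∈ map suc (positions X) → x < suc L
    map-suc-< X x∈ with ∈-map⁻ suc x∈
    ... | y , y∈ , ≡.refl = s≤s (positions-< X y∈)
  positions-< (false ∷ X) x∈ with ∈-map⁻ suc x∈
  ... | y , y∈ , ≡.refl = s≤s (positions-< X y∈)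

  gapsBefore-++ : ∀ {k L} (u : Vec Bool k) (v : Vec Bool L) → gapsBefore (u Vec.++ v) ≡ gapsBefore u ++ map (∣ ∁ u ∣ +_) (gapsBefore v)
  gapsBefore-++ []          v = ≡.sym (List.map-id (gapsBefore v))
  gapsBefore-++ (true ∷ u)  v = ≡.cong (0 ∷_) (gapsBefore-++ u v)
  gapsBefore-++ (false ∷ u) v = ≡.trans (≡.cong (map suc) (gapsBefore-++ u v))
    (≡.trans (List.map-++ suc (gapsBefore u) _) (≡.cong (map suc (gapsBefore u) ++_) (≡.sym (List.map-∘ (gapsBefore v)))))

  gapsBefore-⊤ : ∀ m → gapsBefore (Vec.replicate m true) ≡ replicate m 0
  gapsBefore-⊤ zero    = ≡.refl
  gapsBefore-⊤ (suc m) = ≡.cong (0 ∷_) (gapsBefore-⊤ m)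

  sum-map-suc : ∀ ys → sum (map suc ys) ≡ sum ys + length ys
  sum-map-suc []       = ≡.refl
  sum-map-suc (y ∷ ys) = ≡.trans (≡.cong (suc y +_) (sum-map-suc ys)) (rearrange y (sum ys) (length ys))
    where
    rearrange : ∀ y s l → suc y + (s + l) ≡ y + s + suc l
    rearrange = solve-∀

  -- Each pair of a member of A and a member of ∁ A is counted exactly once,
  -- by whichever of the two comes later.
  sum-gapsBefore-∁ : ∀ {L} (A : Vec Bool L) → sum (gapsBefore A) + sum (gapsBefore (∁ A)) ≡ ∣ A ∣ * ∣ ∁ A ∣
  sum-gapsBefore-∁ [] = ≡.refl
  sum-gapsBefore-∁ (true ∷ A) = begin
    sum (gapsBefore A) + sum (map suc (gapsBefore (∁ A)))              ≡⟨ ≡.cong (sum (gapsBefore A) +_) (sum-map-suc (gapsBefore (∁ A))) ⟩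
    sum (gapsBefore A) + (sum (gapsBefore (∁ A)) + length (gapsBefore (∁ A)))
      ≡⟨ ≡.cong (λ z → sum (gapsBefore A) + (sum (gapsBefore (∁ A)) + z)) (length-gapsBefore (∁ A)) ⟩
    sum (gapsBefore A) + (sum (gapsBefore (∁ A)) + ∣ ∁ A ∣)             ≡⟨ ℕ.+-assoc (sum (gapsBefore A)) _ _ ⟨
    sum (gapsBefore A) + sum (gapsBefore (∁ A)) + ∣ ∁ A ∣               ≡⟨ ≡.cong (_+ ∣ ∁ A ∣) (sum-gapsBefore-∁ A) ⟩
    ∣ A ∣ * ∣ ∁ A ∣ + ∣ ∁ A ∣                                         ≡⟨ ℕ.+-comm (∣ A ∣ * ∣ ∁ A ∣) _ ⟩
    suc ∣ A ∣ * ∣ ∁ A ∣                                               ∎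
  sum-gapsBefore-∁ (false ∷ A) = begin
    sum (map suc (gapsBefore A)) + sum (gapsBefore (∁ A))               ≡⟨ ≡.cong (_+ sum (gapsBefore (∁ A))) (sum-map-suc (gapsBefore A)) ⟩
    sum (gapsBefore A) + length (gapsBefore A) + sum (gapsBefore (∁ A))
      ≡⟨ ≡.cong (λ z → sum (gapsBefore A) + z + sum (gapsBefore (∁ A))) (length-gapsBefore A) ⟩
    sum (gapsBefore A) + ∣ A ∣ + sum (gapsBefore (∁ A))                 ≡⟨ swap₂₃ (sum (gapsBefore A)) ∣ A ∣ _ ⟩
    sum (gapsBefore A) + sum (gapsBefore (∁ A)) + ∣ A ∣                 ≡⟨ ≡.cong (_+ ∣ A ∣) (sum-gapsBefore-∁ A) ⟩
    ∣ A ∣ * ∣ ∁ A ∣ + ∣ A ∣                                           ≡⟨ ℕ.+-comm (∣ A ∣ * ∣ ∁ A ∣) _ ⟩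
    ∣ A ∣ + ∣ A ∣ * ∣ ∁ A ∣                                           ≡⟨ ℕ.*-suc ∣ A ∣ ∣ ∁ A ∣ ⟨
    ∣ A ∣ * suc ∣ ∁ A ∣                                               ∎
    where
    swap₂₃ : ∀ a c b → a + c + b ≡ a + b + c
    swap₂₃ = solve-∀

  padded : ∀ m n {K} → Vec Bool K → Vec Bool (m + (K + n))
  padded m n u = Vec.replicate m true Vec.++ (u Vec.++ Vec.replicate n true)

  gapsBefore-padded : ∀ m n {K} (u : Vec Bool K) → gapsBefore (padded m n u) ≡ replicate m 0 ++ (gapsBefore u ++ replicate n ∣ ∁ u ∣)
  gapsBefore-padded m n u = begin
    gapsBefore (padded m n u)
      ≡⟨ gapsBefore-++ (Vec.replicate m true) (u Vec.++ Vec.replicate n true) ⟩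
    gapsBefore (Vec.replicate m true) ++ map (∣ ∁ (Vec.replicate m true) ∣ +_) (gapsBefore (u Vec.++ Vec.replicate n true))
      ≡⟨ ≡.cong₂ (λ s j → s ++ map (j +_) (gapsBefore (u Vec.++ Vec.replicate n true))) (gapsBefore-⊤ m) (∣∁⊤∣≡0 m) ⟩
    replicate m 0 ++ map (0 +_) (gapsBefore (u Vec.++ Vec.replicate n true))
      ≡⟨ ≡.cong (replicate m 0 ++_) (≡.trans (List.map-id _) (gapsBefore-++ u (Vec.replicate n true))) ⟩
    replicate m 0 ++ (gapsBefore u ++ map (∣ ∁ u ∣ +_) (gapsBefore (Vec.replicate n true)))
      ≡⟨ ≡.cong (λ t → replicate m 0 ++ (gapsBefore u ++ t)) (≡.trans (≡.cong (map (∣ ∁ u ∣ +_)) (gapsBefore-⊤ n))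
           (≡.trans (List.map-replicate (∣ ∁ u ∣ +_) n 0) (≡.cong (replicate n) (ℕ.+-identityʳ ∣ ∁ u ∣)))) ⟩
    replicate m 0 ++ (gapsBefore u ++ replicate n ∣ ∁ u ∣) ∎

  revWeight-padded : ∀ m n {K} (u : Vec Bool K) →
    revWeight (gapsBefore (padded m n u)) ≡ revWeight (gapsBefore u) + n * sum (gapsBefore u) + triangle n * ∣ ∁ u ∣
  revWeight-padded m n u = begin
    revWeight (gapsBefore (padded m n u))                 ≡⟨ ≡.cong revWeight (gapsBefore-padded m n u) ⟩
    revWeight (replicate m 0 ++ (Y ++ replicate n ∣ ∁ u ∣)) ≡⟨ revWeight-++ (replicate m 0) _ ⟩
    revWeight (replicate m 0) + length (Y ++ replicate n ∣ ∁ u ∣) * sum (replicate m 0) + revWeight (Y ++ replicate n ∣ ∁ u ∣)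
      ≡⟨ ≡.cong₂ (λ s t → s + length (Y ++ replicate n ∣ ∁ u ∣) * t + revWeight (Y ++ replicate n ∣ ∁ u ∣))
           (≡.trans (revWeight-replicate m 0) (ℕ.*-zeroʳ (triangle m))) (sum-zeros m) ⟩
    0 + length (Y ++ replicate n ∣ ∁ u ∣) * 0 + revWeight (Y ++ replicate n ∣ ∁ u ∣)
      ≡⟨ ≡.cong (_+ revWeight (Y ++ replicate n ∣ ∁ u ∣)) (ℕ.*-zeroʳ (length (Y ++ replicate n ∣ ∁ u ∣))) ⟩
    revWeight (Y ++ replicate n ∣ ∁ u ∣)                    ≡⟨ revWeight-++ Y (replicate n ∣ ∁ u ∣) ⟩
    revWeight Y + length (replicate n ∣ ∁ u ∣) * sum Y + revWeight (replicate n ∣ ∁ u ∣)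
      ≡⟨ ≡.cong₂ (λ s t → revWeight Y + s * sum Y + t) (List.length-replicate n) (revWeight-replicate n ∣ ∁ u ∣) ⟩
    revWeight Y + n * sum Y + triangle n * ∣ ∁ u ∣          ∎
    where
    Y = gapsBefore u
    sum-zeros : ∀ m → sum (replicate m 0) ≡ 0
    sum-zeros zero    = ≡.refl
    sum-zeros (suc m) = sum-zeros m

  qExponent : ∀ {L} → Vec Bool L → ℕ
  qExponent X = revWeight (gapsBefore X)

  ∣padded∣ : ∀ m n {K} (X : Subset K) k → ∣ X ∣ ≡ k → ∣ padded m n X ∣ ≡ m + n + k
  ∣padded∣ m n X k ∣X∣≡k = ≡.trans (∣++∣ (Vec.replicate m true) (X Vec.++ Vec.replicate n true))
    (≡.trans (≡.cong₂ _+_ (∣⊤∣≡n m) (≡.trans (∣++∣ X (Vec.replicate n true)) (≡.cong₂ _+_ ∣X∣≡k (∣⊤∣≡n n))))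
             (rearrange m k n))
    where
    rearrange : ∀ m k n → m + (k + n) ≡ m + n + k
    rearrange = solve-∀

  exponent-padded : ∀ m n a b (A : Subset (a + b)) → ∣ A ∣ ≡ a → ∣ ∁ A ∣ ≡ b →
    qExponent (padded m n A) + qExponent (padded m n (∁ A)) ≡ a * b * n + (a + b) * ((n + 1) C 2) + qExponent A + qExponent (∁ A)
  exponent-padded m n a b A ∣A∣≡a ∣∁A∣≡b = begin
    qExponent (padded m n A) + qExponent (padded m n (∁ A))
      ≡⟨ ≡.cong₂ _+_ (revWeight-padded m n A) (revWeight-padded m n (∁ A)) ⟩
    qExponent A + n * SA + triangle n * ∣ ∁ A ∣ + (qExponent (∁ A) + n * SB + triangle n * ∣ ∁ (∁ A) ∣)
      ≡⟨ ≡.cong₂ (λ u v → qExponent A + n * SA + triangle n * u + (qExponent (∁ A) + n * SB + triangle n * v))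
           ∣∁A∣≡b (≡.trans (≡.cong ∣_∣ (∁-involutive A)) ∣A∣≡a) ⟩
    qExponent A + n * SA + triangle n * b + (qExponent (∁ A) + n * SB + triangle n * a)
      ≡⟨ collect (qExponent A) (qExponent (∁ A)) SA SB (triangle n) a b n ⟩
    qExponent A + qExponent (∁ A) + n * (SA + SB) + triangle n * (a + b)
      ≡⟨ ≡.cong₂ (λ s t → qExponent A + qExponent (∁ A) + n * s + t * (a + b))
           (≡.trans (sum-gapsBefore-∁ A) (≡.cong₂ _*_ ∣A∣≡a ∣∁A∣≡b)) (triangle≡C n) ⟩
    qExponent A + qExponent (∁ A) + n * (a * b) + ((n + 1) C 2) * (a + b)
      ≡⟨ reorder (qExponent A) (qExponent (∁ A)) a b n ((n + 1) C 2) ⟩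
    a * b * n + (a + b) * ((n + 1) C 2) + qExponent A + qExponent (∁ A) ∎
    where
    SA = sum (gapsBefore A)
    SB = sum (gapsBefore (∁ A))
    collect : ∀ ea eb sa sb t a b n →
      ea + n * sa + t * b + (eb + n * sb + t * a) ≡ ea + eb + n * (sa + sb) + t * (a + b)
    collect = solve-∀
    reorder : ∀ ea eb a b n c → ea + eb + n * (a * b) + c * (a + b) ≡ a * b * n + (a + b) * c + ea + eb
    reorder = solve-∀

module PairProducts {c ℓ} (R : CommutativeRing c ℓ) (q : CommutativeRing.Carrier R) where

  open import Data.Nat as ℕ using (ℕ; zero; suc; _<_; _≤_; _∸_)
  import Data.Nat.Properties as ℕ
  open import Data.Bool using (Bool; true; false)
  open import Data.List as List using (List; []; _∷_; _++_; _∷ʳ_; [_]; map; length; upTo; reverse)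
  import Data.List.Properties as List
  open import Data.List.Membership.Propositional using (_∈_)
  open import Data.Vec as Vec using (Vec; []; _∷_)
  open import Data.Fin.Subset using (∣_∣; ∁)
  open import Relation.Binary.PropositionalEquality as ≡ using (_≡_)
  open import Function using (_∘_)
  open import Defs using (schur; lam; qPoch; Hq)

  open CommutativeRing R hiding (zero)
  open BigOperators R
  open Partitions using (_!!_; !!-++ˡ; !!-++-length; shiftedPart; weightedSize)
  open Subsets
  open GeometricSpecialisation R using (pairFactors; prodBelow-qPoch≈Hq)
  open PrincipalSpecialisation R using (principalSpecialisation)
  open import Relation.Binary.Reasoning.Setoid setoid

  pairFactor : ℕ → ℕ → Carrier
  pairFactor x y = 1# - q ^ (y ∸ x)

  pairProduct : List ℕ → Carrier
  pairProduct []       = 1#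
  pairProduct (x ∷ xs) = prodOver xs (pairFactor x) * pairProduct xs

  crossProduct : List ℕ → List ℕ → Carrier
  crossProduct xs ys = prodOver xs (λ x → prodOver ys (pairFactor x))

  pairProduct-++ : ∀ xs ys → pairProduct (xs ++ ys) ≈ pairProduct xs * pairProduct ys * crossProduct xs ys
  pairProduct-++ []       ys = sym (trans (*-congʳ (*-identityˡ _)) (*-identityʳ _))
  pairProduct-++ (x ∷ xs) ys = begin
    prodOver (xs ++ ys) (pairFactor x) * pairProduct (xs ++ ys)
      ≈⟨ *-cong (prodOver-++ xs ys (pairFactor x)) (pairProduct-++ xs ys) ⟩
    (prodOver xs (pairFactor x) * prodOver ys (pairFactor x)) * (pairProduct xs * pairProduct ys * crossProduct xs ys)
      ≈⟨ solve 5 (λ a b c d e → (a :* b) :* (c :* d :* e) := (a :* c) :* d :* (b :* e)) refl _ _ _ _ _ ⟩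
    prodOver xs (pairFactor x) * pairProduct xs * pairProduct ys * (prodOver ys (pairFactor x) * crossProduct xs ys) ∎

  prodOver-pairFactor-shift : ∀ k x xs → prodOver (map (k ℕ.+_) xs) (pairFactor (k ℕ.+ x)) ≈ prodOver xs (pairFactor x)
  prodOver-pairFactor-shift k x xs = trans (reflexive (prodOver-map (k ℕ.+_) xs (pairFactor (k ℕ.+ x))))
    (prodOver-cong xs (λ y _ → reflexive (≡.cong (λ e → 1# - q ^ e) (ℕ.[m+n]∸[m+o]≡n∸o k y x))))

  pairProduct-shift : ∀ k xs → pairProduct (map (k ℕ.+_) xs) ≈ pairProduct xs
  pairProduct-shift k []       = refl
  pairProduct-shift k (x ∷ xs) = *-cong (prodOver-pairFactor-shift k x xs) (pairProduct-shift k xs)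

  pairProduct-upTo : ∀ m → pairProduct (upTo m) ≈ Hq R q m
  pairProduct-upTo m = trans (go m) (prodBelow-qPoch≈Hq q m)
    where
    firstRow : ∀ m → prodBelow m (λ j → 1# - q ^ suc j) ≈ qPoch R q q m
    firstRow zero    = refl
    firstRow (suc m) = *-congʳ (firstRow m)
    go : ∀ m → pairProduct (upTo m) ≈ prodBelow m (qPoch R q q)
    go zero    = refl
    go (suc m) = begin
      prodOver (List.applyUpTo suc m) (pairFactor 0) * pairProduct (List.applyUpTo suc m)
        ≡⟨ ≡.cong (λ z → prodOver z (pairFactor 0) * pairProduct z) (≡.sym (List.map-upTo suc m)) ⟩
      prodOver (map suc (upTo m)) (pairFactor 0) * pairProduct (map (1 ℕ.+_) (upTo m))
        ≈⟨ *-cong (trans (reflexive (prodOver-map suc (upTo m) (pairFactor 0))) (trans (prodOver-upTo m _) (firstRow m)))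
                  (trans (pairProduct-shift 1 (upTo m)) (go m)) ⟩
      qPoch R q q m * prodBelow m (qPoch R q q) ≈⟨ *-comm _ _ ⟩
      prodBelow (suc m) (qPoch R q q) ∎

  leftBlockFactor : ℕ → ℕ → Carrier
  leftBlockFactor m x = qPoch R (q ^ suc x) q m

  rightBlockFactor : ℕ → ℕ → ℕ → Carrier
  rightBlockFactor K n x = qPoch R (q ^ (K ∸ x)) q n

  prodOver-leftBlock : ∀ m x → prodOver (upTo m) (λ i → pairFactor i (m ℕ.+ x)) ≈ leftBlockFactor m x
  prodOver-leftBlock zero    x = refl
  prodOver-leftBlock (suc m) x = begin
    prodOver (upTo (suc m)) (λ i → pairFactor i (suc m ℕ.+ x))
      ≈⟨ prodOver-upTo-suc m _ ⟩
    (1# - q ^ (suc m ℕ.+ x)) * prodOver (upTo m) (λ i → pairFactor i (m ℕ.+ x))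
      ≈⟨ *-congˡ (prodOver-leftBlock m x) ⟩
    (1# - q ^ (suc m ℕ.+ x)) * leftBlockFactor m x
      ≈⟨ *-comm _ _ ⟩
    leftBlockFactor m x * (1# - q ^ (suc m ℕ.+ x))
      ≈⟨ *-congˡ (+-congˡ (-‿cong (trans (reflexive (≡.cong (λ z → q ^ suc z) (ℕ.+-comm m x))) (^-homo-* q (suc x) m)))) ⟩
    leftBlockFactor (suc m) x ∎

  crossProduct-leftBlock : ∀ m xs → crossProduct (upTo m) (map (m ℕ.+_) xs) ≈ prodOver xs (leftBlockFactor m)
  crossProduct-leftBlock m xs = trans (prodOver-swap (upTo m) (map (m ℕ.+_) xs) pairFactor)
    (trans (reflexive (prodOver-map (m ℕ.+_) xs _)) (prodOver-cong xs (λ x _ → prodOver-leftBlock m x)))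

  prodOver-rightBlock : ∀ K n x → x ≤ K → prodOver (map (K ℕ.+_) (upTo n)) (pairFactor x) ≈ rightBlockFactor K n x
  prodOver-rightBlock K n x x≤K = trans (reflexive (prodOver-map (K ℕ.+_) (upTo n) (pairFactor x))) (trans (prodOver-upTo n _) (go n))
    where
    go : ∀ n → prodBelow n (λ j → pairFactor x (K ℕ.+ j)) ≈ rightBlockFactor K n x
    go zero    = refl
    go (suc n) = *-cong (go n) (+-congˡ (-‿cong (trans (reflexive (≡.cong (q ^_) (ℕ.+-∸-comm n x≤K))) (^-homo-* q (K ∸ x) n))))

  prodOver-positions-∁ : ∀ {L} (A : Vec Bool L) (F : ℕ → Carrier) →
    prodOver (positions A) F * prodOver (positions (∁ A)) F ≈ prodOver (upTo L) F
  prodOver-positions-∁ []                  F = *-identityˡ _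
  prodOver-positions-∁ {suc L} (true ∷ A)  F = begin
    (F 0 * prodOver (map suc (positions A)) F) * prodOver (map suc (positions (∁ A))) F
      ≡⟨ ≡.cong₂ (λ u v → (F 0 * u) * v) (prodOver-map suc (positions A) F) (prodOver-map suc (positions (∁ A)) F) ⟩
    (F 0 * prodOver (positions A) (F ∘ suc)) * prodOver (positions (∁ A)) (F ∘ suc)   ≈⟨ *-assoc _ _ _ ⟩
    F 0 * (prodOver (positions A) (F ∘ suc) * prodOver (positions (∁ A)) (F ∘ suc))   ≈⟨ *-congˡ (prodOver-positions-∁ A (F ∘ suc)) ⟩
    F 0 * prodOver (upTo L) (F ∘ suc)                                                ≈⟨ prodOver-upTo-suc L F ⟨
    prodOver (upTo (suc L)) F                                                        ∎
  prodOver-positions-∁ {suc L} (false ∷ A) F = begin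
    prodOver (map suc (positions A)) F * (F 0 * prodOver (map suc (positions (∁ A))) F)
      ≡⟨ ≡.cong₂ (λ u v → u * (F 0 * v)) (prodOver-map suc (positions A) F) (prodOver-map suc (positions (∁ A)) F) ⟩
    prodOver (positions A) (F ∘ suc) * (F 0 * prodOver (positions (∁ A)) (F ∘ suc))
      ≈⟨ solve 3 (λ a f b → a :* (f :* b) := f :* (a :* b)) refl _ _ _ ⟩
    F 0 * (prodOver (positions A) (F ∘ suc) * prodOver (positions (∁ A)) (F ∘ suc))   ≈⟨ *-congˡ (prodOver-positions-∁ A (F ∘ suc)) ⟩
    F 0 * prodOver (upTo L) (F ∘ suc)                                                ≈⟨ prodOver-upTo-suc L F ⟨
    prodOver (upTo (suc L)) F                                                        ∎

  pairFactors-cong : ∀ N {f f' : ℕ → ℕ} → (∀ s → s < N → f s ≡ f' s) → pairFactors q N f ≈ pairFactors q N f'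
  pairFactors-cong N f≡f' = prodBelow-cong N (λ s s<N → prodBelow-cong s (λ r r<s →
    reflexive (≡.cong₂ (λ u v → 1# - q ^ (u ∸ v)) (f≡f' r (ℕ.<-trans r<s s<N)) (f≡f' s s<N))))

  pairFactors≈pairProduct : ∀ zs → pairFactors q (length zs) (reverse zs !!_) ≈ pairProduct zs
  pairFactors≈pairProduct []       = refl
  pairFactors≈pairProduct (z ∷ zs) = begin
    pairFactors q k f * prodBelow k (λ r → 1# - q ^ (f r ∸ f k))
      ≈⟨ *-cong (trans (pairFactors-cong k before) (pairFactors≈pairProduct zs))
                (trans (prodBelow-cong k (λ r r<k → reflexive (≡.cong₂ (λ u v → 1# - q ^ (u ∸ v)) (before r r<k) last)))
                  (trans (reflexive (≡.cong (λ N → prodBelow N (λ r → pairFactor z (reverse zs !! r))) (≡.sym (List.length-reverse zs))))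
                    (trans (prodBelow-!! (reverse zs) (pairFactor z)) (prodOver-reverse zs (pairFactor z))))) ⟩
    pairProduct zs * prodOver zs (pairFactor z) ≈⟨ *-comm _ _ ⟩
    pairProduct (z ∷ zs)                         ∎
    where
    k = length zs
    f = reverse (z ∷ zs) !!_
    before : ∀ s → s < k → f s ≡ reverse zs !! s
    before s s<k = ≡.trans (≡.cong (_!! s) (List.unfold-reverse z zs))
      (!!-++ˡ (reverse zs) [ z ] s (≡.subst (s <_) (≡.sym (List.length-reverse zs)) s<k))
    last : f k ≡ z
    last = ≡.trans (≡.cong (_!! k) (List.unfold-reverse z zs))
      (≡.subst (λ j → (reverse zs ∷ʳ z) !! j ≡ z) (List.length-reverse zs) (!!-++-length (reverse zs) z []))

  subsetSpecialisation : ∀ {L} (X : Vec Bool L) N → ∣ X ∣ ≡ N →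
    Hq R q N * schur R (lam X) N (q ^_) ≈ q ^ revWeight (gapsBefore X) * pairProduct (positions X)
  subsetSpecialisation X N ∣X∣≡N =
    ≡.subst (λ N → Hq R q N * schur R (lam X) N (q ^_) ≈ q ^ revWeight Y * pairProduct (positions X))
            (≡.trans (length-gapsBefore X) ∣X∣≡N) specialised
    where
    Y = gapsBefore X
    k = length Y
    specialised : Hq R q k * schur R (lam X) k (q ^_) ≈ q ^ revWeight Y * pairProduct (positions X)
    specialised = begin
      Hq R q k * schur R (lam X) k (q ^_)
        ≡⟨ ≡.cong (λ l → Hq R q k * schur R l k (q ^_)) (lam≡reverse-gapsBefore X) ⟩
      Hq R q k * schur R (reverse Y) k (q ^_)
        ≈⟨ principalSpecialisation q k (reverse Y) (List.length-reverse Y) (reverse-increasing (gapsBefore-increasing X)) ⟩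
      q ^ weightedSize k (reverse Y) * pairFactors q k (shiftedPart k (reverse Y))
        ≡⟨ ≡.cong (λ e → q ^ e * pairFactors q k (shiftedPart k (reverse Y))) (weightedSize-reverse Y) ⟩
      q ^ revWeight Y * pairFactors q k (shiftedPart k (reverse Y))
        ≈⟨ *-congˡ (pairFactors-cong k (shiftedPart-reverse Y)) ⟩
      q ^ revWeight Y * pairFactors q k (reverse (addIndices 0 Y) !!_)
        ≡⟨ ≡.cong (λ N → q ^ revWeight Y * pairFactors q N (reverse (addIndices 0 Y) !!_)) (length-addIndices 0 Y) ⟨
      q ^ revWeight Y * pairFactors q (length (addIndices 0 Y)) (reverse (addIndices 0 Y) !!_)
        ≈⟨ *-congˡ (pairFactors≈pairProduct (addIndices 0 Y)) ⟩
      q ^ revWeight Y * pairProduct (addIndices 0 Y)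
        ≡⟨ ≡.cong (λ z → q ^ revWeight Y * pairProduct z) (addIndices-gapsBefore X) ⟩
      q ^ revWeight Y * pairProduct (positions X) ∎

  pairProduct-padded : ∀ m n {K} (u : Vec Bool K) →
    pairProduct (positions (padded m n u)) ≈
      Hq R q m * Hq R q n * pairProduct (positions u)
        * prodOver (positions u) (λ x → leftBlockFactor m x * rightBlockFactor K n x)
        * prodOver (map (K ℕ.+_) (upTo n)) (leftBlockFactor m)
  pairProduct-padded m n {K} u = begin
    pairProduct (positions (padded m n u))
      ≡⟨ ≡.cong pairProduct blocks ⟩
    pairProduct (upTo m ++ map (m ℕ.+_) Z)
      ≈⟨ pairProduct-++ (upTo m) (map (m ℕ.+_) Z) ⟩
    pairProduct (upTo m) * pairProduct (map (m ℕ.+_) Z) * crossProduct (upTo m) (map (m ℕ.+_) Z)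
      ≈⟨ *-cong (*-cong (pairProduct-upTo m) (pairProduct-shift m Z)) (crossProduct-leftBlock m Z) ⟩
    Hq R q m * pairProduct Z * prodOver Z (leftBlockFactor m)
      ≈⟨ *-cong (*-congˡ (trans (pairProduct-++ (positions u) right)
                            (*-cong (*-congˡ (trans (pairProduct-shift K (upTo n)) (pairProduct-upTo n))) middle×right)))
                (prodOver-++ (positions u) right (leftBlockFactor m)) ⟩
    Hq R q m * (pairProduct (positions u) * Hq R q n * Pn) * (Pm * Rm)
      ≈⟨ solve 6 (λ hm hn pu pn pm r → hm :* (pu :* hn :* pn) :* (pm :* r) := hm :* hn :* pu :* (pm :* pn) :* r) refl
           (Hq R q m) (Hq R q n) (pairProduct (positions u)) Pn Pm Rm ⟩
    Hq R q m * Hq R q n * pairProduct (positions u) * (Pm * Pn) * Rm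
      ≈⟨ *-congʳ (*-congˡ (prodOver-* (positions u) (leftBlockFactor m) (rightBlockFactor K n))) ⟨
    Hq R q m * Hq R q n * pairProduct (positions u) * prodOver (positions u) (λ x → leftBlockFactor m x * rightBlockFactor K n x) * Rm ∎
    where
    right = map (K ℕ.+_) (upTo n)
    Z = positions u ++ right
    Pm = prodOver (positions u) (leftBlockFactor m)
    Pn = prodOver (positions u) (rightBlockFactor K n)
    Rm = prodOver right (leftBlockFactor m)
    blocks : positions (padded m n u) ≡ upTo m ++ map (m ℕ.+_) Z
    blocks = ≡.trans (positions-++ (Vec.replicate m true) (u Vec.++ Vec.replicate n true))
      (≡.cong₂ (λ s t → s ++ map (m ℕ.+_) t) (positions-⊤ m)
        (≡.trans (positions-++ u (Vec.replicate n true)) (≡.cong (λ t → positions u ++ map (K ℕ.+_) t) (positions-⊤ n))))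
    middle×right : crossProduct (positions u) right ≈ Pn
    middle×right = prodOver-cong (positions u) (λ x x∈ → prodOver-rightBlock K n x (ℕ.<⇒≤ (positions-< u x∈)))

module ComplementaryPadding {c ℓ} (R : CommutativeRing c ℓ) where

  open import Data.Nat as ℕ using (ℕ; suc; _∸_)
  import Data.Nat.Properties as ℕ
  open import Data.Nat.Combinatorics using (_C_)
  open import Data.List using (map; upTo)
  open import Data.Fin.Subset using (Subset; ∣_∣; ∁)
  open import Relation.Binary.PropositionalEquality as ≡ using (_≡_)
  open import Defs using (schur; lam; qPoch; Hq; prodTo)

  open CommutativeRing R hiding (zero)
  open BigOperators R
  open Partitions using (n∸c≡1+n∸[1+c])
  open Subsets
  open import Relation.Binary.Reasoning.Setoid setoid

  module _ (q : Carrier) (m n a b : ℕ) (A : Subset (a ℕ.+ b)) (∣A∣≡a : ∣ A ∣ ≡ a) (∣∁A∣≡b : ∣ ∁ A ∣ ≡ b) where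

    open PairProducts R q

    private
      K e₀ : ℕ
      K = a ℕ.+ b
      e₀ = a ℕ.* b ℕ.* n ℕ.+ (a ℕ.+ b) ℕ.* ((n ℕ.+ 1) C 2)
      schurAt : ∀ {L} → Subset L → ℕ → Carrier
      schurAt X N = schur R (lam X) N (q ^_)
      Hm Hn FA FB T PA PB core : Carrier
      Hm = Hq R q m
      Hn = Hq R q n
      F : ℕ → Carrier
      F y = leftBlockFactor m y * rightBlockFactor K n y
      FA = prodOver (positions A) F
      FB = prodOver (positions (∁ A)) F
      T = prodOver (map (K ℕ.+_) (upTo n)) (leftBlockFactor m)
      PA = pairProduct (positions A)
      PB = pairProduct (positions (∁ A))
      core = ((Hm * Hm) * (Hn * Hn)) * ((PA * PB) * ((FA * FB) * (T * T)))

    lhs-factorisation :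
      (schurAt (padded m n A) (m ℕ.+ n ℕ.+ a) * schurAt (padded m n (∁ A)) (m ℕ.+ n ℕ.+ b)) * (Hq R q (m ℕ.+ n ℕ.+ a) * Hq R q (m ℕ.+ n ℕ.+ b))
        ≈ ((q ^ e₀ * q ^ qExponent A) * q ^ qExponent (∁ A)) * core
    lhs-factorisation = begin
      (sA′ * sB′) * (HA′ * HB′)
        ≈⟨ solve 4 (λ sa sb ha hb → (sa :* sb) :* (ha :* hb) := (ha :* sa) :* (hb :* sb)) refl sA′ sB′ HA′ HB′ ⟩
      (HA′ * sA′) * (HB′ * sB′)
        ≈⟨ *-cong (subsetSpecialisation (padded m n A) _ (∣padded∣ m n A a ∣A∣≡a))
                  (subsetSpecialisation (padded m n (∁ A)) _ (∣padded∣ m n (∁ A) b ∣∁A∣≡b)) ⟩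
      (q ^ EA′ * pairProduct (positions (padded m n A))) * (q ^ EB′ * pairProduct (positions (padded m n (∁ A))))
        ≈⟨ *-cong (*-congˡ (pairProduct-padded m n A)) (*-congˡ (pairProduct-padded m n (∁ A))) ⟩
      (q ^ EA′ * (Hm * Hn * PA * FA * T)) * (q ^ EB′ * (Hm * Hn * PB * FB * T))
        ≈⟨ solve 9 (λ ea eb hm hn pa pb fa fb t → (ea :* (hm :* hn :* pa :* fa :* t)) :* (eb :* (hm :* hn :* pb :* fb :* t))
                    := (ea :* eb) :* (((hm :* hm) :* (hn :* hn)) :* ((pa :* pb) :* ((fa :* fb) :* (t :* t))))) refl
             (q ^ EA′) (q ^ EB′) Hm Hn PA PB FA FB T ⟩
      (q ^ EA′ * q ^ EB′) * core
        ≈⟨ *-congʳ exponents ⟩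
      ((q ^ e₀ * q ^ qExponent A) * q ^ qExponent (∁ A)) * core ∎
      where
      sA′ = schurAt (padded m n A) (m ℕ.+ n ℕ.+ a)
      sB′ = schurAt (padded m n (∁ A)) (m ℕ.+ n ℕ.+ b)
      HA′ = Hq R q (m ℕ.+ n ℕ.+ a)
      HB′ = Hq R q (m ℕ.+ n ℕ.+ b)
      EA′ = qExponent (padded m n A)
      EB′ = qExponent (padded m n (∁ A))
      exponents : q ^ EA′ * q ^ EB′ ≈ (q ^ e₀ * q ^ qExponent A) * q ^ qExponent (∁ A)
      exponents = begin
        q ^ EA′ * q ^ EB′                                        ≈⟨ ^-homo-* q EA′ EB′ ⟨
        q ^ (EA′ ℕ.+ EB′)                                        ≡⟨ ≡.cong (q ^_) (exponent-padded m n a b A ∣A∣≡a ∣∁A∣≡b) ⟩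
        q ^ (e₀ ℕ.+ qExponent A ℕ.+ qExponent (∁ A))             ≈⟨ ^-homo-* q (e₀ ℕ.+ qExponent A) (qExponent (∁ A)) ⟩
        q ^ (e₀ ℕ.+ qExponent A) * q ^ qExponent (∁ A)           ≈⟨ *-congʳ (^-homo-* q e₀ (qExponent A)) ⟩
        (q ^ e₀ * q ^ qExponent A) * q ^ qExponent (∁ A)         ∎

    middleFactors : prodTo R K (λ i → qPoch R (q ^ i) q m * qPoch R (q ^ (K ∸ i ℕ.+ 1)) q n) ≈ FA * FB
    middleFactors = begin
      prodTo R K (λ i → qPoch R (q ^ i) q m * qPoch R (q ^ (K ∸ i ℕ.+ 1)) q n)
        ≈⟨ prodTo≈prodBelow K _ ⟩
      prodBelow K (λ y → qPoch R (q ^ suc y) q m * qPoch R (q ^ (K ∸ suc y ℕ.+ 1)) q n)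
        ≈⟨ prodBelow-cong K (λ y y<K → *-congˡ (reflexive (≡.cong (λ e → qPoch R (q ^ e) q n)
             (≡.trans (ℕ.+-comm (K ∸ suc y) 1) (≡.sym (n∸c≡1+n∸[1+c] K y y<K)))))) ⟩
      prodBelow K F                           ≈⟨ prodOver-upTo K F ⟨
      prodOver (upTo K) F                     ≈⟨ prodOver-positions-∁ A F ⟨
      FA * FB                                 ∎

    topFactors : prodTo R n (λ j → qPoch R (q ^ (K ℕ.+ j)) q m * qPoch R (q ^ (K ℕ.+ j)) q m) ≈ T * T
    topFactors = begin
      prodTo R n (λ j → qPoch R (q ^ (K ℕ.+ j)) q m * qPoch R (q ^ (K ℕ.+ j)) q m)
        ≈⟨ prodTo≈prodBelow n _ ⟩
      prodBelow n (λ j → qPoch R (q ^ (K ℕ.+ suc j)) q m * qPoch R (q ^ (K ℕ.+ suc j)) q m)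
        ≈⟨ prodBelow-cong n (λ j _ → reflexive (≡.cong (λ e → qPoch R (q ^ e) q m * qPoch R (q ^ e) q m) (ℕ.+-suc K j))) ⟩
      prodBelow n (λ j → leftBlockFactor m (K ℕ.+ j) * leftBlockFactor m (K ℕ.+ j))
        ≈⟨ prodBelow-* n _ _ ⟩
      prodBelow n (λ j → leftBlockFactor m (K ℕ.+ j)) * prodBelow n (λ j → leftBlockFactor m (K ℕ.+ j))
        ≈⟨ *-cong T≈ T≈ ⟨
      T * T ∎
      where
      T≈ : T ≈ prodBelow n (λ j → leftBlockFactor m (K ℕ.+ j))
      T≈ = trans (reflexive (prodOver-map (K ℕ.+_) (upTo n) (leftBlockFactor m))) (prodOver-upTo n _)

    rhs-factorisation :
      q ^ e₀ * (prodTo R K (λ i → qPoch R (q ^ i) q m * qPoch R (q ^ (K ∸ i ℕ.+ 1)) q n)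
               * (prodTo R n (λ j → qPoch R (q ^ (K ℕ.+ j)) q m * qPoch R (q ^ (K ℕ.+ j)) q m)
               * (((Hq R q a * Hq R q b) * ((Hm * Hm) * (Hn * Hn))) * (schurAt A a * schurAt (∁ A) b))))
        ≈ ((q ^ e₀ * q ^ qExponent A) * q ^ qExponent (∁ A)) * core
    rhs-factorisation = begin
      q ^ e₀ * (_ * (_ * (((Ha * Hb) * ((Hm * Hm) * (Hn * Hn))) * (schurAt A a * schurAt (∁ A) b))))
        ≈⟨ *-congˡ (*-cong middleFactors (*-congʳ topFactors)) ⟩
      q ^ e₀ * ((FA * FB) * ((T * T) * (((Ha * Hb) * ((Hm * Hm) * (Hn * Hn))) * (schurAt A a * schurAt (∁ A) b))))
        ≈⟨ *-congˡ (*-congˡ (*-congˡ (solve 6 (λ ha hb hm hn sa sb → (ha :* hb) :* ((hm :* hm) :* (hn :* hn)) :* (sa :* sb)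
              := (ha :* sa) :* (hb :* sb) :* ((hm :* hm) :* (hn :* hn))) refl Ha Hb Hm Hn (schurAt A a) (schurAt (∁ A) b)))) ⟩
      q ^ e₀ * ((FA * FB) * ((T * T) * ((Ha * schurAt A a) * (Hb * schurAt (∁ A) b) * ((Hm * Hm) * (Hn * Hn)))))
        ≈⟨ *-congˡ (*-congˡ (*-congˡ (*-congʳ (*-cong (subsetSpecialisation A a ∣A∣≡a) (subsetSpecialisation (∁ A) b ∣∁A∣≡b))))) ⟩
      q ^ e₀ * ((FA * FB) * ((T * T) * ((q ^ qExponent A * PA) * (q ^ qExponent (∁ A) * PB) * ((Hm * Hm) * (Hn * Hn)))))
        ≈⟨ solve 10 (λ e₀ ea eb hm hn pa pb fa fb t → e₀ :* ((fa :* fb) :* ((t :* t) :* ((ea :* pa) :* (eb :* pb) :* ((hm :* hm) :* (hn :* hn)))))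
                    := ((e₀ :* ea) :* eb) :* (((hm :* hm) :* (hn :* hn)) :* ((pa :* pb) :* ((fa :* fb) :* (t :* t))))) refl
             (q ^ e₀) (q ^ qExponent A) (q ^ qExponent (∁ A)) Hm Hn PA PB FA FB T ⟩
      ((q ^ e₀ * q ^ qExponent A) * q ^ qExponent (∁ A)) * core ∎
      where
      Ha = Hq R q a
      Hb = Hq R q b

open import Defs
open import Level using (Level)
open import Data.Nat using (ℕ; _+_; _*_; _<_; _∸_)
open import Data.Nat.Combinatorics using (_C_)
open import Data.Vec using (replicate; _++_)
open import Data.Fin.Subset using (Subset; inside; ∣_∣; _∩_; _∪_; ⊥; ⊤)
open import Algebra.Bundles using (CommutativeRing)
open import Relation.Binary.PropositionalEquality using (_≡_; refl)

lemma2p13 : ∀ {c ℓ : Level} (R : CommutativeRing c ℓ) (q : CommutativeRing.Carrier R)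
    (m n a b : ℕ) → 0 < m → 0 < n → 0 < a → 0 < b →
    (A B : Subset (a + b)) → A ∩ B ≡ ⊥ → A ∪ B ≡ ⊤ → ∣ A ∣ ≡ a → ∣ B ∣ ≡ b →
    let _·_ = CommutativeRing._*_ R
        _≈_ = CommutativeRing._≈_ R
        A′ = replicate m inside ++ A ++ replicate n inside
        B′ = replicate m inside ++ B ++ replicate n inside
        x = pow R q
    in ((schur R (lam A′) (m + n + a) x · schur R (lam B′) (m + n + b) x)
         · (Hq R q (m + n + a) · Hq R q (m + n + b)))
       ≈ (pow R q (a * b * n + (a + b) * ((n + 1) C 2))
         · (prodTo R (a + b) (λ i → (qPoch R (pow R q i) q m · qPoch R (pow R q (a + b ∸ i + 1)) q n))
         · (prodTo R n (λ j → (qPoch R (pow R q (a + b + j)) q m · qPoch R (pow R q (a + b + j)) q m))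
         · (((Hq R q a · Hq R q b) · ((Hq R q m · Hq R q m) · (Hq R q n · Hq R q n)))
         · (schur R (lam A) a x · schur R (lam B) b x)))))
lemma2p13 R q m n a b _ _ _ _ A B A∩B≡⊥ A∪B≡⊤ ∣A∣≡a ∣B∣≡b with Subsets.complement-unique A B A∩B≡⊥ A∪B≡⊤
... | refl = trans (lhs-factorisation q m n a b A ∣A∣≡a ∣B∣≡b) (sym (rhs-factorisation q m n a b A ∣A∣≡a ∣B∣≡b))
  where
  open CommutativeRing R using (trans; sym)
  open ComplementaryPadding R
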